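{- Let $a,b,c,d,q\in\mathbb{C}$ with $|q|<1$ and let $s\in\mathbb{C}$ be generic; write $s=q^{ -\lambda}$. Let $f(x;s)=x^{ -\lambda}\sum_{n\ge0}c_nx^n$ with $c_0=1$ be the unique formal series satisfying $$Df(x;s)=\Big(s+\frac{abcd}{qs}-1-\frac{abcd}{q}\Big)f(x;s),$$ where $D$ is the Askey–Wilson operator described in the context. Then $$f(x;s)=x^{ -\lambda}\frac{(ax;q)_\infty}{(qx/a;q)_\infty}\sum_{n\ge0}\frac{(qs^2/a^2;q)_n}{(q;q)_n}\Big(\frac{ax}{s}\Big)^n\,{}_6\phi_5\!\left[{q^{ -n},\,q^{n+1}s^2/a^2,\,s,\,qs/ab,\,qs/ac,\,qs/ad\atop q^2s^2/abcd,\,q^{1/2}s/a,\,-q^{1/2}s/a,\,qs/a,\,-qs/a};q,q\right],$$ where $(ax;q)_\infty/(qx/a;q)_\infty$ is expanded as a formal power series in $x$.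
   Context: Notation: $(a_1,\dots,a_k;q)_n=\prod_{j=1}^k\prod_{i=0}^{n-1}(1-q^ia_j)$ (also for $n=\infty$), and ${}_{r+1}\phi_r\left[{a_1,\dots,a_{r+1}\atop b_1,\dots,b_r};q,z\right]=\sum_{m\ge0}\frac{(a_1,\dots,a_{r+1};q)_m}{(q,b_1,\dots,b_r;q)_m}z^m$. The Askey–Wilson $q$-difference operator is $$D=\frac{(1-ax)(1-bx)(1-cx)(1-dx)}{(1-x^2)(1-qx^2)}(T_{q,x}-1)+\frac{(1-a/x)(1-b/x)(1-c/x)(1-d/x)}{(1-1/x^2)(1-q/x^2)}(T_{q,x}^{ -1}-1),$$ where $T_{q,x}^{\pm1}g(x)=g(q^{\pm1}x)$; on formal series one uses $T_{q,x}x^{ -\lambda+n}=sq^nx^{ -\lambda+n}$. The eigenvalue equation together with $c_0=1$ determines the coefficients $c_n$ uniquely as rational functions of $a,b,c,d,q,s$. -}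

module Defs where

open import Level using (Level; _⊔_) renaming (suc to lsuc)
open import Algebra.Bundles using (CommutativeRing)
open import Data.Nat using (ℕ; zero; suc) renaming (_+_ to _+ℕ_; _∸_ to _∸ℕ_)
open import Data.Product using (_×_)
open import Relation.Nullary using (¬_)

-- Fields.  agda-stdlib has no Field bundle, so we define one:
-- a commutative ring with 0 ≠ 1 and a (total) inverse operation that is
-- a genuine inverse on every nonzero element (the value of 0⁻¹ is junk
-- and is never relevant below, because all denominators are assumed
-- nonzero).  x / y := x * y⁻¹.

record Field (c ℓ : Level) : Set (lsuc (c ⊔ ℓ)) where
  field
    commutativeRing : CommutativeRing c ℓ
  open CommutativeRing commutativeRing public
  infix 8 _⁻¹
  field
    _⁻¹       : Carrier → Carrier
    ⁻¹-inverse : ∀ x → ¬ (x ≈ 0#) → x * (x ⁻¹) ≈ 1#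
    0≉1       : ¬ (0# ≈ 1#)

  infixl 7 _/_
  _/_ : Carrier → Carrier → Carrier
  x / y = x * (y ⁻¹)

tri : ℕ → ℕ
tri zero    = 0
tri (suc k) = tri k +ℕ k

module _ {ℓ₁ ℓ₂ : Level} (F : Field ℓ₁ ℓ₂) where
  open Field F

  infixr 8 _^_
  _^_ : Carrier → ℕ → Carrier
  x ^ zero  = 1#
  x ^ suc n = x * (x ^ n)

  sumBelow : ℕ → (ℕ → Carrier) → Carrier
  sumBelow zero    f = 0#
  sumBelow (suc n) f = sumBelow n f + f n

  prodBelow : ℕ → (ℕ → Carrier) → Carrier
  prodBelow zero    f = 1#
  prodBelow (suc n) f = prodBelow n f * f n

  poch : Carrier → Carrier → ℕ → Carrier
  poch u q n = prodBelow n (λ i → 1# - (q ^ i) * u)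

  Series : Set ℓ₁
  Series = ℕ → Carrier

  infixl 7 _⊛_
  _⊛_ : Series → Series → Series
  (f ⊛ g) n = sumBelow (suc n) (λ k → f k * g (n ∸ℕ k))

  infixl 6 _⊕_ _⊖_
  _⊕_ : Series → Series → Series
  (f ⊕ g) n = f n + g n

  _⊖_ : Series → Series → Series
  (f ⊖ g) n = f n - g n

  oneMinus : Carrier → Series
  oneMinus u zero          = 1#
  oneMinus u (suc zero)    = - u
  oneMinus u (suc (suc _)) = 0#

  minusX : Carrier → Series
  minusX u zero          = u
  minusX u (suc zero)    = - 1#
  minusX u (suc (suc _)) = 0#

  -- 1/(1 - u x²) = Σ_k u^k x^{2k}
  geom2 : Carrier → Series
  geom2 u zero          = 1#
  geom2 u (suc zero)    = 0#
  geom2 u (suc (suc n)) = u * geom2 u n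

  -- The Askey–Wilson operator acting on x^{-λ} Σ g_n x^n  (s = q^{-λ}),
  -- represented by the coefficient sequence g.  T x^{-λ+n} = s q^n x^{-λ+n}.

  Tq : Carrier → Carrier → Series → Series
  Tq q s g n = s * (q ^ n) * g n

  Tq⁻¹ : Carrier → Carrier → Series → Series
  Tq⁻¹ q s g n = (s * (q ^ n)) ⁻¹ * g n

  -- (1-ax)(1-bx)(1-cx)(1-dx) / ((1-x²)(1-qx²))  as a power series in x
  coefA : (a b c d q : Carrier) → Series
  coefA a b c d q =
    oneMinus a ⊛ oneMinus b ⊛ oneMinus c ⊛ oneMinus d ⊛ geom2 1# ⊛ geom2 q

  -- (1-a/x)(1-b/x)(1-c/x)(1-d/x) / ((1-1/x²)(1-q/x²))
  --   = (a-x)(b-x)(c-x)(d-x) / ((1-x²)(q-x²))   as a power series in x,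
  -- using 1/(q-x²) = q⁻¹ · 1/(1 - q⁻¹ x²).
  coefB : (a b c d q : Carrier) → Series
  coefB a b c d q =
    minusX a ⊛ minusX b ⊛ minusX c ⊛ minusX d ⊛ geom2 1#
      ⊛ (λ n → q ⁻¹ * geom2 (q ⁻¹) n)

  AWop : (a b c d q s : Carrier) → Series → Series
  AWop a b c d q s g =
    coefA a b c d q ⊛ (Tq q s g ⊖ g) ⊕ coefB a b c d q ⊛ (Tq⁻¹ q s g ⊖ g)

  eigenvalue : (a b c d q s : Carrier) → Carrier
  eigenvalue a b c d q s =
    s + (a * b * c * d) / (q * s) - 1# - (a * b * c * d) / q

  IsEigen : (a b c d q s : Carrier) → Series → Set ℓ₂
  IsEigen a b c d q s g =
    ∀ n → AWop a b c d q s g n ≈ eigenvalue a b c d q s * g n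

  -- Right-hand side.  r plays the role of q^{1/2}.

  -- coefficient of x^k in (ax;q)_∞  (Euler):  (-1)^k q^{k(k-1)/2} a^k/(q;q)_k
  infProdNum : (a q : Carrier) → Series
  infProdNum a q k = ((- 1#) ^ k) * (q ^ tri k) * (a ^ k) / poch q q k

  -- coefficient of x^k in 1/(qx/a;q)_∞  (Euler):  (q/a)^k/(q;q)_k
  infProdDen : (a q : Carrier) → Series
  infProdDen a q k = ((q / a) ^ k) / poch q q k

  -- terminating 6φ5 [q^{-n}, q^{n+1}s²/a², s, qs/ab, qs/ac, qs/ad ;
  --                  q²s²/abcd, r s/a, -r s/a, qs/a, -qs/a ; q, q]
  -- (terms with m > n vanish because (q^{-n};q)_m = 0)
  phi65 : (a b c d q s r : Carrier) → ℕ → Carrier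
  phi65 a b c d q s r n = sumBelow (suc n) term
    where
    term : ℕ → Carrier
    term m =
      (poch ((q ⁻¹) ^ n) q m * poch ((q ^ suc n) * s * s / (a * a)) q m
        * poch s q m * poch (q * s / (a * b)) q m
        * poch (q * s / (a * c)) q m * poch (q * s / (a * d)) q m)
      / (poch q q m * poch (q * q * s * s / (a * b * c * d)) q m
        * poch (r * s / a) q m * poch (- (r * s / a)) q m
        * poch (q * s / a) q m * poch (- (q * s / a)) q m)
      * (q ^ m)

  innerSeries : (a b c d q s r : Carrier) → Series
  innerSeries a b c d q s r n =
    poch (q * s * s / (a * a)) q n / poch q q n * ((a / s) ^ n)
      * phi65 a b c d q s r n

  rhs : (a b c d q s r : Carrier) → Series
  rhs a b c d q s r =
    infProdNum a q ⊛ infProdDen a q ⊛ innerSeries a b c d q s r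

  -- Genericity: all denominators occurring are nonzero.
  -- (The condition on q²s²/abcd also guarantees that the recursion for
  --  the c_n has nonzero leading coefficient (q^n-1)(s - abcd q^{-n-1}/s),
  --  n ≥ 1, i.e. that the eigen-solution with c_0 = 1 is unique.)
  Generic : (a b c d q s r : Carrier) → Set ℓ₂
  Generic a b c d q s r =
    ¬ (q ≈ 0#) × ¬ (s ≈ 0#) × ¬ (a ≈ 0#) × ¬ (b ≈ 0#) × ¬ (c ≈ 0#) × ¬ (d ≈ 0#)
    × (∀ k → ¬ (q ^ suc k ≈ 1#))
    × (∀ k → ¬ (1# - (q ^ k) * (q * q * s * s / (a * b * c * d)) ≈ 0#))
    × (∀ k → ¬ (1# - (q ^ k) * (r * s / a) ≈ 0#))
    × (∀ k → ¬ (1# - (q ^ k) * (- (r * s / a)) ≈ 0#))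
    × (∀ k → ¬ (1# - (q ^ k) * (q * s / a) ≈ 0#))
    × (∀ k → ¬ (1# - (q ^ k) * (- (q * s / a)) ≈ 0#))

-- Write φ t = (ax;q)_∞/(qx/a;q)_∞ · Σₖ (qt²/a²;q)ₖ/(q;q)ₖ (ax/t)ᵏ. With the Askey–Wilson
-- operator D_t taken at s = t, these functions satisfy the contiguity relation
--   D_t φ t = ev t · φ t + ν t · x φ (q t),
-- proved by clearing all denominators with a polynomial in x and comparing coefficients.
-- Expanding the ₆φ₅ rewrites the claimed series as Σₘ C m xᵐ φ (s qᵐ), where
-- C (m + 1) (ev s - ev (s q^{m+1})) = C m ν (s qᵐ). Since D_s (xᵐ f) = xᵐ D_{s qᵐ} f, applying
-- D_s to this sum telescopes to ev s times the sum. Uniqueness holds because for generic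
-- parameters the eigenvalue equation determines each coefficient from the previous ones.
module Submission where

open import Algebra.Bundles using (CommutativeRing)
open import Algebra.Solver.Ring.AlmostCommutativeRing using (fromCommutativeRing; _-Raw-AlmostCommutative⟶_)
open import Data.Fin.Base using () renaming (zero to #0; suc to 1+)
open import Data.Integer.Base as ℤ using (ℤ; +_; -[1+_])
import Data.Integer.Properties as ℤ
open import Data.List.Base using (List; []; _∷_)
open import Data.List.Relation.Unary.All using (All; []; _∷_)
open import Data.Maybe.Base using (Maybe; just; nothing)
open import Data.Nat.Base as ℕ using (ℕ; zero; suc; _∸_; _<_; _≤_; z≤n; s≤s)
open import Data.Nat.Induction using (<-rec)
import Data.Nat.Properties as ℕ
open import Data.Product.Base using (_×_; _,_)
open import Data.Sign.Base as Sign using (Sign)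
open import Data.Sum.Base using (inj₁; inj₂)
open import Data.Vec.Base using (Vec; []; _∷_)
open import Function.Base using (_$_; _⟨_⟩_)
open import Level using (Level)
open import Relation.Binary.PropositionalEquality.Core as ≡ using (_≡_)
open import Relation.Nullary.Decidable.Core using (yes; no)
open import Relation.Nullary.Negation.Core using (contradiction)
import Defs
open Defs using (Field; Generic; IsEigen; rhs)

-- The standard library instantiates the ring solver over an arbitrary commutative
-- (semi)ring only with ℕ coefficients, which cannot cancel x - x; this is the
-- instantiation with ℤ coefficients.
module RingSolverℤ {c ℓ} (R : CommutativeRing c ℓ) where
  open CommutativeRing R
  open import Data.Integer.Base using (_⊖_; sign; ∣_∣; _◃_)
  open import Algebra.Properties.Ring ring using (-‿involutive; -‿distribˡ-*; -‿distribʳ-*; -‿+-comm; -0#≈0#)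
  open import Algebra.Properties.Semiring.Mult.TCOptimised semiring using (×-homo-+; ×1-homo-*; 1+×) renaming (_×_ to _×′_)
  open import Relation.Binary.Reasoning.Setoid setoid

  fromℤ : ℤ → Carrier
  fromℤ (+ n)    = n ×′ 1#
  fromℤ -[1+ n ] = - (suc n ×′ 1#)

  private
    signed : Sign → Carrier → Carrier
    signed Sign.+ x = x
    signed Sign.- x = - x

    signed-cong : ∀ σ {x y} → x ≈ y → signed σ x ≈ signed σ y
    signed-cong Sign.+ x≈y = x≈y
    signed-cong Sign.- x≈y = -‿cong x≈y

    signed-* : ∀ σ τ x y → signed σ x * signed τ y ≈ signed (σ Sign.* τ) (x * y)
    signed-* Sign.+ Sign.+ x y = refl
    signed-* Sign.+ Sign.- x y = sym (-‿distribʳ-* x y)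
    signed-* Sign.- Sign.+ x y = sym (-‿distribˡ-* x y)
    signed-* Sign.- Sign.- x y = begin
      - x * - y     ≈⟨ -‿distribˡ-* x (- y) ⟨
      - (x * - y)   ≈⟨ -‿cong (-‿distribʳ-* x y) ⟨
      - - (x * y)   ≈⟨ -‿involutive (x * y) ⟩
      x * y         ∎

    fromℤ-◃ : ∀ σ n → fromℤ (σ ◃ n) ≈ signed σ (n ×′ 1#)
    fromℤ-◃ Sign.+ zero    = refl
    fromℤ-◃ Sign.- zero    = sym -0#≈0#
    fromℤ-◃ Sign.+ (suc n) = refl
    fromℤ-◃ Sign.- (suc n) = refl

    fromℤ-signAbs : ∀ i → fromℤ i ≈ signed (sign i) (∣ i ∣ ×′ 1#)
    fromℤ-signAbs (+ n)    = refl
    fromℤ-signAbs -[1+ n ] = refl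

    fromℤ-⊖ : ∀ m n → fromℤ (m ⊖ n) ≈ m ×′ 1# - n ×′ 1#
    fromℤ-⊖ zero    zero    = sym (-‿inverseʳ 0#)
    fromℤ-⊖ (suc m) zero    = sym (trans (+-congˡ -0#≈0#) (+-identityʳ _))
    fromℤ-⊖ zero    (suc n) = sym (+-identityˡ _)
    fromℤ-⊖ (suc m) (suc n) = begin
      fromℤ (suc m ⊖ suc n)            ≡⟨ ≡.cong fromℤ (ℤ.[1+m]⊖[1+n]≡m⊖n m n) ⟩
      fromℤ (m ⊖ n)                    ≈⟨ fromℤ-⊖ m n ⟩
      m ×′ 1# - n ×′ 1#                ≈⟨ [1+x]-[1+y]≈x-y (m ×′ 1#) (n ×′ 1#) ⟨
      (1# + m ×′ 1#) - (1# + n ×′ 1#)  ≈⟨ +-cong (1+× m 1#) (-‿cong (1+× n 1#)) ⟨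
      suc m ×′ 1# - suc n ×′ 1#        ∎
      where
      [1+x]-[1+y]≈x-y : ∀ x y → (1# + x) - (1# + y) ≈ x - y
      [1+x]-[1+y]≈x-y x y = begin
        (1# + x) + - (1# + y)     ≈⟨ +-congˡ (-‿+-comm 1# y) ⟨
        (1# + x) + (- 1# + - y)   ≈⟨ +-congʳ (+-comm 1# x) ⟩
        (x + 1#) + (- 1# + - y)   ≈⟨ +-assoc x 1# _ ⟩
        x + (1# + (- 1# + - y))   ≈⟨ +-congˡ (+-assoc 1# (- 1#) (- y)) ⟨
        x + ((1# + - 1#) + - y)   ≈⟨ +-congˡ (+-congʳ (-‿inverseʳ 1#)) ⟩
        x + (0# + - y)            ≈⟨ +-congˡ (+-identityˡ (- y)) ⟩
        x + - y                   ∎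

  fromℤ-+ : ∀ i j → fromℤ (i ℤ.+ j) ≈ fromℤ i + fromℤ j
  fromℤ-+ (+ m)    (+ n)    = ×-homo-+ 1# m n
  fromℤ-+ (+ m)    -[1+ n ] = fromℤ-⊖ m (suc n)
  fromℤ-+ -[1+ m ] (+ n)    = trans (fromℤ-⊖ n (suc m)) (+-comm _ _)
  fromℤ-+ -[1+ m ] -[1+ n ] = begin
    - (suc (suc (m ℕ.+ n)) ×′ 1#)      ≡⟨ ≡.cong (λ k → - (suc k ×′ 1#)) (ℕ.+-suc m n) ⟨
    - ((suc m ℕ.+ suc n) ×′ 1#)        ≈⟨ -‿cong (×-homo-+ 1# (suc m) (suc n)) ⟩
    - (suc m ×′ 1# + suc n ×′ 1#)      ≈⟨ -‿+-comm _ _ ⟨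
    - (suc m ×′ 1#) + - (suc n ×′ 1#)  ∎

  fromℤ-* : ∀ i j → fromℤ (i ℤ.* j) ≈ fromℤ i * fromℤ j
  fromℤ-* i j = begin
    fromℤ (i ℤ.* j)
      ≈⟨ fromℤ-◃ σ (∣ i ∣ ℕ.* ∣ j ∣) ⟩
    signed σ ((∣ i ∣ ℕ.* ∣ j ∣) ×′ 1#)
      ≈⟨ signed-cong σ (×1-homo-* ∣ i ∣ ∣ j ∣) ⟩
    signed σ ((∣ i ∣ ×′ 1#) * (∣ j ∣ ×′ 1#))
      ≈⟨ signed-* (sign i) (sign j) _ _ ⟨
    signed (sign i) (∣ i ∣ ×′ 1#) * signed (sign j) (∣ j ∣ ×′ 1#)
      ≈⟨ *-cong (fromℤ-signAbs i) (fromℤ-signAbs j) ⟨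
    fromℤ i * fromℤ j ∎
    where σ = sign i Sign.* sign j

  fromℤ-neg : ∀ i → fromℤ (ℤ.- i) ≈ - fromℤ i
  fromℤ-neg (+ zero)  = sym -0#≈0#
  fromℤ-neg (+ suc n) = refl
  fromℤ-neg -[1+ n ]  = sym (-‿involutive _)

  fromℤ-homomorphism : ℤ.+-*-rawRing -Raw-AlmostCommutative⟶ fromCommutativeRing R
  fromℤ-homomorphism = record
    { ⟦_⟧ = fromℤ ; +-homo = fromℤ-+ ; *-homo = fromℤ-* ; -‿homo = fromℤ-neg
    ; 0-homo = refl ; 1-homo = refl }

  fromℤ-≟ : ∀ i j → Maybe (fromℤ i ≈ fromℤ j)
  fromℤ-≟ i j with i ℤ.≟ j
  ... | yes ≡.refl = just refl
  ... | no _       = nothing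

  open import Algebra.Solver.Ring ℤ.+-*-rawRing (fromCommutativeRing R) fromℤ-homomorphism fromℤ-≟ public

module FieldProperties {ℓ₁ ℓ₂ : Level} (F : Field ℓ₁ ℓ₂) where
  open Field F hiding (zero) public
  open RingSolverℤ commutativeRing public
  open import Relation.Binary.Reasoning.Setoid setoid public

  infixr 8 _^_
  _^_ : Carrier → ℕ → Carrier
  _^_ = Defs._^_ F

  Σ< Π< : ℕ → (ℕ → Carrier) → Carrier
  Σ< = Defs.sumBelow F
  Π< = Defs.prodBelow F

  1≉0 : 1# ≉ 0#
  1≉0 1≈0 = 0≉1 (sym 1≈0)

  ≉0-resp-≈ : ∀ {x y} → x ≈ y → x ≉ 0# → y ≉ 0#
  ≉0-resp-≈ x≈y x≉0 y≈0 = x≉0 (trans x≈y y≈0)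

  ⁻¹-inverseʳ : ∀ {x} → x ≉ 0# → x * x ⁻¹ ≈ 1#
  ⁻¹-inverseʳ {x} = ⁻¹-inverse x

  ⁻¹-inverseˡ : ∀ {x} → x ≉ 0# → x ⁻¹ * x ≈ 1#
  ⁻¹-inverseˡ x≉0 = trans (*-comm _ _) (⁻¹-inverseʳ x≉0)

  *-cancelˡ : ∀ {z x y} → z ≉ 0# → z * x ≈ z * y → x ≈ y
  *-cancelˡ {z} {x} {y} z≉0 zx≈zy = begin
    x                ≈⟨ *-identityˡ x ⟨
    1# * x           ≈⟨ *-congʳ (⁻¹-inverseˡ z≉0) ⟨
    (z ⁻¹ * z) * x   ≈⟨ *-assoc _ _ _ ⟩
    z ⁻¹ * (z * x)   ≈⟨ *-congˡ zx≈zy ⟩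
    z ⁻¹ * (z * y)   ≈⟨ *-assoc _ _ _ ⟨
    (z ⁻¹ * z) * y   ≈⟨ *-congʳ (⁻¹-inverseˡ z≉0) ⟩
    1# * y           ≈⟨ *-identityˡ y ⟩
    y                ∎

  x*y≈0⇒y≈0 : ∀ {x y} → x ≉ 0# → x * y ≈ 0# → y ≈ 0#
  x*y≈0⇒y≈0 {x} x≉0 xy≈0 = *-cancelˡ x≉0 (trans xy≈0 (sym (zeroʳ x)))

  *-≉0 : ∀ {x y} → x ≉ 0# → y ≉ 0# → x * y ≉ 0#
  *-≉0 x≉0 y≉0 xy≈0 = y≉0 (x*y≈0⇒y≈0 x≉0 xy≈0)

  ⁻¹-unique : ∀ {x y} → x ≉ 0# → x * y ≈ 1# → y ≈ x ⁻¹
  ⁻¹-unique x≉0 xy≈1 = *-cancelˡ x≉0 (trans xy≈1 (sym (⁻¹-inverseʳ x≉0)))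

  ⁻¹-cong : ∀ {x y} → x ≉ 0# → x ≈ y → x ⁻¹ ≈ y ⁻¹
  ⁻¹-cong x≉0 x≈y = sym $ ⁻¹-unique x≉0 $ trans (*-congʳ x≈y) (⁻¹-inverseʳ (≉0-resp-≈ x≈y x≉0))

  ⁻¹-distrib-* : ∀ {x y} → x ≉ 0# → y ≉ 0# → (x * y) ⁻¹ ≈ x ⁻¹ * y ⁻¹
  ⁻¹-distrib-* {x} {y} x≉0 y≉0 = sym (⁻¹-unique (*-≉0 x≉0 y≉0) (begin
    (x * y) * (x ⁻¹ * y ⁻¹)
      ≈⟨ solve 4 (λ x y x′ y′ → (x :* y) :* (x′ :* y′) := (x :* x′) :* (y :* y′)) refl x y (x ⁻¹) (y ⁻¹) ⟩
    (x * x ⁻¹) * (y * y ⁻¹)  ≈⟨ *-cong (⁻¹-inverseʳ x≉0) (⁻¹-inverseʳ y≉0) ⟩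
    1# * 1#                  ≈⟨ *-identityˡ 1# ⟩
    1#                       ∎))

  1⁻¹≈1 : 1# ⁻¹ ≈ 1#
  1⁻¹≈1 = sym (⁻¹-unique 1≉0 (*-identityˡ 1#))

  x≈y*[z*z⁻¹]⇒x≈y : ∀ {x y z} → z ≉ 0# → x ≈ y * (z * z ⁻¹) → x ≈ y
  x≈y*[z*z⁻¹]⇒x≈y {y = y} z≉0 x≈y*1 = trans x≈y*1 (trans (*-congˡ (⁻¹-inverseʳ z≉0)) (*-identityʳ y))

  x-y≈0⇒x≈y : ∀ {x y} → x - y ≈ 0# → x ≈ y
  x-y≈0⇒x≈y {x} {y} x-y≈0 = begin
    x             ≈⟨ solve 2 (λ x y → x := (x :- y) :+ y) refl x y ⟩
    (x - y) + y   ≈⟨ +-congʳ x-y≈0 ⟩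
    0# + y        ≈⟨ +-identityˡ y ⟩
    y             ∎

  x≈y⇒x-y≈0 : ∀ {x y} → x ≈ y → x - y ≈ 0#
  x≈y⇒x-y≈0 {y = y} x≈y = trans (+-congʳ x≈y) (-‿inverseʳ y)

  -- Identities that hold only modulo hypotheses y ≈ z are proved by asking the
  -- solver for  lhs = rhs + Σ cᵢ (yᵢ - zᵢ)  and then discarding each summand.
  x+c*[y-z]≈x : ∀ {y z} x c → y ≈ z → x + c * (y - z) ≈ x
  x+c*[y-z]≈x x c y≈z = trans (+-congˡ (trans (*-congˡ (x≈y⇒x-y≈0 y≈z)) (zeroʳ c))) (+-identityʳ x)

  ^-cong : ∀ {x y} n → x ≈ y → x ^ n ≈ y ^ n
  ^-cong zero    x≈y = refl
  ^-cong (suc n) x≈y = *-cong x≈y (^-cong n x≈y)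

  ^-≉0 : ∀ {x} n → x ≉ 0# → x ^ n ≉ 0#
  ^-≉0 zero    x≉0 = 1≉0
  ^-≉0 (suc n) x≉0 = *-≉0 x≉0 (^-≉0 n x≉0)

  ^-distribˡ-+-* : ∀ x m n → x ^ (m ℕ.+ n) ≈ x ^ m * x ^ n
  ^-distribˡ-+-* x zero    n = sym (*-identityˡ _)
  ^-distribˡ-+-* x (suc m) n = trans (*-congˡ (^-distribˡ-+-* x m n)) (sym (*-assoc _ _ _))

  ^-distribʳ-* : ∀ x y n → (x * y) ^ n ≈ x ^ n * y ^ n
  ^-distribʳ-* x y zero    = sym (*-identityˡ 1#)
  ^-distribʳ-* x y (suc n) = trans (*-congˡ (^-distribʳ-* x y n))
    (solve 4 (λ x y xⁿ yⁿ → (x :* y) :* (xⁿ :* yⁿ) := (x :* xⁿ) :* (y :* yⁿ)) refl x y (x ^ n) (y ^ n))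

  1^n≈1 : ∀ n → 1# ^ n ≈ 1#
  1^n≈1 zero    = refl
  1^n≈1 (suc n) = trans (*-identityˡ _) (1^n≈1 n)

  x^n*x⁻¹^n≈1 : ∀ {x} n → x ≉ 0# → x ^ n * (x ⁻¹) ^ n ≈ 1#
  x^n*x⁻¹^n≈1 {x} n x≉0 = begin
    x ^ n * (x ⁻¹) ^ n  ≈⟨ ^-distribʳ-* x (x ⁻¹) n ⟨
    (x * x ⁻¹) ^ n      ≈⟨ ^-cong n (⁻¹-inverseʳ x≉0) ⟩
    1# ^ n              ≈⟨ 1^n≈1 n ⟩
    1#                  ∎

  ^-⁻¹ : ∀ {x} n → x ≉ 0# → (x ^ n) ⁻¹ ≈ (x ⁻¹) ^ n
  ^-⁻¹ n x≉0 = sym (⁻¹-unique (^-≉0 n x≉0) (x^n*x⁻¹^n≈1 n x≉0))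

  Σ<-cong : ∀ n {f g : ℕ → Carrier} → (∀ k → f k ≈ g k) → Σ< n f ≈ Σ< n g
  Σ<-cong zero    f≈g = refl
  Σ<-cong (suc n) f≈g = +-cong (Σ<-cong n f≈g) (f≈g n)

  Σ<-cong-< : ∀ n {f g : ℕ → Carrier} → (∀ k → k < n → f k ≈ g k) → Σ< n f ≈ Σ< n g
  Σ<-cong-< zero    f≈g = refl
  Σ<-cong-< (suc n) f≈g = +-cong (Σ<-cong-< n (λ k k<n → f≈g k (ℕ.m<n⇒m<1+n k<n))) (f≈g n ℕ.≤-refl)

  Σ<-zero : ∀ n {f : ℕ → Carrier} → (∀ k → k < n → f k ≈ 0#) → Σ< n f ≈ 0#
  Σ<-zero zero    f≈0 = refl
  Σ<-zero (suc n) f≈0 =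
    trans (+-cong (Σ<-zero n (λ k k<n → f≈0 k (ℕ.m<n⇒m<1+n k<n))) (f≈0 n ℕ.≤-refl)) (+-identityʳ 0#)

  Σ<-distrib-+ : ∀ n (f g : ℕ → Carrier) → Σ< n (λ k → f k + g k) ≈ Σ< n f + Σ< n g
  Σ<-distrib-+ zero    f g = sym (+-identityʳ 0#)
  Σ<-distrib-+ (suc n) f g = trans (+-congʳ (Σ<-distrib-+ n f g))
    (solve 4 (λ a b c d → (a :+ b) :+ (c :+ d) := (a :+ c) :+ (b :+ d)) refl (Σ< n f) (Σ< n g) (f n) (g n))

  Σ<-distrib-sub : ∀ n (f g : ℕ → Carrier) → Σ< n (λ k → f k - g k) ≈ Σ< n f - Σ< n g
  Σ<-distrib-sub zero    f g = sym (-‿inverseʳ 0#)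
  Σ<-distrib-sub (suc n) f g = trans (+-congʳ (Σ<-distrib-sub n f g))
    (solve 4 (λ a b c d → (a :- b) :+ (c :- d) := (a :+ c) :- (b :+ d)) refl (Σ< n f) (Σ< n g) (f n) (g n))

  *-distribˡ-Σ< : ∀ n c (f : ℕ → Carrier) → Σ< n (λ k → c * f k) ≈ c * Σ< n f
  *-distribˡ-Σ< zero    c f = sym (zeroʳ c)
  *-distribˡ-Σ< (suc n) c f = trans (+-congʳ (*-distribˡ-Σ< n c f)) (sym (distribˡ c _ _))

  Σ<-head : ∀ n (f : ℕ → Carrier) → Σ< (suc n) f ≈ f 0 + Σ< n (λ k → f (suc k))
  Σ<-head zero    f = trans (+-identityˡ _) (sym (+-identityʳ _))
  Σ<-head (suc n) f = trans (+-congʳ (Σ<-head n f)) (+-assoc _ _ _)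

  Σ<-reverse : ∀ n (f : ℕ → Carrier) → Σ< (suc n) f ≈ Σ< (suc n) (λ k → f (n ∸ k))
  Σ<-reverse zero    f = refl
  Σ<-reverse (suc n) f = begin
    Σ< (suc n) f + f (suc n)                     ≈⟨ +-comm _ _ ⟩
    f (suc n) + Σ< (suc n) f                     ≈⟨ +-congˡ (Σ<-reverse n f) ⟩
    f (suc n) + Σ< (suc n) (λ k → f (n ∸ k))     ≈⟨ Σ<-head (suc n) (λ k → f (suc n ∸ k)) ⟨
    Σ< (suc (suc n)) (λ k → f (suc n ∸ k))       ∎

  Σ<-swap : ∀ n m (f : ℕ → ℕ → Carrier) →
            Σ< n (λ i → Σ< m (λ j → f i j)) ≈ Σ< m (λ j → Σ< n (λ i → f i j))
  Σ<-swap zero    m f = sym (Σ<-zero m (λ _ _ → refl))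
  Σ<-swap (suc n) m f = begin
    Σ< n (λ i → Σ< m (f i)) + Σ< m (f n)             ≈⟨ +-congʳ (Σ<-swap n m f) ⟩
    Σ< m (λ j → Σ< n (λ i → f i j)) + Σ< m (f n)     ≈⟨ Σ<-distrib-+ m _ _ ⟨
    Σ< m (λ j → Σ< n (λ i → f i j) + f n j)          ∎

  Σ<-vanishing-tail : ∀ (f : ℕ → Carrier) i N → i < N → (∀ m → i < m → f m ≈ 0#) → Σ< N f ≈ Σ< (suc i) f
  Σ<-vanishing-tail f i (suc N) i<1+N f≈0 with ℕ.m≤n⇒m<n∨m≡n i<1+N
  ... | inj₁ i<N   = trans (+-cong (Σ<-vanishing-tail f i N (ℕ.≤-pred i<N) f≈0) (f≈0 N (ℕ.≤-pred i<N))) (+-identityʳ _)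
  ... | inj₂ ≡.refl = refl

  Π<-≉0 : ∀ n (f : ℕ → Carrier) → (∀ k → k < n → f k ≉ 0#) → Π< n f ≉ 0#
  Π<-≉0 zero    f f≉0 = 1≉0
  Π<-≉0 (suc n) f f≉0 = *-≉0 (Π<-≉0 n f (λ k k<n → f≉0 k (ℕ.m<n⇒m<1+n k<n))) (f≉0 n ℕ.≤-refl)

  Σ<-telescope : ∀ N (f : ℕ → Carrier) → Σ< N (λ m → f (suc m) - f m) ≈ f N - f 0
  Σ<-telescope zero    f = sym (-‿inverseʳ (f 0))
  Σ<-telescope (suc N) f = trans (+-congʳ (Σ<-telescope N f))
    (solve 3 (λ x y z → (y :- x) :+ (z :- y) := z :- x) refl (f 0) (f N) (f (suc N)))

  *-≈-by-cross-multiplication : ∀ {x y z w dx dy dz dw nx ny nz nw} →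
    dx ≉ 0# → dy ≉ 0# → dz ≉ 0# → dw ≉ 0# →
    x * dx ≈ nx → y * dy ≈ ny → z * dz ≈ nz → w * dw ≈ nw →
    nx * ny * (dz * dw) ≈ nz * nw * (dx * dy) → x * y ≈ z * w
  *-≈-by-cross-multiplication {x} {y} {z} {w} {dx} {dy} {dz} {dw} {nx} {ny} {nz} {nw}
                              dx≉0 dy≉0 dz≉0 dw≉0 x≈ y≈ z≈ w≈ cross = *-cancelˡ D≉0 (begin
    D * (x * y)
      ≈⟨ solve 6 (λ x y dx dy dz dw → dx :* dy :* (dz :* dw) :* (x :* y) := x :* dx :* (y :* dy) :* (dz :* dw))
          refl x y dx dy dz dw ⟩
    x * dx * (y * dy) * (dz * dw)
      ≈⟨ *-congʳ (*-cong x≈ y≈) ⟩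
    nx * ny * (dz * dw)
      ≈⟨ cross ⟩
    nz * nw * (dx * dy)
      ≈⟨ *-congʳ (*-cong z≈ w≈) ⟨
    z * dz * (w * dw) * (dx * dy)
      ≈⟨ solve 6 (λ z w dx dy dz dw → z :* dz :* (w :* dw) :* (dx :* dy) := dx :* dy :* (dz :* dw) :* (z :* w))
          refl z w dx dy dz dw ⟩
    D * (z * w) ∎)
    where
    D = dx * dy * (dz * dw)
    D≉0 : D ≉ 0#
    D≉0 = *-≉0 (*-≉0 dx≉0 dy≉0) (*-≉0 dz≉0 dw≉0)

module PowerSeries {ℓ₁ ℓ₂ : Level} (F : Field ℓ₁ ℓ₂) where
  open FieldProperties F public

  Series : Set ℓ₁
  Series = ℕ → Carrier

  infixl 7 _⊛_
  infixl 6 _⊕_ _⊖_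
  _⊛_ _⊕_ _⊖_ : Series → Series → Series
  _⊛_ = Defs._⊛_ F
  _⊕_ = Defs._⊕_ F
  _⊖_ = Defs._⊖_ F

  infix 4 _≋_
  _≋_ : Series → Series → Set ℓ₂
  f ≋ g = ∀ n → f n ≈ g n

  ≋-refl : ∀ {f} → f ≋ f
  ≋-refl n = refl

  ≋-sym : ∀ {f g} → f ≋ g → g ≋ f
  ≋-sym f≋g n = sym (f≋g n)

  ≋-trans : ∀ {f g h} → f ≋ g → g ≋ h → f ≋ h
  ≋-trans f≋g g≋h n = trans (f≋g n) (g≋h n)

  infixr 2 _≋⟨_⟩_
  infix 3 _≋∎
  _≋⟨_⟩_ : ∀ f {g h} → f ≋ g → g ≋ h → f ≋ h
  f ≋⟨ f≋g ⟩ g≋h = ≋-trans f≋g g≋h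

  _≋∎ : ∀ f → f ≋ f
  f ≋∎ = ≋-refl

  0ₛ 1ₛ : Series
  0ₛ _       = 0#
  1ₛ zero    = 1#
  1ₛ (suc n) = 0#

  shift tail : Series → Series
  shift f zero    = 0#
  shift f (suc n) = f n
  tail f n = f (suc n)

  shiftBy : ℕ → Series → Series
  shiftBy zero    f = f
  shiftBy (suc m) f = shift (shiftBy m f)

  infixr 7 _·_
  _·_ : Carrier → Series → Series
  (c · f) n = c * f n

  dilate : Carrier → Series → Series
  dilate u f n = u ^ n * f n

  ⊖≋0ₛ⇒≋ : ∀ {f g} → f ⊖ g ≋ 0ₛ → f ≋ g
  ⊖≋0ₛ⇒≋ f⊖g≋0 n = x-y≈0⇒x≈y (f⊖g≋0 n)

  ⊕-cong : ∀ {f f′ g g′} → f ≋ f′ → g ≋ g′ → f ⊕ g ≋ f′ ⊕ g′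
  ⊕-cong f≋f′ g≋g′ n = +-cong (f≋f′ n) (g≋g′ n)

  ⊖-cong : ∀ {f f′ g g′} → f ≋ f′ → g ≋ g′ → f ⊖ g ≋ f′ ⊖ g′
  ⊖-cong f≋f′ g≋g′ n = +-cong (f≋f′ n) (-‿cong (g≋g′ n))

  ·-cong : ∀ {c c′ f f′} → c ≈ c′ → f ≋ f′ → c · f ≋ c′ · f′
  ·-cong c≈c′ f≋f′ n = *-cong c≈c′ (f≋f′ n)

  ·-congˡ : ∀ {c f f′} → f ≋ f′ → c · f ≋ c · f′
  ·-congˡ = ·-cong refl

  shift-cong : ∀ {f g} → f ≋ g → shift f ≋ shift g
  shift-cong f≋g zero    = refl
  shift-cong f≋g (suc n) = f≋g n

  shift-0ₛ : shift 0ₛ ≋ 0ₛ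
  shift-0ₛ zero    = refl
  shift-0ₛ (suc n) = refl

  shiftBy-cong : ∀ m {f g} → f ≋ g → shiftBy m f ≋ shiftBy m g
  shiftBy-cong zero    f≋g = f≋g
  shiftBy-cong (suc m) f≋g = shift-cong (shiftBy-cong m f≋g)

  shiftBy-< : ∀ m f k → k < m → shiftBy m f k ≈ 0#
  shiftBy-< (suc m) f zero    _         = refl
  shiftBy-< (suc m) f (suc k) (s≤s k<m) = shiftBy-< m f k k<m

  shiftBy-+ : ∀ m f k → shiftBy m f (m ℕ.+ k) ≈ f k
  shiftBy-+ zero    f k = refl
  shiftBy-+ (suc m) f k = shiftBy-+ m f k

  ·-distrib-⊕ : ∀ c f g → c · (f ⊕ g) ≋ (c · f) ⊕ (c · g)
  ·-distrib-⊕ c f g n = distribˡ _ _ _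

  ·-distrib-⊖ : ∀ c f g → c · (f ⊖ g) ≋ (c · f) ⊖ (c · g)
  ·-distrib-⊖ c f g n = solve 3 (λ x y z → x :* (y :- z) := x :* y :- x :* z) refl _ _ _

  ·-assoc : ∀ c d f → c · (d · f) ≋ (c * d) · f
  ·-assoc c d f n = sym (*-assoc _ _ _)

  ·-shift : ∀ c f → c · shift f ≋ shift (c · f)
  ·-shift c f zero    = zeroʳ _
  ·-shift c f (suc n) = refl

  ·-cancelˡ : ∀ {c f g} → c ≉ 0# → c · f ≋ c · g → f ≋ g
  ·-cancelˡ c≉0 cf≋cg n = *-cancelˡ c≉0 (cf≋cg n)

  shift-⊕ : ∀ f g → shift f ⊕ shift g ≋ shift (f ⊕ g)
  shift-⊕ f g zero    = +-identityʳ 0#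
  shift-⊕ f g (suc n) = refl

  shiftBy-⊕ : ∀ m f g → shiftBy m (f ⊕ g) ≋ shiftBy m f ⊕ shiftBy m g
  shiftBy-⊕ zero    f g = ≋-refl
  shiftBy-⊕ (suc m) f g = ≋-trans (shift-cong (shiftBy-⊕ m f g)) (≋-sym (shift-⊕ (shiftBy m f) (shiftBy m g)))

  shiftBy-· : ∀ m c f → shiftBy m (c · f) ≋ c · shiftBy m f
  shiftBy-· zero    c f = ≋-refl
  shiftBy-· (suc m) c f = ≋-trans (shift-cong (shiftBy-· m c f)) (≋-sym (·-shift c (shiftBy m f)))

  shiftBy-shift : ∀ m f → shiftBy m (shift f) ≋ shift (shiftBy m f)
  shiftBy-shift zero    f = ≋-refl
  shiftBy-shift (suc m) f = shift-cong (shiftBy-shift m f)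

  dilate-shift : ∀ u f → dilate u (shift f) ≋ u · shift (dilate u f)
  dilate-shift u f zero    = trans (zeroʳ _) (sym (zeroʳ _))
  dilate-shift u f (suc n) = *-assoc _ _ _

  dilate-· : ∀ u c f → dilate u (c · f) ≋ c · dilate u f
  dilate-· u c f n = solve 3 (λ x y z → x :* (y :* z) := y :* (x :* z)) refl _ _ _

  dilate-⊕ : ∀ u f g → dilate u (f ⊕ g) ≋ dilate u f ⊕ dilate u g
  dilate-⊕ u f g n = distribˡ _ _ _

  dilate-⊖ : ∀ u f g → dilate u (f ⊖ g) ≋ dilate u f ⊖ dilate u g
  dilate-⊖ u f g n = solve 3 (λ x y z → x :* (y :- z) := x :* y :- x :* z) refl _ _ _

  ⊛-zeroth : ∀ f g → (f ⊛ g) 0 ≈ f 0 * g 0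
  ⊛-zeroth f g = +-identityˡ _

  ⊛-suc : ∀ f g n → (f ⊛ g) (suc n) ≈ f 0 * g (suc n) + (tail f ⊛ g) n
  ⊛-suc f g n = Σ<-head (suc n) (λ k → f k * g (suc n ∸ k))

  ⊛-cong : ∀ {f f′ g g′} → f ≋ f′ → g ≋ g′ → f ⊛ g ≋ f′ ⊛ g′
  ⊛-cong f≋f′ g≋g′ n = Σ<-cong (suc n) (λ k → *-cong (f≋f′ k) (g≋g′ (n ∸ k)))

  ⊛-congˡ : ∀ {f g g′} → g ≋ g′ → f ⊛ g ≋ f ⊛ g′
  ⊛-congˡ {f} = ⊛-cong (≋-refl {f})

  ⊛-congʳ : ∀ {f f′ g} → f ≋ f′ → f ⊛ g ≋ f′ ⊛ g
  ⊛-congʳ {g = g} f≋f′ = ⊛-cong f≋f′ (≋-refl {g})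

  ⊛-cong-≤ : ∀ f {g g′} n → (∀ k → k ≤ n → g k ≈ g′ k) → (f ⊛ g) n ≈ (f ⊛ g′) n
  ⊛-cong-≤ f n g≈g′ = Σ<-cong-< (suc n) (λ k _ → *-congˡ (g≈g′ (n ∸ k) (ℕ.m∸n≤m n k)))

  ⊛-vanishing-prefix : ∀ f g n → (∀ k → k < n → g k ≈ 0#) → (f ⊛ g) n ≈ f 0 * g n
  ⊛-vanishing-prefix f g zero    g≈0 = ⊛-zeroth f g
  ⊛-vanishing-prefix f g (suc n) g≈0 = begin
    (f ⊛ g) (suc n)                    ≈⟨ ⊛-suc f g n ⟩
    f 0 * g (suc n) + (tail f ⊛ g) n   ≈⟨ +-congˡ (⊛-cong-≤ (tail f) n (λ k k≤n → g≈0 k (s≤s k≤n))) ⟩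
    f 0 * g (suc n) + (tail f ⊛ 0ₛ) n  ≈⟨ +-congˡ (Σ<-zero (suc n) (λ k _ → zeroʳ _)) ⟩
    f 0 * g (suc n) + 0#               ≈⟨ +-identityʳ _ ⟩
    f 0 * g (suc n)                    ∎

  ⊛-comm : ∀ f g → f ⊛ g ≋ g ⊛ f
  ⊛-comm f g n = begin
    Σ< (suc n) (λ k → f k * g (n ∸ k))             ≈⟨ Σ<-reverse n (λ k → f k * g (n ∸ k)) ⟩
    Σ< (suc n) (λ k → f (n ∸ k) * g (n ∸ (n ∸ k))) ≈⟨ Σ<-cong-< (suc n) swap ⟩
    Σ< (suc n) (λ k → g k * f (n ∸ k))             ∎
    where
    swap : ∀ k → k < suc n → f (n ∸ k) * g (n ∸ (n ∸ k)) ≈ g k * f (n ∸ k)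
    swap k k<1+n = trans (*-comm _ _) (*-congʳ (reflexive (≡.cong g (ℕ.m∸[m∸n]≡n (ℕ.≤-pred k<1+n)))))

  ⊛-distribʳ-⊕ : ∀ f f′ g → (f ⊕ f′) ⊛ g ≋ (f ⊛ g) ⊕ (f′ ⊛ g)
  ⊛-distribʳ-⊕ f f′ g n = trans (Σ<-cong (suc n) (λ k → distribʳ _ _ _))
    (Σ<-distrib-+ (suc n) (λ k → f k * g (n ∸ k)) (λ k → f′ k * g (n ∸ k)))

  ⊛-distribˡ-⊕ : ∀ f g g′ → f ⊛ (g ⊕ g′) ≋ (f ⊛ g) ⊕ (f ⊛ g′)
  ⊛-distribˡ-⊕ f g g′ n = trans (Σ<-cong (suc n) (λ k → distribˡ _ _ _))
    (Σ<-distrib-+ (suc n) (λ k → f k * g (n ∸ k)) (λ k → f k * g′ (n ∸ k)))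

  ⊛-distribˡ-⊖ : ∀ f g g′ → f ⊛ (g ⊖ g′) ≋ (f ⊛ g) ⊖ (f ⊛ g′)
  ⊛-distribˡ-⊖ f g g′ n =
    trans (Σ<-cong (suc n) (λ k → solve 3 (λ x y z → x :* (y :- z) := x :* y :- x :* z) refl _ _ _))
          (Σ<-distrib-sub (suc n) (λ k → f k * g (n ∸ k)) (λ k → f k * g′ (n ∸ k)))

  ⊛-·ˡ : ∀ c f g → (c · f) ⊛ g ≋ c · (f ⊛ g)
  ⊛-·ˡ c f g n = trans (Σ<-cong (suc n) (λ k → *-assoc _ _ _)) (*-distribˡ-Σ< (suc n) c (λ k → f k * g (n ∸ k)))

  ⊛-·ʳ : ∀ c f g → f ⊛ (c · g) ≋ c · (f ⊛ g)
  ⊛-·ʳ c f g n = trans (Σ<-cong (suc n) (λ k → solve 3 (λ x y z → x :* (y :* z) := y :* (x :* z)) refl _ _ _))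
    (*-distribˡ-Σ< (suc n) c (λ k → f k * g (n ∸ k)))

  ⊛-shiftˡ : ∀ f g → shift f ⊛ g ≋ shift (f ⊛ g)
  ⊛-shiftˡ f g zero    = trans (⊛-zeroth (shift f) g) (zeroˡ _)
  ⊛-shiftˡ f g (suc n) = trans (⊛-suc (shift f) g n) (trans (+-congʳ (zeroˡ _)) (+-identityˡ _))

  ⊛-shiftʳ : ∀ f g → f ⊛ shift g ≋ shift (f ⊛ g)
  ⊛-shiftʳ f g = ≋-trans (⊛-comm f (shift g)) (≋-trans (⊛-shiftˡ g f) (shift-cong (⊛-comm g f)))

  ⊛-shiftByʳ : ∀ f m g → f ⊛ shiftBy m g ≋ shiftBy m (f ⊛ g)
  ⊛-shiftByʳ f zero    g = ≋-refl
  ⊛-shiftByʳ f (suc m) g = ≋-trans (⊛-shiftʳ f (shiftBy m g)) (shift-cong (⊛-shiftByʳ f m g))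

  ⊛-identityˡ : ∀ g → 1ₛ ⊛ g ≋ g
  ⊛-identityˡ g zero    = trans (⊛-zeroth 1ₛ g) (*-identityˡ _)
  ⊛-identityˡ g (suc n) = begin
    (1ₛ ⊛ g) (suc n)                    ≈⟨ ⊛-suc 1ₛ g n ⟩
    1# * g (suc n) + (tail 1ₛ ⊛ g) n    ≈⟨ +-cong (*-identityˡ _) (Σ<-zero (suc n) (λ k _ → zeroˡ _)) ⟩
    g (suc n) + 0#                      ≈⟨ +-identityʳ _ ⟩
    g (suc n)                           ∎

  ⊛-assoc : ∀ f g h → (f ⊛ g) ⊛ h ≋ f ⊛ (g ⊛ h)
  ⊛-assoc f g h zero = begin
    ((f ⊛ g) ⊛ h) 0        ≈⟨ ⊛-zeroth (f ⊛ g) h ⟩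
    (f ⊛ g) 0 * h 0        ≈⟨ *-congʳ (⊛-zeroth f g) ⟩
    (f 0 * g 0) * h 0      ≈⟨ *-assoc _ _ _ ⟩
    f 0 * (g 0 * h 0)      ≈⟨ *-congˡ (⊛-zeroth g h) ⟨
    f 0 * (g ⊛ h) 0        ≈⟨ ⊛-zeroth f (g ⊛ h) ⟨
    (f ⊛ (g ⊛ h)) 0        ∎
  ⊛-assoc f g h (suc n) = begin
    ((f ⊛ g) ⊛ h) (suc n)
      ≈⟨ ⊛-suc (f ⊛ g) h n ⟩
    (f ⊛ g) 0 * h (suc n) + (tail (f ⊛ g) ⊛ h) n
      ≈⟨ +-cong (*-congʳ (⊛-zeroth f g)) (⊛-congʳ {g = h} (⊛-suc f g) n) ⟩
    (f 0 * g 0) * h (suc n) + (((f 0 · tail g) ⊕ (tail f ⊛ g)) ⊛ h) n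
      ≈⟨ +-congˡ (⊛-distribʳ-⊕ (f 0 · tail g) (tail f ⊛ g) h n) ⟩
    (f 0 * g 0) * h (suc n) + (((f 0 · tail g) ⊛ h) n + ((tail f ⊛ g) ⊛ h) n)
      ≈⟨ +-congˡ (+-cong (⊛-·ˡ (f 0) (tail g) h n) (⊛-assoc (tail f) g h n)) ⟩
    (f 0 * g 0) * h (suc n) + (f 0 * (tail g ⊛ h) n + (tail f ⊛ (g ⊛ h)) n)
      ≈⟨ solve 5 (λ a b c d e → (a :* b) :* c :+ (a :* d :+ e) := a :* (b :* c :+ d) :+ e) refl _ _ _ _ _ ⟩
    f 0 * (g 0 * h (suc n) + (tail g ⊛ h) n) + (tail f ⊛ (g ⊛ h)) n
      ≈⟨ +-congʳ (*-congˡ (⊛-suc g h n)) ⟨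
    f 0 * (g ⊛ h) (suc n) + (tail f ⊛ (g ⊛ h)) n
      ≈⟨ ⊛-suc f (g ⊛ h) n ⟨
    (f ⊛ (g ⊛ h)) (suc n) ∎

  dilate-⊛ : ∀ u f g → dilate u (f ⊛ g) ≋ dilate u f ⊛ dilate u g
  dilate-⊛ u f g n = begin
    u ^ n * Σ< (suc n) (λ k → f k * g (n ∸ k))
      ≈⟨ *-distribˡ-Σ< (suc n) _ _ ⟨
    Σ< (suc n) (λ k → u ^ n * (f k * g (n ∸ k)))
      ≈⟨ Σ<-cong-< (suc n) (λ k k<1+n → split k (ℕ.≤-pred k<1+n)) ⟩
    Σ< (suc n) (λ k → (u ^ k * f k) * (u ^ (n ∸ k) * g (n ∸ k))) ∎
    where
    split : ∀ k → k ≤ n → u ^ n * (f k * g (n ∸ k)) ≈ (u ^ k * f k) * (u ^ (n ∸ k) * g (n ∸ k))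
    split k k≤n = begin
      u ^ n * (f k * g (n ∸ k))
        ≡⟨ ≡.cong (λ m → u ^ m * (f k * g (n ∸ k))) (ℕ.m+[n∸m]≡n k≤n) ⟨
      u ^ (k ℕ.+ (n ∸ k)) * (f k * g (n ∸ k))
        ≈⟨ *-congʳ (^-distribˡ-+-* u k (n ∸ k)) ⟩
      (u ^ k * u ^ (n ∸ k)) * (f k * g (n ∸ k))
        ≈⟨ solve 4 (λ a b c d → (a :* b) :* (c :* d) := (a :* c) :* (b :* d)) refl _ _ _ _ ⟩
      (u ^ k * f k) * (u ^ (n ∸ k) * g (n ∸ k)) ∎

  Σₛ : ℕ → (ℕ → Series) → Series
  Σₛ N g n = Σ< N (λ m → g m n)

  ⊛-Σₛ : ∀ f N g → f ⊛ Σₛ N g ≋ Σₛ N (λ m → f ⊛ g m)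
  ⊛-Σₛ f N g n = begin
    Σ< (suc n) (λ k → f k * Σ< N (λ m → g m (n ∸ k)))
      ≈⟨ Σ<-cong (suc n) (λ k → *-distribˡ-Σ< N _ (λ m → g m (n ∸ k))) ⟨
    Σ< (suc n) (λ k → Σ< N (λ m → f k * g m (n ∸ k)))
      ≈⟨ Σ<-swap (suc n) N (λ k m → f k * g m (n ∸ k)) ⟩
    Σ< N (λ m → Σ< (suc n) (λ k → f k * g m (n ∸ k))) ∎

  mulLinear : Carrier → Carrier → Series → Series
  mulLinear α β f = (α · f) ⊕ shift (β · f)

  mulLinear-cong : ∀ {α α′ β β′ f g} → α ≈ α′ → β ≈ β′ → f ≋ g → mulLinear α β f ≋ mulLinear α′ β′ g
  mulLinear-cong α≈α′ β≈β′ f≋g = ⊕-cong (·-cong α≈α′ f≋g) (shift-cong (·-cong β≈β′ f≋g))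

  mulLinear-congʳ : ∀ {α β f g} → f ≋ g → mulLinear α β f ≋ mulLinear α β g
  mulLinear-congʳ = mulLinear-cong refl refl

  mulLinear-⊛ˡ : ∀ α β f g → mulLinear α β (f ⊛ g) ≋ mulLinear α β f ⊛ g
  mulLinear-⊛ˡ α β f g =
    mulLinear α β (f ⊛ g)                  ≋⟨ ⊕-cong (≋-sym (⊛-·ˡ α f g)) (shift-cong (≋-sym (⊛-·ˡ β f g))) ⟩
    (α · f) ⊛ g ⊕ shift ((β · f) ⊛ g)      ≋⟨ ⊕-cong (≋-refl {(α · f) ⊛ g}) (≋-sym (⊛-shiftˡ (β · f) g)) ⟩
    (α · f) ⊛ g ⊕ shift (β · f) ⊛ g        ≋⟨ ≋-sym (⊛-distribʳ-⊕ (α · f) (shift (β · f)) g) ⟩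
    mulLinear α β f ⊛ g                    ≋∎

  mulLinear-⊛ʳ : ∀ α β f g → mulLinear α β (f ⊛ g) ≋ f ⊛ mulLinear α β g
  mulLinear-⊛ʳ α β f g =
    ≋-trans (mulLinear-congʳ (⊛-comm f g)) (≋-trans (mulLinear-⊛ˡ α β g f) (⊛-comm (mulLinear α β g) f))

  mulLinear-scale : ∀ c α β f → mulLinear (c * α) (c * β) f ≋ c · mulLinear α β f
  mulLinear-scale c α β f zero    =
    solve 3 (λ c a x → (c :* a) :* x :+ con (+ 0) := c :* (a :* x :+ con (+ 0))) refl c α (f 0)
  mulLinear-scale c α β f (suc n) =
    solve 5 (λ c a b x y → (c :* a) :* x :+ (c :* b) :* y := c :* (a :* x :+ b :* y)) refl c α β (f (suc n)) (f n)

  mulLinear-· : ∀ α β c f → mulLinear α β (c · f) ≋ c · mulLinear α β f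
  mulLinear-· α β c f zero    =
    solve 3 (λ c a x → a :* (c :* x) :+ con (+ 0) := c :* (a :* x :+ con (+ 0))) refl c α (f 0)
  mulLinear-· α β c f (suc n) =
    solve 5 (λ c a b x y → a :* (c :* x) :+ b :* (c :* y) := c :* (a :* x :+ b :* y)) refl c α β (f (suc n)) (f n)

  mulLinear-⊖ : ∀ α β f g → mulLinear α β (f ⊖ g) ≋ mulLinear α β f ⊖ mulLinear α β g
  mulLinear-⊖ α β f g zero    =
    solve 3 (λ a x y → a :* (x :- y) :+ con (+ 0) := (a :* x :+ con (+ 0)) :- (a :* y :+ con (+ 0))) refl α (f 0) (g 0)
  mulLinear-⊖ α β f g (suc n) =
    solve 6 (λ a b x y z w → a :* (x :- y) :+ b :* (z :- w) := (a :* x :+ b :* z) :- (a :* y :+ b :* w))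
      refl α β (f (suc n)) (g (suc n)) (f n) (g n)

  dilate-cong : ∀ {u v f g} → u ≈ v → f ≋ g → dilate u f ≋ dilate v g
  dilate-cong u≈v f≋g n = *-cong (^-cong n u≈v) (f≋g n)

  dilate-dilate : ∀ u v f → dilate u (dilate v f) ≋ dilate (u * v) f
  dilate-dilate u v f n = trans (sym (*-assoc _ _ _)) (*-congʳ (sym (^-distribʳ-* u v n)))

  dilate-1 : ∀ f → dilate 1# f ≋ f
  dilate-1 f n = trans (*-congʳ (1^n≈1 n)) (*-identityˡ _)

  dilate-mulLinear : ∀ u α β f → dilate u (mulLinear α β f) ≋ mulLinear α (β * u) (dilate u f)
  dilate-mulLinear u α β f =
    dilate u ((α · f) ⊕ shift (β · f))
      ≋⟨ dilate-⊕ u (α · f) (shift (β · f)) ⟩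
    dilate u (α · f) ⊕ dilate u (shift (β · f))
      ≋⟨ ⊕-cong (dilate-· u α f) (dilate-shift u (β · f)) ⟩
    α · dilate u f ⊕ u · shift (dilate u (β · f))
      ≋⟨ ⊕-cong (≋-refl {α · dilate u f}) (·-shift u (dilate u (β · f))) ⟩
    α · dilate u f ⊕ shift (u · dilate u (β · f))
      ≋⟨ ⊕-cong (≋-refl {α · dilate u f}) (shift-cong βu) ⟩
    mulLinear α (β * u) (dilate u f) ≋∎
    where
    βu : ∀ n → u * (u ^ n * (β * f n)) ≈ (β * u) * (u ^ n * f n)
    βu n = solve 4 (λ u uⁿ β x → u :* (uⁿ :* (β :* x)) := (β :* u) :* (uⁿ :* x)) refl u (u ^ n) β (f n)

  mulLinear-dilate⁻¹ : ∀ {u α β γ δ f} → u ≉ 0# →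
    mulLinear α β (dilate u f) ≋ mulLinear γ δ f →
    mulLinear (u * γ) δ (dilate (u ⁻¹) f) ≋ mulLinear (u * α) β f
  mulLinear-dilate⁻¹ {u} {α} {β} {γ} {δ} {f} u≉0 eq =
    mulLinear (u * γ) δ (dilate (u ⁻¹) f)
      ≋⟨ mulLinear-cong refl (sym (u*[x*u⁻¹]≈x δ)) (≋-refl {dilate (u ⁻¹) f}) ⟩
    mulLinear (u * γ) (u * (δ * u ⁻¹)) (dilate (u ⁻¹) f)
      ≋⟨ mulLinear-scale u γ (δ * u ⁻¹) (dilate (u ⁻¹) f) ⟩
    u · mulLinear γ (δ * u ⁻¹) (dilate (u ⁻¹) f)
      ≋⟨ ·-congˡ (≋-sym (dilate-mulLinear (u ⁻¹) γ δ f)) ⟩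
    u · dilate (u ⁻¹) (mulLinear γ δ f)
      ≋⟨ ·-congˡ (dilate-cong refl (≋-sym eq)) ⟩
    u · dilate (u ⁻¹) (mulLinear α β (dilate u f))
      ≋⟨ ·-congˡ (dilate-mulLinear (u ⁻¹) α β (dilate u f)) ⟩
    u · mulLinear α (β * u ⁻¹) (dilate (u ⁻¹) (dilate u f))
      ≋⟨ ·-congˡ (mulLinear-congʳ undo) ⟩
    u · mulLinear α (β * u ⁻¹) f
      ≋⟨ ≋-sym (mulLinear-scale u α (β * u ⁻¹) f) ⟩
    mulLinear (u * α) (u * (β * u ⁻¹)) f
      ≋⟨ mulLinear-cong refl (u*[x*u⁻¹]≈x β) (≋-refl {f}) ⟩
    mulLinear (u * α) β f ≋∎
    where
    u*[x*u⁻¹]≈x : ∀ x → u * (x * u ⁻¹) ≈ x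
    u*[x*u⁻¹]≈x x = x≈y*[z*z⁻¹]⇒x≈y u≉0 (solve 3 (λ u x u′ → u :* (x :* u′) := x :* (u :* u′)) refl u x (u ⁻¹))
    undo : dilate (u ⁻¹) (dilate u f) ≋ f
    undo = ≋-trans (dilate-dilate (u ⁻¹) u f) (≋-trans (dilate-cong (⁻¹-inverseˡ u≉0) (≋-refl {f})) (dilate-1 f))

  qdiff-unique : ∀ {u α β γ δ Z} → (∀ n → α * u ^ suc n - γ ≉ 0#) →
    mulLinear α β (dilate u Z) ≋ mulLinear γ δ Z → Z 0 ≈ 0# → Z ≋ 0ₛ
  qdiff-unique nonzero eq Z₀≈0 zero = Z₀≈0
  qdiff-unique {u} {α} {β} {γ} {δ} {Z} nonzero eq Z₀≈0 (suc n) = x*y≈0⇒y≈0 (nonzero n) (begin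
    (α * (u * uⁿ) - γ) * Z (suc n)
      ≈⟨ solve 8 (λ α β γ δ u uⁿ z₁ z₀ → (α :* (u :* uⁿ) :- γ) :* z₁
          := (α :* ((u :* uⁿ) :* z₁) :+ β :* (uⁿ :* z₀)) :- (γ :* z₁ :+ δ :* z₀) :+ (δ :- β :* uⁿ) :* (z₀ :- con (+ 0)))
          refl α β γ δ u uⁿ (Z (suc n)) (Z n) ⟩
    (α * (u * uⁿ * Z (suc n)) + β * (uⁿ * Z n)) - (γ * Z (suc n) + δ * Z n) + (δ - β * uⁿ) * (Z n - 0#)
      ≈⟨ x+c*[y-z]≈x _ _ (qdiff-unique nonzero eq Z₀≈0 n) ⟩
    (α * (u * uⁿ * Z (suc n)) + β * (uⁿ * Z n)) - (γ * Z (suc n) + δ * Z n)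
      ≈⟨ x≈y⇒x-y≈0 (eq (suc n)) ⟩
    0# ∎)
    where uⁿ = u ^ n

module PolynomialMultipliers {ℓ₁ ℓ₂ : Level} (F : Field ℓ₁ ℓ₂) where
  open PowerSeries F public

  -- Polynomials in x (coefficient lists, lowest degree first) whose coefficients are
  -- solver expressions over the variables ρ; ⟪ p ⟫ multiplies a series by p.
  module Symbolic {nv : ℕ} (ρ : Vec Carrier nv) where
    Coeff : Set
    Coeff = Polynomial nv

    Poly : Set
    Poly = List Coeff

    ⟦_⟧ᶜ : Coeff → Carrier
    ⟦ e ⟧ᶜ = ⟦ e ⟧ ρ

    0ᶜ 1ᶜ -1ᶜ : Coeff
    0ᶜ  = con (+ 0)
    1ᶜ  = con (+ 1)
    -1ᶜ = con -[1+ 0 ]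

    infixl 6 _⊞_ _⊟_
    infixl 7 _⊠_
    _⊞_ : Poly → Poly → Poly
    []      ⊞ q       = q
    (x ∷ p) ⊞ []      = x ∷ p
    (x ∷ p) ⊞ (y ∷ q) = (x :+ y) ∷ (p ⊞ q)

    scale : Coeff → Poly → Poly
    scale e []      = []
    scale e (x ∷ p) = (e :* x) ∷ scale e p

    _⊠_ : Poly → Poly → Poly
    []      ⊠ q = []
    (x ∷ p) ⊠ q = scale x q ⊞ (0ᶜ ∷ (p ⊠ q))

    _⊟_ : Poly → Poly → Poly
    p ⊟ q = p ⊞ scale -1ᶜ q

    dilateᵖ : Coeff → Poly → Poly
    dilateᵖ e []      = []
    dilateᵖ e (x ∷ p) = x ∷ scale e (dilateᵖ e p)

    ⟪_⟫ : Poly → Series → Series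
    ⟪ []    ⟫ f = 0ₛ
    ⟪ e ∷ p ⟫ f = (⟦ e ⟧ᶜ · f) ⊕ shift (⟪ p ⟫ f)

    ⟪⟫-cong : ∀ p {f g} → f ≋ g → ⟪ p ⟫ f ≋ ⟪ p ⟫ g
    ⟪⟫-cong []      f≋g n = refl
    ⟪⟫-cong (e ∷ p) f≋g   = ⊕-cong (·-congˡ f≋g) (shift-cong (⟪⟫-cong p f≋g))

    ⟪⟫-⊕ : ∀ p f g → ⟪ p ⟫ (f ⊕ g) ≋ ⟪ p ⟫ f ⊕ ⟪ p ⟫ g
    ⟪⟫-⊕ []      f g n       = sym (+-identityʳ 0#)
    ⟪⟫-⊕ (e ∷ p) f g zero    =
      solve 3 (λ x y z → x :* (y :+ z) :+ con (+ 0) := (x :* y :+ con (+ 0)) :+ (x :* z :+ con (+ 0))) refl _ _ _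
    ⟪⟫-⊕ (e ∷ p) f g (suc n) = trans (+-congˡ (⟪⟫-⊕ p f g n))
      (solve 5 (λ x y z u v → x :* (y :+ z) :+ (u :+ v) := (x :* y :+ u) :+ (x :* z :+ v)) refl _ _ _ _ _)

    ⟪⟫-· : ∀ p c f → ⟪ p ⟫ (c · f) ≋ c · ⟪ p ⟫ f
    ⟪⟫-· []      c f n       = sym (zeroʳ c)
    ⟪⟫-· (e ∷ p) c f zero    = solve 3 (λ x y z → x :* (y :* z) :+ con (+ 0) := y :* (x :* z :+ con (+ 0))) refl _ _ _
    ⟪⟫-· (e ∷ p) c f (suc n) = trans (+-congˡ (⟪⟫-· p c f n))
      (solve 4 (λ x y z u → x :* (y :* z) :+ y :* u := y :* (x :* z :+ u)) refl _ _ _ _)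

    ⟪⟫-⊖ : ∀ p f g → ⟪ p ⟫ (f ⊖ g) ≋ ⟪ p ⟫ f ⊖ ⟪ p ⟫ g
    ⟪⟫-⊖ p f g n = begin
      ⟪ p ⟫ (f ⊖ g) n                     ≈⟨ ⟪⟫-cong p (λ k → +-congˡ (-1*x≈-x (g k))) n ⟨
      ⟪ p ⟫ (f ⊕ (- 1#) · g) n            ≈⟨ ⟪⟫-⊕ p f ((- 1#) · g) n ⟩
      ⟪ p ⟫ f n + ⟪ p ⟫ ((- 1#) · g) n    ≈⟨ +-congˡ (⟪⟫-· p (- 1#) g n) ⟩
      ⟪ p ⟫ f n + (- 1#) * ⟪ p ⟫ g n      ≈⟨ +-congˡ (-1*x≈-x _) ⟩
      ⟪ p ⟫ f n - ⟪ p ⟫ g n               ∎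
      where open import Algebra.Properties.Ring ring using (-1*x≈-x)

    ⟪⟫-shift : ∀ p f → ⟪ p ⟫ (shift f) ≋ shift (⟪ p ⟫ f)
    ⟪⟫-shift []      f zero    = refl
    ⟪⟫-shift []      f (suc n) = refl
    ⟪⟫-shift (e ∷ p) f zero    = trans (+-identityʳ _) (zeroʳ _)
    ⟪⟫-shift (e ∷ p) f (suc n) = +-congˡ (⟪⟫-shift p f n)

    ⟪⟫-⊞ : ∀ p q f → ⟪ p ⊞ q ⟫ f ≋ ⟪ p ⟫ f ⊕ ⟪ q ⟫ f
    ⟪⟫-⊞ []      q       f n       = sym (+-identityˡ _)
    ⟪⟫-⊞ (x ∷ p) []      f n       = sym (+-identityʳ _)
    ⟪⟫-⊞ (x ∷ p) (y ∷ q) f zero    =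
      solve 3 (λ a b c → (a :+ b) :* c :+ con (+ 0) := (a :* c :+ con (+ 0)) :+ (b :* c :+ con (+ 0))) refl _ _ _
    ⟪⟫-⊞ (x ∷ p) (y ∷ q) f (suc n) = trans (+-congˡ (⟪⟫-⊞ p q f n))
      (solve 5 (λ a b c u v → (a :+ b) :* c :+ (u :+ v) := (a :* c :+ u) :+ (b :* c :+ v)) refl _ _ _ _ _)

    ⟪⟫-scale : ∀ e p f → ⟪ scale e p ⟫ f ≋ ⟦ e ⟧ᶜ · ⟪ p ⟫ f
    ⟪⟫-scale e []      f n       = sym (zeroʳ _)
    ⟪⟫-scale e (x ∷ p) f zero    = solve 3 (λ a b c → (a :* b) :* c :+ con (+ 0) := a :* (b :* c :+ con (+ 0))) refl _ _ _
    ⟪⟫-scale e (x ∷ p) f (suc n) = trans (+-congˡ (⟪⟫-scale e p f n))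
      (solve 4 (λ a b c u → (a :* b) :* c :+ a :* u := a :* (b :* c :+ u)) refl _ _ _ _)

    ⟪⟫-⊟ : ∀ p q f → ⟪ p ⊟ q ⟫ f ≋ ⟪ p ⟫ f ⊖ ⟪ q ⟫ f
    ⟪⟫-⊟ p q f n = trans (⟪⟫-⊞ p (scale -1ᶜ q) f n)
      (+-congˡ (trans (⟪⟫-scale -1ᶜ q f n) (solve 1 (λ x → con -[1+ 0 ] :* x := :- x) refl _)))

    ⟪⟫-⊠ : ∀ p q f → ⟪ p ⊠ q ⟫ f ≋ ⟪ p ⟫ (⟪ q ⟫ f)
    ⟪⟫-⊠ []      q f n = refl
    ⟪⟫-⊠ (x ∷ p) q f n = begin
      ⟪ scale x q ⊞ (0ᶜ ∷ (p ⊠ q)) ⟫ f n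
        ≈⟨ ⟪⟫-⊞ (scale x q) (0ᶜ ∷ (p ⊠ q)) f n ⟩
      ⟪ scale x q ⟫ f n + ⟪ 0ᶜ ∷ (p ⊠ q) ⟫ f n
        ≈⟨ +-cong (⟪⟫-scale x q f n) (+-cong (zeroˡ _) (shift-cong (⟪⟫-⊠ p q f) n)) ⟩
      ⟦ x ⟧ᶜ * ⟪ q ⟫ f n + (0# + shift (⟪ p ⟫ (⟪ q ⟫ f)) n)
        ≈⟨ +-congˡ (+-identityˡ _) ⟩
      ⟪ x ∷ p ⟫ (⟪ q ⟫ f) n ∎

    ⟪⟫-⊠³ : ∀ p q r f → ⟪ p ⊠ (q ⊠ r) ⟫ f ≋ ⟪ p ⟫ (⟪ q ⟫ (⟪ r ⟫ f))
    ⟪⟫-⊠³ p q r f = ≋-trans (⟪⟫-⊠ p (q ⊠ r) f) (⟪⟫-cong p (⟪⟫-⊠ q r f))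

    ⟪⟫-⊠⁴ : ∀ p q r s f → ⟪ p ⊠ (q ⊠ (r ⊠ s)) ⟫ f ≋ ⟪ p ⟫ (⟪ q ⟫ (⟪ r ⟫ (⟪ s ⟫ f)))
    ⟪⟫-⊠⁴ p q r s f = ≋-trans (⟪⟫-⊠ p (q ⊠ (r ⊠ s)) f) (⟪⟫-cong p (⟪⟫-⊠³ q r s f))

    ⟪⟫-⊛ʳ : ∀ p g f → ⟪ p ⟫ (g ⊛ f) ≋ g ⊛ ⟪ p ⟫ f
    ⟪⟫-⊛ʳ []      g f n = sym (Σ<-zero (suc n) (λ k _ → zeroʳ _))
    ⟪⟫-⊛ʳ (e ∷ p) g f =
      ⟪ e ∷ p ⟫ (g ⊛ f)
        ≋⟨ ⊕-cong (≋-sym (⊛-·ʳ _ g f)) (shift-cong (⟪⟫-⊛ʳ p g f)) ⟩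
      g ⊛ (⟦ e ⟧ᶜ · f) ⊕ shift (g ⊛ ⟪ p ⟫ f)
        ≋⟨ ⊕-cong (≋-refl {g ⊛ (⟦ e ⟧ᶜ · f)}) (≋-sym (⊛-shiftʳ g (⟪ p ⟫ f))) ⟩
      g ⊛ (⟦ e ⟧ᶜ · f) ⊕ g ⊛ shift (⟪ p ⟫ f)
        ≋⟨ ≋-sym (⊛-distribˡ-⊕ g (⟦ e ⟧ᶜ · f) (shift (⟪ p ⟫ f))) ⟩
      g ⊛ ⟪ e ∷ p ⟫ f ≋∎

    ⟪⟫-⊛ˡ : ∀ p f g → ⟪ p ⟫ (f ⊛ g) ≋ ⟪ p ⟫ f ⊛ g
    ⟪⟫-⊛ˡ p f g = ≋-trans (⟪⟫-cong p (⊛-comm f g)) (≋-trans (⟪⟫-⊛ʳ p g f) (⊛-comm g (⟪ p ⟫ f)))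

    ⟪⟫-0ₛ : ∀ q → ⟪ q ⟫ 0ₛ ≋ 0ₛ
    ⟪⟫-0ₛ []      n       = refl
    ⟪⟫-0ₛ (e ∷ q) zero    = trans (+-identityʳ _) (zeroʳ _)
    ⟪⟫-0ₛ (e ∷ q) (suc n) = trans (+-cong (zeroʳ _) (⟪⟫-0ₛ q n)) (+-identityʳ _)

    ⟪⟫-comm : ∀ p q f → ⟪ p ⟫ (⟪ q ⟫ f) ≋ ⟪ q ⟫ (⟪ p ⟫ f)
    ⟪⟫-comm []      q f = ≋-sym (⟪⟫-0ₛ q)
    ⟪⟫-comm (e ∷ p) q f =
      ⟪ e ∷ p ⟫ (⟪ q ⟫ f)
        ≋⟨ ⊕-cong (≋-sym (⟪⟫-· q ⟦ e ⟧ᶜ f)) (shift-cong (⟪⟫-comm p q f)) ⟩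
      ⟪ q ⟫ (⟦ e ⟧ᶜ · f) ⊕ shift (⟪ q ⟫ (⟪ p ⟫ f))
        ≋⟨ ⊕-cong (≋-refl {⟪ q ⟫ (⟦ e ⟧ᶜ · f)}) (≋-sym (⟪⟫-shift q (⟪ p ⟫ f))) ⟩
      ⟪ q ⟫ (⟦ e ⟧ᶜ · f) ⊕ ⟪ q ⟫ (shift (⟪ p ⟫ f))
        ≋⟨ ≋-sym (⟪⟫-⊕ q (⟦ e ⟧ᶜ · f) (shift (⟪ p ⟫ f))) ⟩
      ⟪ q ⟫ (⟪ e ∷ p ⟫ f) ≋∎

    ⟪⟫-linear : ∀ e₀ e₁ f → ⟪ e₀ ∷ e₁ ∷ [] ⟫ f ≋ mulLinear ⟦ e₀ ⟧ᶜ ⟦ e₁ ⟧ᶜ f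
    ⟪⟫-linear e₀ e₁ f zero          = refl
    ⟪⟫-linear e₀ e₁ f (suc zero)    = +-congˡ (+-identityʳ _)
    ⟪⟫-linear e₀ e₁ f (suc (suc n)) = +-congˡ (+-identityʳ _)

    dilate-⟪⟫ : ∀ e p f → dilate ⟦ e ⟧ᶜ (⟪ p ⟫ f) ≋ ⟪ dilateᵖ e p ⟫ (dilate ⟦ e ⟧ᶜ f)
    dilate-⟪⟫ e []      f n = zeroʳ _
    dilate-⟪⟫ e (x ∷ p) f =
      dilate u (⟪ x ∷ p ⟫ f)
        ≋⟨ dilate-⊕ u (⟦ x ⟧ᶜ · f) (shift (⟪ p ⟫ f)) ⟩
      dilate u (⟦ x ⟧ᶜ · f) ⊕ dilate u (shift (⟪ p ⟫ f))
        ≋⟨ ⊕-cong (dilate-· u ⟦ x ⟧ᶜ f) (dilate-shift u (⟪ p ⟫ f)) ⟩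
      ⟦ x ⟧ᶜ · dilate u f ⊕ u · shift (dilate u (⟪ p ⟫ f))
        ≋⟨ ⊕-cong (≋-refl {⟦ x ⟧ᶜ · dilate u f}) (·-congˡ (shift-cong (dilate-⟪⟫ e p f))) ⟩
      ⟦ x ⟧ᶜ · dilate u f ⊕ u · shift (⟪ p′ ⟫ (dilate u f))
        ≋⟨ ⊕-cong (≋-refl {⟦ x ⟧ᶜ · dilate u f}) (·-shift u (⟪ p′ ⟫ (dilate u f))) ⟩
      ⟦ x ⟧ᶜ · dilate u f ⊕ shift (u · ⟪ p′ ⟫ (dilate u f))
        ≋⟨ ⊕-cong (≋-refl {⟦ x ⟧ᶜ · dilate u f}) (shift-cong (≋-sym (⟪⟫-scale e p′ (dilate u f)))) ⟩
      ⟪ dilateᵖ e (x ∷ p) ⟫ (dilate u f) ≋∎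
      where
      u  = ⟦ e ⟧ᶜ
      p′ = dilateᵖ e p

    ⟪⟫-vanishing-prefix : ∀ p f m → (∀ k → k ≤ m → f k ≈ 0#) → ⟪ p ⟫ f m ≈ 0#
    ⟪⟫-vanishing-prefix []      f m       f≈0 = refl
    ⟪⟫-vanishing-prefix (e ∷ p) f zero    f≈0 = trans (+-identityʳ _) (trans (*-congˡ (f≈0 0 z≤n)) (zeroʳ _))
    ⟪⟫-vanishing-prefix (e ∷ p) f (suc m) f≈0 = trans
      (+-cong (trans (*-congˡ (f≈0 (suc m) ℕ.≤-refl)) (zeroʳ _))
              (⟪⟫-vanishing-prefix p f m (λ k k≤m → f≈0 k (ℕ.m≤n⇒m≤1+n k≤m))))
      (+-identityʳ _)

    ⟪⟫-zero⇒≋0ₛ : ∀ e p f → ⟦ e ⟧ᶜ ≉ 0# → ⟪ e ∷ p ⟫ f ≋ 0ₛ → f ≋ 0ₛ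
    ⟪⟫-zero⇒≋0ₛ e p f e≉0 ef≋0 = <-rec (λ n → f n ≈ 0#) vanish
      where
      vanish : ∀ n → (∀ {k} → k < n → f k ≈ 0#) → f n ≈ 0#
      vanish zero    _  = x*y≈0⇒y≈0 e≉0 (trans (sym (+-identityʳ _)) (ef≋0 0))
      vanish (suc n) ih = x*y≈0⇒y≈0 e≉0 (begin
        ⟦ e ⟧ᶜ * f (suc n)                ≈⟨ +-identityʳ _ ⟨
        ⟦ e ⟧ᶜ * f (suc n) + 0#           ≈⟨ +-congˡ (⟪⟫-vanishing-prefix p f n (λ k k≤n → ih (s≤s k≤n))) ⟨
        ⟦ e ⟧ᶜ * f (suc n) + ⟪ p ⟫ f n    ≈⟨ ef≋0 (suc n) ⟩
        0#                                ∎)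

    constantCoeff : Poly → Coeff
    constantCoeff []      = 0ᶜ
    constantCoeff (e ∷ _) = e

    ⟪⟫-cancel : ∀ p {f g} → ⟦ constantCoeff p ⟧ᶜ ≉ 0# → ⟪ p ⟫ f ≋ ⟪ p ⟫ g → f ≋ g
    ⟪⟫-cancel []      0≉0 _     = contradiction refl 0≉0
    ⟪⟫-cancel (e ∷ p) {f} {g} e≉0 ef≋eg = ⊖≋0ₛ⇒≋ (⟪⟫-zero⇒≋0ₛ e p (f ⊖ g) e≉0 (λ n →
      trans (⟪⟫-⊖ (e ∷ p) f g n) (x≈y⇒x-y≈0 (ef≋eg n))))

    ≋-by-coefficients : ∀ p q → All (λ e → ⟦ e ⟧↓ ρ ≈ ⟦ 0ᶜ ⟧↓ ρ) (p ⊟ q) → ∀ f → ⟪ p ⟫ f ≋ ⟪ q ⟫ f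
    ≋-by-coefficients p q normal-forms f = ⊖≋0ₛ⇒≋ (≋-trans (≋-sym (⟪⟫-⊟ p q f)) (vanishing (p ⊟ q) normal-forms))
      where
      vanishing : ∀ r → All (λ e → ⟦ e ⟧↓ ρ ≈ ⟦ 0ᶜ ⟧↓ ρ) r → ⟪ r ⟫ f ≋ 0ₛ
      vanishing []      []       n       = refl
      vanishing (e ∷ r) (e≈0 ∷ _) zero    = trans (+-identityʳ _) (trans (*-congʳ (prove ρ e 0ᶜ e≈0)) (zeroˡ _))
      vanishing (e ∷ r) (e≈0 ∷ r≈0) (suc n) =
        trans (+-cong (trans (*-congʳ (prove ρ e 0ᶜ e≈0)) (zeroˡ _)) (vanishing r r≈0 n)) (+-identityʳ _)

    ⟪⟫-linear-≋ : ∀ e₀ e₁ e₂ e₃ {f g} →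
                  mulLinear ⟦ e₀ ⟧ᶜ ⟦ e₁ ⟧ᶜ f ≋ mulLinear ⟦ e₂ ⟧ᶜ ⟦ e₃ ⟧ᶜ g →
                  ⟪ e₀ ∷ e₁ ∷ [] ⟫ f ≋ ⟪ e₂ ∷ e₃ ∷ [] ⟫ g
    ⟪⟫-linear-≋ e₀ e₁ e₂ e₃ {f} {g} eq = ≋-trans (⟪⟫-linear e₀ e₁ f) (≋-trans eq (≋-sym (⟪⟫-linear e₂ e₃ g)))

    qdiff-⊛ : ∀ u p p′ r r′ A B → ⟪ p ⟫ (dilate u A) ≋ ⟪ p′ ⟫ A → ⟪ r ⟫ (dilate u B) ≋ ⟪ r′ ⟫ B →
              ⟪ p ⟫ (⟪ r ⟫ (dilate u (A ⊛ B))) ≋ ⟪ p′ ⟫ (⟪ r′ ⟫ (A ⊛ B))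
    qdiff-⊛ u p p′ r r′ A B eqA eqB =
      ⟪ p ⟫ (⟪ r ⟫ (dilate u (A ⊛ B)))          ≋⟨ ⟪⟫-cong p (⟪⟫-cong r (dilate-⊛ u A B)) ⟩
      ⟪ p ⟫ (⟪ r ⟫ (dilate u A ⊛ dilate u B))   ≋⟨ ⟪⟫-cong p (⟪⟫-⊛ʳ r (dilate u A) (dilate u B)) ⟩
      ⟪ p ⟫ (dilate u A ⊛ ⟪ r ⟫ (dilate u B))   ≋⟨ ⟪⟫-cong p (⊛-congˡ eqB) ⟩
      ⟪ p ⟫ (dilate u A ⊛ ⟪ r′ ⟫ B)             ≋⟨ ⟪⟫-⊛ˡ p (dilate u A) (⟪ r′ ⟫ B) ⟩
      ⟪ p ⟫ (dilate u A) ⊛ ⟪ r′ ⟫ B             ≋⟨ ⊛-congʳ {g = ⟪ r′ ⟫ B} eqA ⟩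
      ⟪ p′ ⟫ A ⊛ ⟪ r′ ⟫ B                       ≋⟨ ≋-sym (⟪⟫-⊛ˡ p′ A (⟪ r′ ⟫ B)) ⟩
      ⟪ p′ ⟫ (A ⊛ ⟪ r′ ⟫ B)                     ≋⟨ ⟪⟫-cong p′ (≋-sym (⟪⟫-⊛ʳ r′ A B)) ⟩
      ⟪ p′ ⟫ (⟪ r′ ⟫ (A ⊛ B))                   ≋∎

    ⊛-as-⟪⟫ : ∀ p {f} g → f ≋ ⟪ p ⟫ 1ₛ → f ⊛ g ≋ ⟪ p ⟫ g
    ⊛-as-⟪⟫ p {f} g f≋p =
      ≋-trans (⊛-congʳ {g = g} f≋p) (≋-trans (≋-sym (⟪⟫-⊛ˡ p 1ₛ g)) (⟪⟫-cong p (⊛-identityˡ g)))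

    ⟪⟫-cancels : ∀ p {f} g → ⟪ p ⟫ f ≋ 1ₛ → ⟪ p ⟫ (f ⊛ g) ≋ g
    ⟪⟫-cancels p {f} g pf≋1 = ≋-trans (⟪⟫-⊛ˡ p f g) (≋-trans (⊛-congʳ {g = g} pf≋1) (⊛-identityˡ g))

    oneMinus-⊛ : ∀ e g → Defs.oneMinus F ⟦ e ⟧ᶜ ⊛ g ≋ ⟪ 1ᶜ ∷ :- e ∷ [] ⟫ g
    oneMinus-⊛ e g = ⊛-as-⟪⟫ (1ᶜ ∷ :- e ∷ []) g coefficients
      where
      coefficients : Defs.oneMinus F ⟦ e ⟧ᶜ ≋ ⟪ 1ᶜ ∷ :- e ∷ [] ⟫ 1ₛ
      coefficients zero          = solve 0 (con (+ 1) := con (+ 1) :* con (+ 1) :+ con (+ 0)) refl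
      coefficients (suc zero)    = solve 1 (λ u → :- u := con (+ 1) :* con (+ 0) :+ ((:- u) :* con (+ 1) :+ con (+ 0))) refl ⟦ e ⟧ᶜ
      coefficients (suc (suc n)) = solve 1 (λ u → con (+ 0) := con (+ 1) :* con (+ 0) :+ ((:- u) :* con (+ 0) :+ con (+ 0))) refl ⟦ e ⟧ᶜ

    minusX-⊛ : ∀ e g → Defs.minusX F ⟦ e ⟧ᶜ ⊛ g ≋ ⟪ e ∷ -1ᶜ ∷ [] ⟫ g
    minusX-⊛ e g = ⊛-as-⟪⟫ (e ∷ -1ᶜ ∷ []) g coefficients
      where
      coefficients : Defs.minusX F ⟦ e ⟧ᶜ ≋ ⟪ e ∷ -1ᶜ ∷ [] ⟫ 1ₛ
      coefficients zero          = solve 1 (λ u → u := u :* con (+ 1) :+ con (+ 0)) refl ⟦ e ⟧ᶜ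
      coefficients (suc zero)    = solve 1 (λ u → :- con (+ 1) := u :* con (+ 0) :+ (con -[1+ 0 ] :* con (+ 1) :+ con (+ 0))) refl ⟦ e ⟧ᶜ
      coefficients (suc (suc n)) = solve 1 (λ u → con (+ 0) := u :* con (+ 0) :+ (con -[1+ 0 ] :* con (+ 0) :+ con (+ 0))) refl ⟦ e ⟧ᶜ

    ⟪1-ex²⟫-geom2 : ∀ e → ⟪ 1ᶜ ∷ 0ᶜ ∷ :- e ∷ [] ⟫ (Defs.geom2 F ⟦ e ⟧ᶜ) ≋ 1ₛ
    ⟪1-ex²⟫-geom2 e zero          = solve 0 (con (+ 1) :* con (+ 1) :+ con (+ 0) := con (+ 1)) refl
    ⟪1-ex²⟫-geom2 e (suc zero)    = solve 1 (λ u → con (+ 1) :* con (+ 0) :+ (con (+ 0) :* con (+ 1) :+ con (+ 0)) := con (+ 0)) refl ⟦ e ⟧ᶜ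
    ⟪1-ex²⟫-geom2 e (suc (suc n)) = trans (+-congˡ (+-congˡ (+-congˡ (shift-0ₛ n))))
      (solve 3 (λ u x y → con (+ 1) :* (u :* x) :+ (con (+ 0) :* y :+ ((:- u) :* x :+ con (+ 0))) := con (+ 0))
         refl ⟦ e ⟧ᶜ (Defs.geom2 F ⟦ e ⟧ᶜ n) (Defs.geom2 F ⟦ e ⟧ᶜ (suc n)))

    ⟪e-x²⟫-geom2 : ∀ e → ⟦ e ⟧ᶜ ≉ 0# →
      ⟪ e ∷ 0ᶜ ∷ -1ᶜ ∷ [] ⟫ (λ n → ⟦ e ⟧ᶜ ⁻¹ * Defs.geom2 F (⟦ e ⟧ᶜ ⁻¹) n) ≋ 1ₛ
    ⟪e-x²⟫-geom2 e e≉0 zero          = x≈y*[z*z⁻¹]⇒x≈y e≉0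
      (solve 2 (λ u u′ → u :* (u′ :* con (+ 1)) :+ con (+ 0) := con (+ 1) :* (u :* u′)) refl ⟦ e ⟧ᶜ (⟦ e ⟧ᶜ ⁻¹))
    ⟪e-x²⟫-geom2 e e≉0 (suc zero)    =
      solve 2 (λ u u′ → u :* (u′ :* con (+ 0)) :+ (con (+ 0) :* (u′ :* con (+ 1)) :+ con (+ 0)) := con (+ 0)) refl ⟦ e ⟧ᶜ (⟦ e ⟧ᶜ ⁻¹)
    ⟪e-x²⟫-geom2 e e≉0 (suc (suc n)) = trans (+-congˡ (+-congˡ (+-congˡ (shift-0ₛ n))))
      (trans (solve 4 (λ u u′ G G₁ → u :* (u′ :* (u′ :* G)) :+ (con (+ 0) :* (u′ :* G₁) :+ (con -[1+ 0 ] :* (u′ :* G) :+ con (+ 0)))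
                        := con (+ 0) :+ (G :* u′) :* (u :* u′ :- con (+ 1)))
                refl ⟦ e ⟧ᶜ (⟦ e ⟧ᶜ ⁻¹) (Defs.geom2 F (⟦ e ⟧ᶜ ⁻¹) n) (Defs.geom2 F (⟦ e ⟧ᶜ ⁻¹) (suc n)))
             (x+c*[y-z]≈x _ _ (⁻¹-inverseʳ e≉0)))

    ⊛⁴-as-⟪⟫ : ∀ f₁ f₂ f₃ f₄ p₁ p₂ p₃ p₄ →
      (∀ g → f₁ ⊛ g ≋ ⟪ p₁ ⟫ g) → (∀ g → f₂ ⊛ g ≋ ⟪ p₂ ⟫ g) →
      (∀ g → f₃ ⊛ g ≋ ⟪ p₃ ⟫ g) → (∀ g → f₄ ⊛ g ≋ ⟪ p₄ ⟫ g) →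
      ∀ h → f₁ ⊛ f₂ ⊛ f₃ ⊛ f₄ ⊛ h ≋ ⟪ p₁ ⊠ (p₂ ⊠ (p₃ ⊠ p₄)) ⟫ h
    ⊛⁴-as-⟪⟫ f₁ f₂ f₃ f₄ p₁ p₂ p₃ p₄ eq₁ eq₂ eq₃ eq₄ h =
      f₁ ⊛ f₂ ⊛ f₃ ⊛ f₄ ⊛ h
        ≋⟨ ⊛-assoc (f₁ ⊛ f₂ ⊛ f₃) f₄ h ⟩
      f₁ ⊛ f₂ ⊛ f₃ ⊛ (f₄ ⊛ h)
        ≋⟨ ⊛-assoc (f₁ ⊛ f₂) f₃ (f₄ ⊛ h) ⟩
      f₁ ⊛ f₂ ⊛ (f₃ ⊛ (f₄ ⊛ h))
        ≋⟨ ⊛-assoc f₁ f₂ (f₃ ⊛ (f₄ ⊛ h)) ⟩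
      f₁ ⊛ (f₂ ⊛ (f₃ ⊛ (f₄ ⊛ h)))
        ≋⟨ ⊛-congˡ (⊛-congˡ (⊛-congˡ (eq₄ h))) ⟩
      f₁ ⊛ (f₂ ⊛ (f₃ ⊛ ⟪ p₄ ⟫ h))
        ≋⟨ ⊛-congˡ (⊛-congˡ (eq₃ (⟪ p₄ ⟫ h))) ⟩
      f₁ ⊛ (f₂ ⊛ ⟪ p₃ ⟫ (⟪ p₄ ⟫ h))
        ≋⟨ ⊛-congˡ (eq₂ (⟪ p₃ ⟫ (⟪ p₄ ⟫ h))) ⟩
      f₁ ⊛ ⟪ p₂ ⟫ (⟪ p₃ ⟫ (⟪ p₄ ⟫ h))
        ≋⟨ eq₁ (⟪ p₂ ⟫ (⟪ p₃ ⟫ (⟪ p₄ ⟫ h))) ⟩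
      ⟪ p₁ ⟫ (⟪ p₂ ⟫ (⟪ p₃ ⟫ (⟪ p₄ ⟫ h)))
        ≋⟨ ≋-sym (⟪⟫-⊠⁴ p₁ p₂ p₃ p₄ h) ⟩
      ⟪ p₁ ⊠ (p₂ ⊠ (p₃ ⊠ p₄)) ⟫ h ≋∎

    ⟪⟫-cancels² : ∀ p₁ p₂ X G₁ G₂ h → ⟪ p₁ ⟫ G₁ ≋ 1ₛ → ⟪ p₂ ⟫ G₂ ≋ 1ₛ →
                  ⟪ p₁ ⟫ (⟪ p₂ ⟫ (X ⊛ G₁ ⊛ G₂ ⊛ h)) ≋ X ⊛ h
    ⟪⟫-cancels² p₁ p₂ X G₁ G₂ h p₁G₁≋1 p₂G₂≋1 =
      ⟪ p₁ ⟫ (⟪ p₂ ⟫ (X ⊛ G₁ ⊛ G₂ ⊛ h))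
        ≋⟨ ⟪⟫-cong p₁ (⟪⟫-cong p₂ reorder) ⟩
      ⟪ p₁ ⟫ (⟪ p₂ ⟫ (G₂ ⊛ (G₁ ⊛ (X ⊛ h))))
        ≋⟨ ⟪⟫-cong p₁ (⟪⟫-cancels p₂ (G₁ ⊛ (X ⊛ h)) p₂G₂≋1) ⟩
      ⟪ p₁ ⟫ (G₁ ⊛ (X ⊛ h))
        ≋⟨ ⟪⟫-cancels p₁ (X ⊛ h) p₁G₁≋1 ⟩
      X ⊛ h ≋∎
      where
      reorder : X ⊛ G₁ ⊛ G₂ ⊛ h ≋ G₂ ⊛ (G₁ ⊛ (X ⊛ h))
      reorder =
        X ⊛ G₁ ⊛ G₂ ⊛ h
          ≋⟨ ⊛-congʳ {g = h} (⊛-comm (X ⊛ G₁) G₂) ⟩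
        G₂ ⊛ (X ⊛ G₁) ⊛ h
          ≋⟨ ⊛-assoc G₂ (X ⊛ G₁) h ⟩
        G₂ ⊛ (X ⊛ G₁ ⊛ h)
          ≋⟨ ⊛-congˡ (⊛-congʳ {g = h} (⊛-comm X G₁)) ⟩
        G₂ ⊛ (G₁ ⊛ X ⊛ h)
          ≋⟨ ⊛-congˡ (⊛-assoc G₁ X h) ⟩
        G₂ ⊛ (G₁ ⊛ (X ⊛ h)) ≋∎

    ⟪⟫-scale-⊟ : ∀ e₁ e₂ p₁ p₂ f →
                 ⟦ e₁ ⟧ᶜ · ⟪ p₁ ⟫ f ⊖ ⟦ e₂ ⟧ᶜ · ⟪ p₂ ⟫ f ≋ ⟪ scale e₁ p₁ ⊟ scale e₂ p₂ ⟫ f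
    ⟪⟫-scale-⊟ e₁ e₂ p₁ p₂ f =
      ≋-sym (≋-trans (⟪⟫-⊟ (scale e₁ p₁) (scale e₂ p₂) f) (⊖-cong (⟪⟫-scale e₁ p₁ f) (⟪⟫-scale e₂ p₂ f)))

    shift-as-⟪⟫ : ∀ e f → shift (⟦ e ⟧ᶜ · f) ≋ ⟪ 0ᶜ ∷ e ∷ [] ⟫ f
    shift-as-⟪⟫ e f zero    = solve 1 (λ x → con (+ 0) := con (+ 0) :* x :+ con (+ 0)) refl (f 0)
    shift-as-⟪⟫ e f (suc n) = trans
      (solve 3 (λ c x y → c :* x := con (+ 0) :* y :+ (c :* x :+ con (+ 0))) refl ⟦ e ⟧ᶜ (f n) (f (suc n)))
      (+-congˡ (+-congˡ (sym (shift-0ₛ n))))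

module EulerProducts {ℓ₁ ℓ₂ : Level} (F : Field ℓ₁ ℓ₂) where
  open PolynomialMultipliers F public

  module QSeries (a q : Carrier) (a≉0 : a ≉ 0#) (q≉0 : q ≉ 0#) (qᵏ⁺¹≉1 : ∀ k → q ^ suc k ≉ 1#) where

    poch : Carrier → ℕ → Carrier
    poch u = Defs.poch F u q

    qfac : ℕ → Carrier
    qfac = poch q

    1-qᵏq≉0 : ∀ k → 1# - q ^ k * q ≉ 0#
    1-qᵏq≉0 k 1-qᵏq≈0 = qᵏ⁺¹≉1 k (trans (*-comm q (q ^ k)) (sym (x-y≈0⇒x≈y 1-qᵏq≈0)))

    qfac-≉0 : ∀ k → qfac k ≉ 0#
    qfac-≉0 k = Π<-≉0 k (λ i → 1# - q ^ i * q) (λ i _ → 1-qᵏq≉0 i)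

    qfac-suc⁻¹ : ∀ k → qfac (suc k) ⁻¹ ≈ qfac k ⁻¹ * (1# - q ^ k * q) ⁻¹
    qfac-suc⁻¹ k = ⁻¹-distrib-* (qfac-≉0 k) (1-qᵏq≉0 k)

    poch-cong : ∀ {u v} k → u ≈ v → poch u k ≈ poch v k
    poch-cong zero    u≈v = refl
    poch-cong (suc k) u≈v = *-cong (poch-cong k u≈v) (+-congˡ (-‿cong (*-congˡ u≈v)))

    poch-suc-shift : ∀ u k → poch u (suc k) ≈ (1# - u) * poch (q * u) k
    poch-suc-shift u zero    = solve 1 (λ u → con (+ 1) :* (con (+ 1) :- con (+ 1) :* u) := (con (+ 1) :- u) :* con (+ 1)) refl u
    poch-suc-shift u (suc k) = begin
      poch u (suc k) * (1# - q * q ^ k * u)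
        ≈⟨ *-congʳ (poch-suc-shift u k) ⟩
      (1# - u) * poch (q * u) k * (1# - q * q ^ k * u)
        ≈⟨ solve 5 (λ x P q qᵏ u → x :* P :* (con (+ 1) :- q :* qᵏ :* u) := x :* (P :* (con (+ 1) :- qᵏ :* (q :* u))))
             refl (1# - u) (poch (q * u) k) q (q ^ k) u ⟩
      (1# - u) * poch (q * u) (suc k) ∎

    num den P : Series
    num = Defs.infProdNum F a q
    den = Defs.infProdDen F a q
    P   = num ⊛ den

    num-0 : num 0 ≈ 1#
    num-0 = trans (*-congˡ 1⁻¹≈1) (trans (*-identityʳ _) (trans (*-identityʳ _) (*-identityʳ _)))

    den-0 : den 0 ≈ 1#
    den-0 = trans (*-congˡ 1⁻¹≈1) (*-identityʳ _)

    P-0 : P 0 ≈ 1#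
    P-0 = trans (⊛-zeroth num den) (trans (*-cong num-0 den-0) (*-identityˡ 1#))

    num-suc : ∀ k → num (suc k) * (1# - q ^ k * q) ≈ - (q ^ k * a) * num k
    num-suc k = x≈y*[z*z⁻¹]⇒x≈y (1-qᵏq≉0 k) (begin
      (- 1# * sgn) * q ^ (Defs.tri k ℕ.+ k) * (a * a ^ k) * qfac (suc k) ⁻¹ * f
        ≈⟨ *-congʳ (*-cong (*-congʳ (*-congˡ (^-distribˡ-+-* q (Defs.tri k) k))) (qfac-suc⁻¹ k)) ⟩
      (- 1# * sgn) * (T * qᵏ) * (a * aᵏ) * (qfac k ⁻¹ * f ⁻¹) * f
        ≈⟨ solve 8 (λ sgn T qᵏ a aᵏ Q f′ f → ((((:- con (+ 1)) :* sgn) :* (T :* qᵏ)) :* (a :* aᵏ)) :* (Q :* f′) :* f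
            := (:- (qᵏ :* a) :* (((sgn :* T) :* aᵏ) :* Q)) :* (f :* f′)) refl sgn T qᵏ a aᵏ (qfac k ⁻¹) (f ⁻¹) f ⟩
      - (q ^ k * a) * num k * (f * f ⁻¹) ∎)
      where
      f   = 1# - q ^ k * q
      sgn = (- 1#) ^ k
      T   = q ^ Defs.tri k
      qᵏ  = q ^ k
      aᵏ  = a ^ k

    den-suc : ∀ k → a * (den (suc k) * (1# - q ^ k * q)) ≈ q * den k
    den-suc k = x≈y*[z*z⁻¹]⇒x≈y (1-qᵏq≉0 k) (x≈y*[z*z⁻¹]⇒x≈y a≉0 (begin
      a * ((q * a ⁻¹) * W * qfac (suc k) ⁻¹ * f)
        ≈⟨ *-congˡ (*-congʳ (*-congˡ (qfac-suc⁻¹ k))) ⟩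
      a * ((q * a ⁻¹) * W * (qfac k ⁻¹ * f ⁻¹) * f)
        ≈⟨ solve 7 (λ q a a′ W Q f′ f → a :* ((((q :* a′) :* W) :* (Q :* f′)) :* f) := ((q :* (W :* Q)) :* (f :* f′)) :* (a :* a′))
            refl q a (a ⁻¹) W (qfac k ⁻¹) (f ⁻¹) f ⟩
      ((q * den k) * (f * f ⁻¹)) * (a * a ⁻¹) ∎))
      where
      f = 1# - q ^ k * q
      W = (q * a ⁻¹) ^ k

    num-qdiff : mulLinear 1# (- a) (dilate q num) ≋ num
    num-qdiff zero    = solve 1 (λ x → con (+ 1) :* (con (+ 1) :* x) :+ con (+ 0) := x) refl (num 0)
    num-qdiff (suc n) = trans
      (solve 5 (λ q qⁿ N₁ N₀ a → con (+ 1) :* ((q :* qⁿ) :* N₁) :+ (:- a) :* (qⁿ :* N₀)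
                  := N₁ :+ con -[1+ 0 ] :* (N₁ :* (con (+ 1) :- qⁿ :* q) :- (:- (qⁿ :* a)) :* N₀))
         refl q (q ^ n) (num (suc n)) (num n) a)
      (x+c*[y-z]≈x _ _ (num-suc n))

    den-qdiff : a · dilate q den ≋ mulLinear a (- q) den
    den-qdiff zero    = solve 2 (λ a x → a :* (con (+ 1) :* x) := a :* x :+ con (+ 0)) refl a (den 0)
    den-qdiff (suc n) = trans
      (solve 5 (λ q qⁿ D₁ D₀ a → a :* ((q :* qⁿ) :* D₁)
                  := (a :* D₁ :+ (:- q) :* D₀) :+ con -[1+ 0 ] :* (a :* (D₁ :* (con (+ 1) :- qⁿ :* q)) :- q :* D₀))
         refl q (q ^ n) (den (suc n)) (den n) a)
      (x+c*[y-z]≈x _ _ (den-suc n))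

    P-qdiff : mulLinear a (- (a * a)) (dilate q P) ≋ mulLinear a (- q) P
    P-qdiff =
      mulLinear a (- (a * a)) (dilate q P)
        ≋⟨ mulLinear-congʳ (dilate-⊛ q num den) ⟩
      mulLinear a (- (a * a)) (dilate q num ⊛ dilate q den)
        ≋⟨ mulLinear-⊛ˡ a (- (a * a)) (dilate q num) (dilate q den) ⟩
      mulLinear a (- (a * a)) (dilate q num) ⊛ dilate q den
        ≋⟨ ⊛-congʳ {g = dilate q den} (≋-trans factor-a (·-congˡ num-qdiff)) ⟩
      (a · num) ⊛ dilate q den
        ≋⟨ ⊛-·ˡ a num (dilate q den) ⟩
      a · (num ⊛ dilate q den)
        ≋⟨ ≋-sym (⊛-·ʳ a num (dilate q den)) ⟩
      num ⊛ (a · dilate q den)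
        ≋⟨ ⊛-congˡ den-qdiff ⟩
      num ⊛ mulLinear a (- q) den
        ≋⟨ ≋-sym (mulLinear-⊛ʳ a (- q) num den) ⟩
      mulLinear a (- q) P ≋∎
      where
      factor-a : mulLinear a (- (a * a)) (dilate q num) ≋ a · mulLinear 1# (- a) (dilate q num)
      factor-a = ≋-trans
        (mulLinear-cong (sym (*-identityʳ a)) (solve 1 (λ a → :- (a :* a) := a :* (:- a)) refl a) (≋-refl {dilate q num}))
        (mulLinear-scale a 1# (- a) (dilate q num))

    P-qdiff⁻¹ : mulLinear (q * a) (- q) (dilate (q ⁻¹) P) ≋ mulLinear (q * a) (- (a * a)) P
    P-qdiff⁻¹ = mulLinear-dilate⁻¹ q≉0 P-qdiff

    base : Carrier → Carrier
    base t = q * t * t / (a * a)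

    R : Carrier → Series
    R t k = poch (base t) k / qfac k * (a / t) ^ k

    R-0 : ∀ t → R t 0 ≈ 1#
    R-0 t = trans (*-identityʳ _) (trans (*-congˡ 1⁻¹≈1) (*-identityˡ _))

    R-cong : ∀ {t t′} → t ≉ 0# → t ≈ t′ → ∀ k → R t k ≈ R t′ k
    R-cong t≉0 t≈t′ k = *-cong (*-congʳ (poch-cong k (*-congʳ (*-cong (*-congˡ t≈t′) t≈t′))))
                               (^-cong k (*-congˡ (⁻¹-cong t≉0 t≈t′)))

    R-suc : ∀ t → t ≉ 0# → ∀ k → R t (suc k) * ((1# - q ^ k * q) * t) ≈ a * ((1# - q ^ k * base t) * R t k)
    R-suc t t≉0 k = x≈y*[z*z⁻¹]⇒x≈y (1-qᵏq≉0 k) (x≈y*[z*z⁻¹]⇒x≈y t≉0 (begin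
      Pu * g * qfac (suc k) ⁻¹ * ((a * t ⁻¹) * W) * (f * t)
        ≈⟨ *-congʳ (*-congʳ (*-congˡ (qfac-suc⁻¹ k))) ⟩
      Pu * g * (qfac k ⁻¹ * f ⁻¹) * ((a * t ⁻¹) * W) * (f * t)
        ≈⟨ solve 9 (λ t Pu g Q f′ a t′ W f → ((Pu :* g) :* (Q :* f′)) :* ((a :* t′) :* W) :* (f :* t)
                      := ((a :* (g :* ((Pu :* Q) :* W))) :* (f :* f′)) :* (t :* t′))
             refl t Pu g (qfac k ⁻¹) (f ⁻¹) a (t ⁻¹) W f ⟩
      (a * ((1# - q ^ k * base t) * R t k)) * (f * f ⁻¹) * (t * t ⁻¹) ∎))
      where
      f  = 1# - q ^ k * q
      g  = 1# - q ^ k * base t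
      Pu = poch (base t) k
      W  = (a * t ⁻¹) ^ k

    base-clear : ∀ t → base t * (a * a) ≈ q * t * t
    base-clear t = x≈y*[z*z⁻¹]⇒x≈y (*-≉0 a≉0 a≉0)
      (solve 3 (λ x y z → (x :* y) :* z := x :* (z :* y)) refl (q * t * t) ((a * a) ⁻¹) (a * a))

    R-qdiff : ∀ t → t ≉ 0# → mulLinear (t * a) (- (q * t * t)) (dilate q (R t)) ≋ mulLinear (a * t) (- (a * a)) (R t)
    R-qdiff t t≉0 zero    =
      solve 3 (λ t a x → (t :* a) :* (con (+ 1) :* x) :+ con (+ 0) := (a :* t) :* x :+ con (+ 0)) refl t a (R t 0)
    R-qdiff t t≉0 (suc n) = trans
      (solve 7 (λ q qⁿ X₁ X₀ a t U → (t :* a) :* ((q :* qⁿ) :* X₁) :+ (:- (q :* t :* t)) :* (qⁿ :* X₀)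
                  := (((a :* t) :* X₁ :+ (:- (a :* a)) :* X₀)
                       :+ (con -[1+ 0 ] :* a) :* (X₁ :* ((con (+ 1) :- qⁿ :* q) :* t) :- a :* ((con (+ 1) :- qⁿ :* U) :* X₀)))
                     :+ (qⁿ :* X₀) :* (U :* (a :* a) :- q :* t :* t))
         refl q (q ^ n) (R t (suc n)) (R t n) a t (base t))
      (trans (x+c*[y-z]≈x _ _ (base-clear t)) (x+c*[y-z]≈x _ _ (R-suc t t≉0 n)))

    R-qdiff⁻¹ : ∀ t → t ≉ 0# →
      mulLinear (q * (a * t)) (- (a * a)) (dilate (q ⁻¹) (R t)) ≋ mulLinear (q * (t * a)) (- (q * t * t)) (R t)
    R-qdiff⁻¹ t t≉0 = mulLinear-dilate⁻¹ q≉0 (R-qdiff t t≉0)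

    R-suc-shift : ∀ t → t ≉ 0# → ∀ k →
      R t (suc k) * ((1# - (q ⁻¹) ^ suc k) * (1# - q ^ suc k * base t)) * q
        ≈ - (a / t) * ((1# - base t) * (1# - q * base t)) * R (q * t) k
    R-suc-shift t t≉0 k = begin
      poch B (suc k) * qfac (suc k) ⁻¹ * w ^ suc k * ((1# - Q′) * (1# - Q * B)) * q
        ≈⟨ solve 6 (λ P F W x y q → P :* F :* W :* (x :* y) :* q := (P :* y) :* (F :* x) :* (W :* q))
             refl (poch B (suc k)) (qfac (suc k) ⁻¹) (w ^ suc k) (1# - Q′) (1# - Q * B) q ⟩
      (poch B (suc k) * (1# - Q * B)) * (qfac (suc k) ⁻¹ * (1# - Q′)) * (w ^ suc k * q)
        ≈⟨ *-congʳ (*-cong poch-shift² qfac-shift) ⟩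
      ((1# - B) * ((1# - q * B) * poch (q * (q * B)) k)) * (- Q′ * qfac k ⁻¹) * (w ^ suc k * q)
        ≈⟨ solve 8 (λ x y P Q′ F W w q → (x :* (y :* P)) :* (:- Q′ :* F) :* (w :* W :* q)
                                          := :- w :* (x :* y) :* (P :* F :* (W :* (q :* Q′))))
             refl (1# - B) (1# - q * B) (poch (q * (q * B)) k) Q′ (qfac k ⁻¹) (w ^ k) w q ⟩
      - w * ((1# - B) * (1# - q * B)) * (poch (q * (q * B)) k * qfac k ⁻¹ * (w ^ k * (q * Q′)))
        ≈⟨ *-congˡ (*-cong (*-congʳ (poch-cong k base-q)) w^k*q*Q′) ⟩
      - w * ((1# - B) * (1# - q * B)) * R (q * t) k ∎
      where
      B  = base t
      Q  = q ^ suc k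
      Q′ = (q ⁻¹) ^ suc k
      w  = a * t ⁻¹

      poch-shift² : poch B (suc k) * (1# - Q * B) ≈ (1# - B) * ((1# - q * B) * poch (q * (q * B)) k)
      poch-shift² = trans (poch-suc-shift B (suc k)) (*-congˡ (poch-suc-shift (q * B) k))

      qfac-shift : qfac (suc k) ⁻¹ * (1# - Q′) ≈ - Q′ * qfac k ⁻¹
      qfac-shift = x≈y*[z*z⁻¹]⇒x≈y (1-qᵏq≉0 k) (begin
        qfac (suc k) ⁻¹ * (1# - Q′)
          ≈⟨ *-congʳ (qfac-suc⁻¹ k) ⟩
        qfac k ⁻¹ * f ⁻¹ * (1# - Q′)
          ≈⟨ solve 5 (λ P f′ q qᵏ Q′ → P :* f′ :* (con (+ 1) :- Q′)
               := :- Q′ :* P :* ((con (+ 1) :- qᵏ :* q) :* f′) :+ (:- (P :* f′)) :* (q :* qᵏ :* Q′ :- con (+ 1)))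
              refl (qfac k ⁻¹) (f ⁻¹) q (q ^ k) Q′ ⟩
        - Q′ * qfac k ⁻¹ * (f * f ⁻¹) + _ * (Q * Q′ - 1#)
          ≈⟨ x+c*[y-z]≈x _ _ (x^n*x⁻¹^n≈1 (suc k) q≉0) ⟩
        - Q′ * qfac k ⁻¹ * (f * f ⁻¹) ∎)
        where f = 1# - q ^ k * q

      base-q : q * (q * B) ≈ base (q * t)
      base-q = solve 3 (λ q t A → q :* (q :* (q :* t :* t :* A)) := q :* (q :* t) :* (q :* t) :* A) refl q t ((a * a) ⁻¹)

      w^k*q*Q′ : w ^ k * (q * Q′) ≈ (a / (q * t)) ^ k
      w^k*q*Q′ = begin
        w ^ k * (q * (q ⁻¹ * (q ⁻¹) ^ k))
          ≈⟨ solve 4 (λ W q q′ Q′ → W :* (q :* (q′ :* Q′)) := W :* Q′ :* (q :* q′)) refl (w ^ k) q (q ⁻¹) ((q ⁻¹) ^ k) ⟩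
        w ^ k * (q ⁻¹) ^ k * (q * q ⁻¹)
          ≈⟨ x≈y*[z*z⁻¹]⇒x≈y q≉0 refl ⟩
        w ^ k * (q ⁻¹) ^ k
          ≈⟨ ^-distribʳ-* w (q ⁻¹) k ⟨
        (w * q ⁻¹) ^ k
          ≈⟨ ^-cong k a/qt ⟩
        (a / (q * t)) ^ k ∎
        where
        a/qt : w * q ⁻¹ ≈ a / (q * t)
        a/qt = trans (solve 3 (λ a t′ q′ → a :* t′ :* q′ := a :* (q′ :* t′)) refl a (t ⁻¹) (q ⁻¹))
                     (*-congˡ (sym (⁻¹-distrib-* q≉0 t≉0)))

module AskeyWilsonOperator {ℓ₁ ℓ₂ : Level} (F : Field ℓ₁ ℓ₂) where
  open EulerProducts F public

  -- Both halves of the Askey–Wilson operator are T - 1 with T diagonal on the monomials x^{-λ+n}.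
  diagonal : (ℕ → Carrier) → Series → Series
  diagonal μ g n = μ n * g n - g n

  diagonal-⊕ : ∀ μ f g → diagonal μ (f ⊕ g) ≋ diagonal μ f ⊕ diagonal μ g
  diagonal-⊕ μ f g k = solve 3 (λ m x y → m :* (x :+ y) :- (x :+ y) := (m :* x :- x) :+ (m :* y :- y)) refl (μ k) (f k) (g k)

  diagonal-⊖ : ∀ μ f g → diagonal μ (f ⊖ g) ≋ diagonal μ f ⊖ diagonal μ g
  diagonal-⊖ μ f g k = solve 3 (λ m x y → m :* (x :- y) :- (x :- y) := (m :* x :- x) :- (m :* y :- y)) refl (μ k) (f k) (g k)

  diagonal-· : ∀ μ c f → diagonal μ (c · f) ≋ c · diagonal μ f
  diagonal-· μ c f k = solve 3 (λ m c x → m :* (c :* x) :- c :* x := c :* (m :* x :- x)) refl (μ k) c (f k)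

  diagonal-0ₛ : ∀ μ → diagonal μ 0ₛ ≋ 0ₛ
  diagonal-0ₛ μ k = solve 1 (λ m → m :* con (+ 0) :- con (+ 0) := con (+ 0)) refl (μ k)

  module Properties (a b c d q : Carrier) (q≉0 : q ≉ 0#) where

    coefA coefB : Series
    coefA = Defs.coefA F a b c d q
    coefB = Defs.coefB F a b c d q

    AW : Carrier → Series → Series
    AW = Defs.AWop F a b c d q

    ev : Carrier → Carrier
    ev = Defs.eigenvalue F a b c d q

    private
      μ⁺ μ⁻ : Carrier → ℕ → Carrier
      μ⁺ t k = t * q ^ k
      μ⁻ t k = (t * q ^ k) ⁻¹

    AW-⊕ : ∀ t f g → AW t (f ⊕ g) ≋ AW t f ⊕ AW t g
    AW-⊕ t f g n = begin
      (coefA ⊛ diagonal (μ⁺ t) (f ⊕ g)) n + (coefB ⊛ diagonal (μ⁻ t) (f ⊕ g)) n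
        ≈⟨ +-cong (⊛-congˡ (diagonal-⊕ (μ⁺ t) f g) n) (⊛-congˡ (diagonal-⊕ (μ⁻ t) f g) n) ⟩
      (coefA ⊛ (A f ⊕ A g)) n + (coefB ⊛ (B f ⊕ B g)) n
        ≈⟨ +-cong (⊛-distribˡ-⊕ coefA (A f) (A g) n) (⊛-distribˡ-⊕ coefB (B f) (B g) n) ⟩
      ((coefA ⊛ A f) n + (coefA ⊛ A g) n) + ((coefB ⊛ B f) n + (coefB ⊛ B g) n)
        ≈⟨ solve 4 (λ x y z w → (x :+ y) :+ (z :+ w) := (x :+ z) :+ (y :+ w)) refl _ _ _ _ ⟩
      AW t f n + AW t g n ∎
      where A = diagonal (μ⁺ t); B = diagonal (μ⁻ t)

    AW-⊖ : ∀ t f g → AW t (f ⊖ g) ≋ AW t f ⊖ AW t g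
    AW-⊖ t f g n = begin
      (coefA ⊛ diagonal (μ⁺ t) (f ⊖ g)) n + (coefB ⊛ diagonal (μ⁻ t) (f ⊖ g)) n
        ≈⟨ +-cong (⊛-congˡ (diagonal-⊖ (μ⁺ t) f g) n) (⊛-congˡ (diagonal-⊖ (μ⁻ t) f g) n) ⟩
      (coefA ⊛ (A f ⊖ A g)) n + (coefB ⊛ (B f ⊖ B g)) n
        ≈⟨ +-cong (⊛-distribˡ-⊖ coefA (A f) (A g) n) (⊛-distribˡ-⊖ coefB (B f) (B g) n) ⟩
      ((coefA ⊛ A f) n - (coefA ⊛ A g) n) + ((coefB ⊛ B f) n - (coefB ⊛ B g) n)
        ≈⟨ solve 4 (λ x y z w → (x :- y) :+ (z :- w) := (x :+ z) :- (y :+ w)) refl _ _ _ _ ⟩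
      AW t f n - AW t g n ∎
      where A = diagonal (μ⁺ t); B = diagonal (μ⁻ t)

    AW-· : ∀ t c f → AW t (c · f) ≋ c · AW t f
    AW-· t c f n = begin
      (coefA ⊛ diagonal (μ⁺ t) (c · f)) n + (coefB ⊛ diagonal (μ⁻ t) (c · f)) n
        ≈⟨ +-cong (⊛-congˡ (diagonal-· (μ⁺ t) c f) n) (⊛-congˡ (diagonal-· (μ⁻ t) c f) n) ⟩
      (coefA ⊛ (c · A f)) n + (coefB ⊛ (c · B f)) n
        ≈⟨ +-cong (⊛-·ʳ c coefA (A f) n) (⊛-·ʳ c coefB (B f) n) ⟩
      c * (coefA ⊛ A f) n + c * (coefB ⊛ B f) n
        ≈⟨ distribˡ c _ _ ⟨
      c * AW t f n ∎
      where A = diagonal (μ⁺ t); B = diagonal (μ⁻ t)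

    AW-0ₛ : ∀ t → AW t 0ₛ ≋ 0ₛ
    AW-0ₛ t n = trans (+-cong (vanish coefA (μ⁺ t)) (vanish coefB (μ⁻ t))) (+-identityʳ 0#)
      where
      vanish : ∀ C μ → (C ⊛ diagonal μ 0ₛ) n ≈ 0#
      vanish C μ = trans (⊛-congˡ (diagonal-0ₛ μ) n) (Σ<-zero (suc n) (λ k _ → zeroʳ _))

    AW-Σₛ : ∀ t N g → AW t (Σₛ N g) ≋ Σₛ N (λ m → AW t (g m))
    AW-Σₛ t zero    g = AW-0ₛ t
    AW-Σₛ t (suc N) g = ≋-trans (AW-⊕ t (Σₛ N g) (g N)) (⊕-cong (AW-Σₛ t N g) (≋-refl {AW t (g N)}))

    AW-cong-≤ : ∀ t f g n → (∀ k → k ≤ n → f k ≈ g k) → AW t f n ≈ AW t g n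
    AW-cong-≤ t f g n f≈g = +-cong (⊛-cong-≤ coefA n (λ k k≤n → diag (μ⁺ t) k (f≈g k k≤n)))
                                   (⊛-cong-≤ coefB n (λ k k≤n → diag (μ⁻ t) k (f≈g k k≤n)))
      where
      diag : ∀ μ k → f k ≈ g k → diagonal μ f k ≈ diagonal μ g k
      diag μ k fk≈gk = +-cong (*-congˡ fk≈gk) (-‿cong fk≈gk)

    AW-cong-parameter : ∀ {t t′} f → t ≉ 0# → t ≈ t′ → AW t f ≋ AW t′ f
    AW-cong-parameter {t} {t′} f t≉0 t≈t′ n =
      +-cong (⊛-congˡ {coefA} {diagonal (μ⁺ t) f} {diagonal (μ⁺ t′) f} (λ k → +-congʳ (*-congʳ (*-congʳ t≈t′))) n)
             (⊛-congˡ {coefB} {diagonal (μ⁻ t) f} {diagonal (μ⁻ t′) f}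
                      (λ k → +-congʳ (*-congʳ (⁻¹-cong (*-≉0 t≉0 (^-≉0 k q≉0)) (*-congʳ t≈t′)))) n)

    AW-shift : ∀ t g → t ≉ 0# → AW t (shift g) ≋ shift (AW (t * q) g)
    AW-shift t g t≉0 =
      AW t (shift g)
        ≋⟨ ⊕-cong (⊛-congˡ A-shift) (⊛-congˡ B-shift) ⟩
      coefA ⊛ shift (diagonal (μ⁺ tq) g) ⊕ coefB ⊛ shift (diagonal (μ⁻ tq) g)
        ≋⟨ ⊕-cong (⊛-shiftʳ coefA _) (⊛-shiftʳ coefB _) ⟩
      shift (coefA ⊛ diagonal (μ⁺ tq) g) ⊕ shift (coefB ⊛ diagonal (μ⁻ tq) g)
        ≋⟨ shift-⊕ _ _ ⟩
      shift (AW tq g) ≋∎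
      where
      tq = t * q
      A-shift : diagonal (μ⁺ t) (shift g) ≋ shift (diagonal (μ⁺ tq) g)
      A-shift zero    = diagonal-0ₛ (μ⁺ t) 0
      A-shift (suc k) = +-congʳ (*-congʳ (sym (*-assoc t q (q ^ k))))
      B-shift : diagonal (μ⁻ t) (shift g) ≋ shift (diagonal (μ⁻ tq) g)
      B-shift zero    = diagonal-0ₛ (μ⁻ t) 0
      B-shift (suc k) = +-congʳ (*-congʳ (⁻¹-cong (*-≉0 t≉0 (^-≉0 (suc k) q≉0)) (sym (*-assoc t q (q ^ k)))))

    AW-shiftBy : ∀ t m g → t ≉ 0# → AW t (shiftBy m g) ≋ shiftBy m (AW (t * q ^ m) g)
    AW-shiftBy t zero    g t≉0 = AW-cong-parameter g t≉0 (sym (*-identityʳ t))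
    AW-shiftBy t (suc m) g t≉0 = ≋-trans (AW-shift t (shiftBy m g) t≉0) (shift-cong (≋-trans
      (AW-shiftBy (t * q) m g (*-≉0 t≉0 q≉0))
      (shiftBy-cong m (AW-cong-parameter g (*-≉0 (*-≉0 t≉0 q≉0) (^-≉0 m q≉0)) (*-assoc t q (q ^ m))))))

    ev-cong : ∀ {u v} → u ≉ 0# → u ≈ v → ev u ≈ ev v
    ev-cong u≉0 u≈v = +-congʳ (+-congʳ (+-cong u≈v (*-congˡ (⁻¹-cong (*-≉0 q≉0 u≉0) (*-congˡ u≈v)))))

    ev-difference : ∀ u v → u ≉ 0# → v ≉ 0# → (ev u - ev v) * (q * u * v) ≈ (u - v) * (q * u * v - a * b * c * d)
    ev-difference u v u≉0 v≉0 = begin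
      (ev u - ev v) * (q * u * v)
        ≈⟨ *-congʳ (+-cong (+-congʳ (+-congʳ (+-congˡ (*-congˡ (⁻¹-distrib-* q≉0 u≉0)))))
            (-‿cong (+-congʳ (+-congʳ (+-congˡ (*-congˡ (⁻¹-distrib-* q≉0 v≉0))))))) ⟩
      ((u + e * (q′ * u′) - 1# - e * q′) - (v + e * (q′ * v′) - 1# - e * q′)) * (q * u * v)
        ≈⟨ solve 7 (λ e q u v q′ u′ v′ →
            ((u :+ e :* (q′ :* u′) :- con (+ 1) :- e :* q′) :- (v :+ e :* (q′ :* v′) :- con (+ 1) :- e :* q′)) :* (q :* u :* v)
            := (u :- v) :* (q :* u :* v :- e)
               :+ (:- (e :* u)) :* (v :* v′ :- con (+ 1))
               :+ (:- (e :* u :* (v :* v′))) :* (q :* q′ :- con (+ 1))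
               :+ (e :* v) :* (u :* u′ :- con (+ 1))
               :+ (e :* v :* (u :* u′)) :* (q :* q′ :- con (+ 1)))
            refl e q u v q′ u′ v′ ⟩
      (u - v) * (q * u * v - e) + _ * (v * v′ - 1#) + _ * (q * q′ - 1#) + _ * (u * u′ - 1#) + _ * (q * q′ - 1#)
        ≈⟨ x+c*[y-z]≈x _ _ (⁻¹-inverseʳ q≉0) ⟨ trans ⟩ x+c*[y-z]≈x _ _ (⁻¹-inverseʳ u≉0)
            ⟨ trans ⟩ x+c*[y-z]≈x _ _ (⁻¹-inverseʳ q≉0) ⟨ trans ⟩ x+c*[y-z]≈x _ _ (⁻¹-inverseʳ v≉0) ⟩
      (u - v) * (q * u * v - e) ∎
      where
      e  = a * b * c * d
      q′ = q ⁻¹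
      u′ = u ⁻¹
      v′ = v ⁻¹

    private
      om mx : Carrier → Series
      om = Defs.oneMinus F
      mx = Defs.minusX F

      ⊛⁶-zeroth : ∀ f₁ f₂ f₃ f₄ f₅ f₆ →
                  (f₁ ⊛ f₂ ⊛ f₃ ⊛ f₄ ⊛ f₅ ⊛ f₆) 0 ≈ f₁ 0 * f₂ 0 * f₃ 0 * f₄ 0 * f₅ 0 * f₆ 0
      ⊛⁶-zeroth f₁ f₂ f₃ f₄ f₅ f₆ =
        trans (⊛-zeroth (f₁ ⊛ f₂ ⊛ f₃ ⊛ f₄ ⊛ f₅) f₆) (*-congʳ (
        trans (⊛-zeroth (f₁ ⊛ f₂ ⊛ f₃ ⊛ f₄) f₅) (*-congʳ (
        trans (⊛-zeroth (f₁ ⊛ f₂ ⊛ f₃) f₄) (*-congʳ (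
        trans (⊛-zeroth (f₁ ⊛ f₂) f₃) (*-congʳ (⊛-zeroth f₁ f₂))))))))

    coefA-0 : coefA 0 ≈ 1#
    coefA-0 = trans (⊛⁶-zeroth (om a) (om b) (om c) (om d) (Defs.geom2 F 1#) (Defs.geom2 F q))
      (solve 0 (con (+ 1) :* con (+ 1) :* con (+ 1) :* con (+ 1) :* con (+ 1) :* con (+ 1) := con (+ 1)) refl)

    coefB-0 : coefB 0 ≈ a * b * c * d / q
    coefB-0 = trans (⊛⁶-zeroth (mx a) (mx b) (mx c) (mx d) (Defs.geom2 F 1#) (λ n → q ⁻¹ * Defs.geom2 F (q ⁻¹) n))
      (solve 5 (λ a b c d q′ → a :* b :* c :* d :* con (+ 1) :* (q′ :* con (+ 1)) := a :* b :* c :* d :* q′) refl a b c d (q ⁻¹))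

    AW-vanishing-prefix : ∀ t h N → (∀ k → k < N → h k ≈ 0#) →
      AW t h N ≈ (coefA 0 * (t * q ^ N - 1#) + coefB 0 * ((t * q ^ N) ⁻¹ - 1#)) * h N
    AW-vanishing-prefix t h N h≈0 = begin
      (coefA ⊛ diagonal (μ⁺ t) h) N + (coefB ⊛ diagonal (μ⁻ t) h) N
        ≈⟨ +-cong (⊛-vanishing-prefix coefA _ N (diagonal-≈0 (μ⁺ t))) (⊛-vanishing-prefix coefB _ N (diagonal-≈0 (μ⁻ t))) ⟩
      coefA 0 * (μ⁺ t N * h N - h N) + coefB 0 * (μ⁻ t N * h N - h N)
        ≈⟨ solve 5 (λ A B m⁺ m⁻ x → A :* (m⁺ :* x :- x) :+ B :* (m⁻ :* x :- x) := (A :* (m⁺ :- con (+ 1)) :+ B :* (m⁻ :- con (+ 1))) :* x)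
            refl (coefA 0) (coefB 0) (μ⁺ t N) (μ⁻ t N) (h N) ⟩
      (coefA 0 * (t * q ^ N - 1#) + coefB 0 * ((t * q ^ N) ⁻¹ - 1#)) * h N ∎
      where
      diagonal-≈0 : ∀ μ k → k < N → diagonal μ h k ≈ 0#
      diagonal-≈0 μ k k<N = trans (+-cong (*-congˡ (h≈0 k k<N)) (-‿cong (h≈0 k k<N))) (diagonal-0ₛ μ k)

    -- The recursion for the coefficients of an eigenvector with eigenvalue ev s
    -- has leading factor (qᴺ - 1)(q qᴺ s² - abcd), up to the unit q s qᴺ.
    eigen-leading-factor : ∀ s N → s ≉ 0# →
      (coefA 0 * (s * q ^ N - 1#) + coefB 0 * ((s * q ^ N) ⁻¹ - 1#) - ev s) * (q * s * q ^ N)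
        ≈ (q ^ N - 1#) * (q * q ^ N * s * s - a * b * c * d)
    eigen-leading-factor s N s≉0 = begin
      (coefA 0 * (s * Q - 1#) + coefB 0 * ((s * Q) ⁻¹ - 1#) - (s + e * (q * s) ⁻¹ - 1# - e * q′)) * (q * s * Q)
        ≈⟨ *-congʳ (+-cong (+-cong (*-congʳ coefA-0) (*-cong coefB-0 (+-congʳ sQ⁻¹)))
            (-‿cong (+-congʳ (+-congʳ (+-congˡ (*-congˡ (⁻¹-distrib-* q≉0 s≉0))))))) ⟩
      (1# * (s * Q - 1#) + e * q′ * (s′ * Q′ - 1#) - (s + e * (q′ * s′) - 1# - e * q′)) * (q * s * Q)
        ≈⟨ solve 7 (λ e q s Q q′ s′ Q′ →
            (con (+ 1) :* (s :* Q :- con (+ 1)) :+ e :* q′ :* (s′ :* Q′ :- con (+ 1))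
               :- (s :+ e :* (q′ :* s′) :- con (+ 1) :- e :* q′)) :* (q :* s :* Q)
            := (Q :- con (+ 1)) :* (q :* Q :* s :* s :- e)
               :+ (:- (e :* Q)) :* (s :* s′ :- con (+ 1))
               :+ (:- (e :* Q :* (s :* s′))) :* (q :* q′ :- con (+ 1))
               :+ e :* (Q :* Q′ :- con (+ 1))
               :+ e :* (Q :* Q′) :* (s :* s′ :- con (+ 1))
               :+ e :* (s :* s′) :* (Q :* Q′) :* (q :* q′ :- con (+ 1)))
            refl e q s Q q′ s′ Q′ ⟩
      (Q - 1#) * (q * Q * s * s - e)
        + (- (e * Q)) * (s * s′ - 1#)
        + (- (e * Q * (s * s′))) * (q * q′ - 1#)
        + e * (Q * Q′ - 1#)
        + e * (Q * Q′) * (s * s′ - 1#)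
        + e * (s * s′) * (Q * Q′) * (q * q′ - 1#)
        ≈⟨ x+c*[y-z]≈x _ _ (⁻¹-inverseʳ q≉0) ⟨ trans ⟩ x+c*[y-z]≈x _ _ (⁻¹-inverseʳ s≉0)
            ⟨ trans ⟩ x+c*[y-z]≈x _ _ (x^n*x⁻¹^n≈1 N q≉0) ⟨ trans ⟩ x+c*[y-z]≈x _ _ (⁻¹-inverseʳ q≉0)
            ⟨ trans ⟩ x+c*[y-z]≈x _ _ (⁻¹-inverseʳ s≉0) ⟩
      (Q - 1#) * (q * Q * s * s - e) ∎
      where
      e  = a * b * c * d
      Q  = q ^ N
      q′ = q ⁻¹
      s′ = s ⁻¹
      Q′ = (q ⁻¹) ^ N
      sQ⁻¹ : (s * Q) ⁻¹ ≈ s′ * Q′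
      sQ⁻¹ = trans (⁻¹-distrib-* s≉0 (^-≉0 N q≉0)) (*-congˡ (^-⁻¹ N q≉0))

    eigenvector-unique : ∀ {s} f g → s ≉ 0# → (∀ k → q ^ suc k ≉ 1#) →
      (∀ k → q * q ^ suc k * s * s ≉ a * b * c * d) →
      IsEigen F a b c d q s f → IsEigen F a b c d q s g → f 0 ≈ g 0 → f ≋ g
    eigenvector-unique {s} f g s≉0 qᵏ⁺¹≉1 q²⁺ᵏs²≉abcd f-eigen g-eigen f₀≈g₀ =
      ⊖≋0ₛ⇒≋ (<-rec (λ n → (f ⊖ g) n ≈ 0#) vanish)
      where
      h = f ⊖ g

      h-eigen : ∀ n → AW s h n ≈ ev s * h n
      h-eigen n = begin
        AW s h n
          ≈⟨ AW-⊖ s f g n ⟩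
        AW s f n - AW s g n
          ≈⟨ +-cong (f-eigen n) (-‿cong (g-eigen n)) ⟩
        ev s * f n - ev s * g n
          ≈⟨ solve 3 (λ e x y → e :* x :- e :* y := e :* (x :- y)) refl (ev s) (f n) (g n) ⟩
        ev s * h n ∎

      vanish : ∀ n → (∀ {k} → k < n → h k ≈ 0#) → h n ≈ 0#
      vanish zero    _  = x≈y⇒x-y≈0 f₀≈g₀
      vanish (suc k) ih = x*y≈0⇒y≈0 L≉0 (begin
        (M - ev s) * h N      ≈⟨ solve 3 (λ M e x → (M :- e) :* x := M :* x :- e :* x) refl M (ev s) (h N) ⟩
        M * h N - ev s * h N  ≈⟨ +-congʳ (AW-vanishing-prefix s h N (λ j j<N → ih j<N)) ⟨
        AW s h N - ev s * h N ≈⟨ x≈y⇒x-y≈0 (h-eigen N) ⟩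
        0#                    ∎)
        where
        N = suc k
        Q = q ^ N
        M = coefA 0 * (s * Q - 1#) + coefB 0 * ((s * Q) ⁻¹ - 1#)
        L = M - ev s
        L≉0 : L ≉ 0#
        L≉0 L≈0 = *-≉0 (λ Q-1≈0 → qᵏ⁺¹≉1 k (x-y≈0⇒x≈y Q-1≈0)) (λ d≈0 → q²⁺ᵏs²≉abcd k (x-y≈0⇒x≈y d≈0)) (begin
          (Q - 1#) * (q * Q * s * s - a * b * c * d)
            ≈⟨ eigen-leading-factor s N s≉0 ⟨
          L * (q * s * Q)
            ≈⟨ *-congʳ L≈0 ⟩
          0# * (q * s * Q)
            ≈⟨ zeroˡ _ ⟩
          0# ∎)

module ContiguityRelation {ℓ₁ ℓ₂ : Level} (F : Field ℓ₁ ℓ₂) where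
  open AskeyWilsonOperator F public

  module BasisFunctions (a b c d q : Carrier) (a≉0 : a ≉ 0#) (q≉0 : q ≉ 0#) (qᵏ⁺¹≉1 : ∀ k → q ^ suc k ≉ 1#) where
    open QSeries a q a≉0 q≉0 qᵏ⁺¹≉1 public
    open Properties a b c d q q≉0 public

    ν : Carrier → Carrier
    ν t = (t - 1#) * (q * t - a * b) * (q * t - a * c) * (q * t - a * d) * (a * q * q * t * t) ⁻¹

    φ : Carrier → Series
    φ t = P ⊛ R t

    module AtParameter (t : Carrier) (t≉0 : t ≉ 0#) where
      ρ : Vec Carrier 6
      ρ = a ∷ b ∷ c ∷ d ∷ q ∷ t ∷ []

      open Symbolic ρ public

      𝐚 𝐛 𝐜 𝐝 𝐪 𝐭 : Coeff
      𝐚 = var #0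
      𝐛 = var (1+ #0)
      𝐜 = var (1+ (1+ #0))
      𝐝 = var (1+ (1+ (1+ #0)))
      𝐪 = var (1+ (1+ (1+ (1+ #0))))
      𝐭 = var (1+ (1+ (1+ (1+ (1+ #0)))))

      ⟨1-_x⟩ ⟨_-x⟩ : Coeff → Poly
      ⟨1- e x⟩ = 1ᶜ ∷ :- e ∷ []
      ⟨ e -x⟩  = e ∷ -1ᶜ ∷ []

      ⟨1-x²⟩ ⟨1-qx²⟩ ⟨q-x²⟩ : Poly
      ⟨1-x²⟩  = 1ᶜ ∷ 0ᶜ ∷ :- 1ᶜ ∷ []
      ⟨1-qx²⟩ = 1ᶜ ∷ 0ᶜ ∷ :- 𝐪 ∷ []
      ⟨q-x²⟩  = 𝐪 ∷ 0ᶜ ∷ -1ᶜ ∷ []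

      linear : Coeff → Coeff → Poly
      linear e₀ e₁ = e₀ ∷ e₁ ∷ []

      -- For X = P or R t, the q-difference equation ⟪ X⁺ˡ ⟫ (X (q x)) ≋ ⟪ X⁺ʳ ⟫ (X x), and ⁻ for q⁻¹.
      P⁺ˡ P⁺ʳ R⁺ˡ R⁺ʳ P⁻ˡ P⁻ʳ R⁻ˡ R⁻ʳ : Poly
      P⁺ˡ = linear 𝐚 (:- (𝐚 :* 𝐚))
      P⁺ʳ = linear 𝐚 (:- 𝐪)
      R⁺ˡ = linear (𝐭 :* 𝐚) (:- (𝐪 :* 𝐭 :* 𝐭))
      R⁺ʳ = linear (𝐚 :* 𝐭) (:- (𝐚 :* 𝐚))
      P⁻ˡ = linear (𝐪 :* 𝐚) (:- 𝐪)
      P⁻ʳ = linear (𝐪 :* 𝐚) (:- (𝐚 :* 𝐚))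
      R⁻ˡ = linear (𝐪 :* (𝐚 :* 𝐭)) (:- (𝐚 :* 𝐚))
      R⁻ʳ = linear (𝐪 :* (𝐭 :* 𝐚)) (:- (𝐪 :* 𝐭 :* 𝐭))

      φ-qdiff : ⟪ P⁺ˡ ⟫ (⟪ R⁺ˡ ⟫ (dilate q (φ t))) ≋ ⟪ P⁺ʳ ⟫ (⟪ R⁺ʳ ⟫ (φ t))
      φ-qdiff = qdiff-⊛ q P⁺ˡ P⁺ʳ R⁺ˡ R⁺ʳ P (R t)
        (⟪⟫-linear-≋ 𝐚 (:- (𝐚 :* 𝐚)) 𝐚 (:- 𝐪) P-qdiff)
        (⟪⟫-linear-≋ (𝐭 :* 𝐚) (:- (𝐪 :* 𝐭 :* 𝐭)) (𝐚 :* 𝐭) (:- (𝐚 :* 𝐚)) (R-qdiff t t≉0))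

      φ-qdiff⁻¹ : ⟪ P⁻ˡ ⟫ (⟪ R⁻ˡ ⟫ (dilate (q ⁻¹) (φ t))) ≋ ⟪ P⁻ʳ ⟫ (⟪ R⁻ʳ ⟫ (φ t))
      φ-qdiff⁻¹ = qdiff-⊛ (q ⁻¹) P⁻ˡ P⁻ʳ R⁻ˡ R⁻ʳ P (R t)
        (⟪⟫-linear-≋ (𝐪 :* 𝐚) (:- 𝐪) (𝐪 :* 𝐚) (:- (𝐚 :* 𝐚)) P-qdiff⁻¹)
        (⟪⟫-linear-≋ (𝐪 :* (𝐚 :* 𝐭)) (:- (𝐚 :* 𝐚)) (𝐪 :* (𝐭 :* 𝐚)) (:- (𝐪 :* 𝐭 :* 𝐭)) (R-qdiff⁻¹ t t≉0))

      cR : Coeff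
      cR = 𝐭 :* 𝐚 :* (𝐪 :* (𝐚 :* 𝐭))

      -- Both sides satisfy the q-difference equation of R t and agree at x⁰.
      R-contiguous : ⟪ R⁺ˡ ⟫ (⟪ R⁻ˡ ⟫ (R (q * t))) ≋ ⟦ cR ⟧ᶜ · R t
      R-contiguous = ⊖≋0ₛ⇒≋ (qdiff-unique nonzero X⊖Y-qdiff X₀≈Y₀)
        where
        R′ X Y : Series
        R′ = R (q * t)
        X  = ⟪ R⁺ˡ ⟫ (⟪ R⁻ˡ ⟫ R′)
        Y  = ⟦ cR ⟧ᶜ · R t

        R⁺ˡ′ R⁺ʳ′ : Poly
        R⁺ˡ′ = linear (𝐪 :* 𝐭 :* 𝐚) (:- (𝐪 :* (𝐪 :* 𝐭) :* (𝐪 :* 𝐭)))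
        R⁺ʳ′ = linear (𝐚 :* (𝐪 :* 𝐭)) (:- (𝐚 :* 𝐚))

        X-qdiff : mulLinear (t * a) (- (q * t * t)) (dilate q X) ≋ mulLinear (a * t) (- (a * a)) X
        X-qdiff = ·-cancelˡ q≉0 (
          q · mulLinear (t * a) (- (q * t * t)) (dilate q X)
            ≋⟨ ·-congˡ (≋-sym (⟪⟫-linear (𝐭 :* 𝐚) (:- (𝐪 :* 𝐭 :* 𝐭)) (dilate q X))) ⟩
          q · ⟪ R⁺ˡ ⟫ (dilate q X)
            ≋⟨ ·-congˡ (⟪⟫-cong R⁺ˡ (≋-trans (dilate-⟪⟫ 𝐪 R⁺ˡ (⟪ R⁻ˡ ⟫ R′))
                (⟪⟫-cong (dilateᵖ 𝐪 R⁺ˡ) (dilate-⟪⟫ 𝐪 R⁻ˡ R′)))) ⟩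
          q · ⟪ R⁺ˡ ⟫ (⟪ dilateᵖ 𝐪 R⁺ˡ ⟫ (⟪ dilateᵖ 𝐪 R⁻ˡ ⟫ (dilate q R′)))
            ≋⟨ ≋-sym (⟪⟫-scale 𝐪 R⁺ˡ _) ⟩
          ⟪ scale 𝐪 R⁺ˡ ⟫ (⟪ dilateᵖ 𝐪 R⁺ˡ ⟫ (⟪ dilateᵖ 𝐪 R⁻ˡ ⟫ (dilate q R′)))
            ≋⟨ ≋-sym (⟪⟫-⊠³ (scale 𝐪 R⁺ˡ) (dilateᵖ 𝐪 R⁺ˡ) (dilateᵖ 𝐪 R⁻ˡ) (dilate q R′)) ⟩
          ⟪ scale 𝐪 R⁺ˡ ⊠ (dilateᵖ 𝐪 R⁺ˡ ⊠ dilateᵖ 𝐪 R⁻ˡ) ⟫ (dilate q R′)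
            ≋⟨ ≋-by-coefficients (scale 𝐪 R⁺ˡ ⊠ (dilateᵖ 𝐪 R⁺ˡ ⊠ dilateᵖ 𝐪 R⁻ˡ))
                ((R⁺ˡ ⊠ dilateᵖ 𝐪 R⁻ˡ) ⊠ R⁺ˡ′) (refl ∷ refl ∷ refl ∷ refl ∷ []) (dilate q R′) ⟩
          ⟪ (R⁺ˡ ⊠ dilateᵖ 𝐪 R⁻ˡ) ⊠ R⁺ˡ′ ⟫ (dilate q R′)
            ≋⟨ ⟪⟫-⊠ (R⁺ˡ ⊠ dilateᵖ 𝐪 R⁻ˡ) R⁺ˡ′ (dilate q R′) ⟩
          ⟪ R⁺ˡ ⊠ dilateᵖ 𝐪 R⁻ˡ ⟫ (⟪ R⁺ˡ′ ⟫ (dilate q R′))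
            ≋⟨ ⟪⟫-cong (R⁺ˡ ⊠ dilateᵖ 𝐪 R⁻ˡ)
                (⟪⟫-linear-≋ (𝐪 :* 𝐭 :* 𝐚) (:- (𝐪 :* (𝐪 :* 𝐭) :* (𝐪 :* 𝐭)))
                             (𝐚 :* (𝐪 :* 𝐭)) (:- (𝐚 :* 𝐚)) (R-qdiff (q * t) (*-≉0 q≉0 t≉0))) ⟩
          ⟪ R⁺ˡ ⊠ dilateᵖ 𝐪 R⁻ˡ ⟫ (⟪ R⁺ʳ′ ⟫ R′)
            ≋⟨ ≋-sym (⟪⟫-⊠ (R⁺ˡ ⊠ dilateᵖ 𝐪 R⁻ˡ) R⁺ʳ′ R′) ⟩
          ⟪ (R⁺ˡ ⊠ dilateᵖ 𝐪 R⁻ˡ) ⊠ R⁺ʳ′ ⟫ R′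
            ≋⟨ ≋-by-coefficients ((R⁺ˡ ⊠ dilateᵖ 𝐪 R⁻ˡ) ⊠ R⁺ʳ′) (scale 𝐪 (R⁺ʳ ⊠ (R⁺ˡ ⊠ R⁻ˡ)))
                (refl ∷ refl ∷ refl ∷ refl ∷ []) R′ ⟩
          ⟪ scale 𝐪 (R⁺ʳ ⊠ (R⁺ˡ ⊠ R⁻ˡ)) ⟫ R′
            ≋⟨ ≋-trans (⟪⟫-scale 𝐪 (R⁺ʳ ⊠ (R⁺ˡ ⊠ R⁻ˡ)) R′) (·-congˡ (⟪⟫-⊠³ R⁺ʳ R⁺ˡ R⁻ˡ R′)) ⟩
          q · ⟪ R⁺ʳ ⟫ X
            ≋⟨ ·-congˡ (⟪⟫-linear (𝐚 :* 𝐭) (:- (𝐚 :* 𝐚)) X) ⟩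
          q · mulLinear (a * t) (- (a * a)) X ≋∎)

        Y-qdiff : mulLinear (t * a) (- (q * t * t)) (dilate q Y) ≋ mulLinear (a * t) (- (a * a)) Y
        Y-qdiff =
          mulLinear (t * a) (- (q * t * t)) (dilate q Y)
            ≋⟨ mulLinear-congʳ (dilate-· q ⟦ cR ⟧ᶜ (R t)) ⟩
          mulLinear (t * a) (- (q * t * t)) (⟦ cR ⟧ᶜ · dilate q (R t))
            ≋⟨ mulLinear-· (t * a) (- (q * t * t)) ⟦ cR ⟧ᶜ (dilate q (R t)) ⟩
          ⟦ cR ⟧ᶜ · mulLinear (t * a) (- (q * t * t)) (dilate q (R t))
            ≋⟨ ·-congˡ (R-qdiff t t≉0) ⟩
          ⟦ cR ⟧ᶜ · mulLinear (a * t) (- (a * a)) (R t)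
            ≋⟨ ≋-sym (mulLinear-· (a * t) (- (a * a)) ⟦ cR ⟧ᶜ (R t)) ⟩
          mulLinear (a * t) (- (a * a)) Y ≋∎

        X⊖Y-qdiff : mulLinear (t * a) (- (q * t * t)) (dilate q (X ⊖ Y)) ≋ mulLinear (a * t) (- (a * a)) (X ⊖ Y)
        X⊖Y-qdiff =
          mulLinear (t * a) (- (q * t * t)) (dilate q (X ⊖ Y))
            ≋⟨ mulLinear-congʳ (dilate-⊖ q X Y) ⟩
          mulLinear (t * a) (- (q * t * t)) (dilate q X ⊖ dilate q Y)
            ≋⟨ mulLinear-⊖ (t * a) (- (q * t * t)) (dilate q X) (dilate q Y) ⟩
          mulLinear (t * a) (- (q * t * t)) (dilate q X) ⊖ mulLinear (t * a) (- (q * t * t)) (dilate q Y)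
            ≋⟨ ⊖-cong X-qdiff Y-qdiff ⟩
          mulLinear (a * t) (- (a * a)) X ⊖ mulLinear (a * t) (- (a * a)) Y
            ≋⟨ ≋-sym (mulLinear-⊖ (a * t) (- (a * a)) X Y) ⟩
          mulLinear (a * t) (- (a * a)) (X ⊖ Y) ≋∎

        nonzero : ∀ n → t * a * q ^ suc n - a * t ≉ 0#
        nonzero n ≈0 = qᵏ⁺¹≉1 n (x-y≈0⇒x≈y (x*y≈0⇒y≈0 (*-≉0 a≉0 t≉0) (trans
          (solve 3 (λ t a Q → (a :* t) :* (Q :- con (+ 1)) := t :* a :* Q :- a :* t) refl t a (q ^ suc n)) ≈0)))

        X₀≈Y₀ : X 0 - Y 0 ≈ 0#
        X₀≈Y₀ = begin
          t * a * (q * (a * t) * R′ 0 + 0#) + 0# - cR₀ * R t 0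
            ≈⟨ solve 6 (λ t a q c R′₀ R₀ → t :* a :* (q :* (a :* t) :* R′₀ :+ con (+ 0)) :+ con (+ 0) :- c :* R₀
                         := t :* a :* (q :* (a :* t)) :* R′₀ :- c :* R₀)
                refl t a q cR₀ (R′ 0) (R t 0) ⟩
          cR₀ * R′ 0 - cR₀ * R t 0
            ≈⟨ +-cong (*-congˡ (R-0 (q * t))) (-‿cong (*-congˡ (R-0 t))) ⟩
          cR₀ * 1# - cR₀ * 1#
            ≈⟨ -‿inverseʳ _ ⟩
          0# ∎
          where cR₀ = ⟦ cR ⟧ᶜ

      φ-contiguous : ⟪ R⁺ˡ ⟫ (⟪ R⁻ˡ ⟫ (φ (q * t))) ≋ ⟦ cR ⟧ᶜ · φ t
      φ-contiguous =
        ⟪ R⁺ˡ ⟫ (⟪ R⁻ˡ ⟫ (P ⊛ R (q * t)))    ≋⟨ ⟪⟫-cong R⁺ˡ (⟪⟫-⊛ʳ R⁻ˡ P (R (q * t))) ⟩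
        ⟪ R⁺ˡ ⟫ (P ⊛ ⟪ R⁻ˡ ⟫ (R (q * t)))    ≋⟨ ⟪⟫-⊛ʳ R⁺ˡ P (⟪ R⁻ˡ ⟫ (R (q * t))) ⟩
        P ⊛ ⟪ R⁺ˡ ⟫ (⟪ R⁻ˡ ⟫ (R (q * t)))    ≋⟨ ⊛-congˡ R-contiguous ⟩
        P ⊛ (⟦ cR ⟧ᶜ · R t)                  ≋⟨ ⊛-·ʳ ⟦ cR ⟧ᶜ P (R t) ⟩
        ⟦ cR ⟧ᶜ · φ t                        ≋∎

      NA NB : Poly
      NA = ⟨1- 𝐚 x⟩ ⊠ (⟨1- 𝐛 x⟩ ⊠ (⟨1- 𝐜 x⟩ ⊠ ⟨1- 𝐝 x⟩))
      NB = ⟨ 𝐚 -x⟩ ⊠ (⟨ 𝐛 -x⟩ ⊠ (⟨ 𝐜 -x⟩ ⊠ ⟨ 𝐝 -x⟩))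

      coefA-cleared : ∀ h → ⟪ ⟨1-x²⟩ ⟫ (⟪ ⟨1-qx²⟩ ⟫ (coefA ⊛ h)) ≋ ⟪ NA ⟫ h
      coefA-cleared h = ≋-trans
        (⟪⟫-cancels² ⟨1-x²⟩ ⟨1-qx²⟩ _ _ _ h (⟪1-ex²⟫-geom2 1ᶜ) (⟪1-ex²⟫-geom2 𝐪))
        (⊛⁴-as-⟪⟫ _ _ _ _ ⟨1- 𝐚 x⟩ ⟨1- 𝐛 x⟩ ⟨1- 𝐜 x⟩ ⟨1- 𝐝 x⟩
                  (oneMinus-⊛ 𝐚) (oneMinus-⊛ 𝐛) (oneMinus-⊛ 𝐜) (oneMinus-⊛ 𝐝) h)

      coefB-cleared : ∀ h → ⟪ ⟨1-x²⟩ ⟫ (⟪ ⟨q-x²⟩ ⟫ (coefB ⊛ h)) ≋ ⟪ NB ⟫ h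
      coefB-cleared h = ≋-trans
        (⟪⟫-cancels² ⟨1-x²⟩ ⟨q-x²⟩ _ _ _ h (⟪1-ex²⟫-geom2 1ᶜ) (⟪e-x²⟫-geom2 𝐪 q≉0))
        (⊛⁴-as-⟪⟫ _ _ _ _ ⟨ 𝐚 -x⟩ ⟨ 𝐛 -x⟩ ⟨ 𝐜 -x⟩ ⟨ 𝐝 -x⟩
                  (minusX-⊛ 𝐚) (minusX-⊛ 𝐛) (minusX-⊛ 𝐜) (minusX-⊛ 𝐝) h)

      𝐞 𝐊 𝐊t 𝐊/t 𝐊ev 𝐊ν cA cB : Coeff
      𝐞   = 𝐚 :* 𝐛 :* 𝐜 :* 𝐝
      𝐊   = 𝐚 :* 𝐪 :* 𝐪 :* 𝐭 :* 𝐭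
      𝐊t  = 𝐊 :* 𝐭
      𝐊/t = 𝐚 :* 𝐪 :* 𝐪 :* 𝐭
      𝐊ev = 𝐚 :* 𝐪 :* 𝐭 :* (𝐪 :* 𝐭 :* 𝐭 :+ 𝐞 :- 𝐪 :* 𝐭 :- 𝐞 :* 𝐭)
      𝐊ν  = (𝐭 :- 1ᶜ) :* (𝐪 :* 𝐭 :- 𝐚 :* 𝐛) :* (𝐪 :* 𝐭 :- 𝐚 :* 𝐜) :* (𝐪 :* 𝐭 :- 𝐚 :* 𝐝)
      cA  = 𝐚 :* 𝐚 :* 𝐚 :* 𝐪 :* 𝐪 :* 𝐭 :* 𝐭 :* 𝐭 :* (𝐭 :- 1ᶜ)
      cB  = 𝐚 :* 𝐚 :* 𝐚 :* 𝐪 :* 𝐪 :* 𝐪 :* 𝐭 :* 𝐭 :* (1ᶜ :- 𝐭)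

      K : Carrier
      K = ⟦ 𝐊 ⟧ᶜ

      K≉0 : K ≉ 0#
      K≉0 = *-≉0 (*-≉0 (*-≉0 (*-≉0 a≉0 q≉0) q≉0) t≉0) t≉0

      K*ev : K * ev t ≈ ⟦ 𝐊ev ⟧ᶜ
      K*ev = begin
        K * (t + e * (q * t) ⁻¹ - 1# - e * q ⁻¹)
          ≈⟨ *-congˡ (+-congʳ (+-congʳ (+-congˡ (*-congˡ (⁻¹-distrib-* q≉0 t≉0))))) ⟩
        K * (t + e * (q ⁻¹ * t ⁻¹) - 1# - e * q ⁻¹)
          ≈⟨ solve 6 (λ a e q t q′ t′ → a :* q :* q :* t :* t :* (t :+ e :* (q′ :* t′) :- con (+ 1) :- e :* q′)
               := a :* q :* t :* (q :* t :* t :+ e :- q :* t :- e :* t)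
                  :+ (a :* e :* q :* t :* t :* t′ :- a :* e :* q :* t :* t) :* (q :* q′ :- con (+ 1))
                  :+ (a :* e :* q :* t) :* (t :* t′ :- con (+ 1)))
              refl a e q t (q ⁻¹) (t ⁻¹) ⟩
        ⟦ 𝐊ev ⟧ᶜ + _ * (q * q ⁻¹ - 1#) + _ * (t * t ⁻¹ - 1#)
          ≈⟨ trans (x+c*[y-z]≈x _ _ (⁻¹-inverseʳ t≉0)) (x+c*[y-z]≈x _ _ (⁻¹-inverseʳ q≉0)) ⟩
        ⟦ 𝐊ev ⟧ᶜ ∎
        where e = a * b * c * d

      K*ν : K * ν t ≈ ⟦ 𝐊ν ⟧ᶜ
      K*ν = x≈y*[z*z⁻¹]⇒x≈y K≉0
        (solve 3 (λ K N K′ → K :* (N :* K′) := N :* (K :* K′)) refl K ⟦ 𝐊ν ⟧ᶜ (K ⁻¹))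

      Gᴬ Gᴮ : Series
      Gᴬ = ⟦ 𝐊t ⟧ᶜ · dilate q (φ t) ⊖ K · φ t
      Gᴮ = ⟦ 𝐊/t ⟧ᶜ · dilate (q ⁻¹) (φ t) ⊖ K · φ t

      K·AW-φ : K · AW t (φ t) ≋ coefA ⊛ Gᴬ ⊕ coefB ⊛ Gᴮ
      K·AW-φ =
        K · AW t (φ t)
          ≋⟨ ·-distrib-⊕ K (coefA ⊛ Tᴬ) (coefB ⊛ Tᴮ) ⟩
        K · (coefA ⊛ Tᴬ) ⊕ K · (coefB ⊛ Tᴮ)
          ≋⟨ ⊕-cong (≋-sym (⊛-·ʳ K coefA Tᴬ)) (≋-sym (⊛-·ʳ K coefB Tᴮ)) ⟩
        coefA ⊛ (K · Tᴬ) ⊕ coefB ⊛ (K · Tᴮ)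
          ≋⟨ ⊕-cong (⊛-congˡ (≋-trans (·-distrib-⊖ K _ (φ t)) (⊖-cong K·T (≋-refl {K · φ t}))))
              (⊛-congˡ (≋-trans (·-distrib-⊖ K _ (φ t)) (⊖-cong K·T⁻¹ (≋-refl {K · φ t})))) ⟩
        coefA ⊛ Gᴬ ⊕ coefB ⊛ Gᴮ ≋∎
        where
        Tᴬ Tᴮ : Series
        Tᴬ = Defs.Tq F q t (φ t) ⊖ φ t
        Tᴮ = Defs.Tq⁻¹ F q t (φ t) ⊖ φ t
        K·T : K · Defs.Tq F q t (φ t) ≋ ⟦ 𝐊t ⟧ᶜ · dilate q (φ t)
        K·T n = solve 4 (λ K t Q x → K :* ((t :* Q) :* x) := (K :* t) :* (Q :* x)) refl K t (q ^ n) (φ t n)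
        K·T⁻¹ : K · Defs.Tq⁻¹ F q t (φ t) ≋ ⟦ 𝐊/t ⟧ᶜ · dilate (q ⁻¹) (φ t)
        K·T⁻¹ n = begin
          K * ((t * q ^ n) ⁻¹ * φ t n)
            ≈⟨ *-congˡ (*-congʳ (trans (⁻¹-distrib-* t≉0 (^-≉0 n q≉0)) (*-congˡ (^-⁻¹ n q≉0)))) ⟩
          K * ((t ⁻¹ * (q ⁻¹) ^ n) * φ t n)
            ≈⟨ solve 6 (λ a q t t′ Q′ x → a :* q :* q :* t :* t :* ((t′ :* Q′) :* x)
                         := a :* q :* q :* t :* (Q′ :* x) :+ (a :* q :* q :* t :* Q′ :* x) :* (t :* t′ :- con (+ 1)))
                refl a q t (t ⁻¹) ((q ⁻¹) ^ n) (φ t n) ⟩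
          ⟦ 𝐊/t ⟧ᶜ * ((q ⁻¹) ^ n * φ t n) + _ * (t * t ⁻¹ - 1#)
            ≈⟨ x+c*[y-z]≈x _ _ (⁻¹-inverseʳ t≉0) ⟩
          ⟦ 𝐊/t ⟧ᶜ * ((q ⁻¹) ^ n * φ t n) ∎

      W⁺ W⁻ V : Poly
      W⁺ = P⁺ˡ ⊠ R⁺ˡ
      W⁻ = P⁻ˡ ⊠ R⁻ˡ
      V  = ⟨1-x²⟩ ⊠ (W⁻ ⊠ W⁺)

      W⁺Gᴬ : ⟪ W⁺ ⟫ Gᴬ ≋ ⟦ cA ⟧ᶜ · ⟪ ⟨1-qx²⟩ ⟫ (φ t)
      W⁺Gᴬ =
        ⟪ W⁺ ⟫ Gᴬ
          ≋⟨ ≋-trans (⟪⟫-⊖ W⁺ _ (K · φ t)) (⊖-cong (⟪⟫-· W⁺ ⟦ 𝐊t ⟧ᶜ _) (⟪⟫-· W⁺ K (φ t))) ⟩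
        ⟦ 𝐊t ⟧ᶜ · ⟪ W⁺ ⟫ (dilate q (φ t)) ⊖ K · ⟪ W⁺ ⟫ (φ t)
          ≋⟨ ⊖-cong (·-congˡ (≋-trans (⟪⟫-⊠ P⁺ˡ R⁺ˡ _) (≋-trans φ-qdiff (≋-sym (⟪⟫-⊠ P⁺ʳ R⁺ʳ (φ t))))))
              (≋-refl {K · ⟪ W⁺ ⟫ (φ t)}) ⟩
        ⟦ 𝐊t ⟧ᶜ · ⟪ P⁺ʳ ⊠ R⁺ʳ ⟫ (φ t) ⊖ ⟦ 𝐊 ⟧ᶜ · ⟪ W⁺ ⟫ (φ t)
          ≋⟨ ⟪⟫-scale-⊟ 𝐊t 𝐊 (P⁺ʳ ⊠ R⁺ʳ) W⁺ (φ t) ⟩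
        ⟪ scale 𝐊t (P⁺ʳ ⊠ R⁺ʳ) ⊟ scale 𝐊 W⁺ ⟫ (φ t)
          ≋⟨ ≋-by-coefficients (scale 𝐊t (P⁺ʳ ⊠ R⁺ʳ) ⊟ scale 𝐊 W⁺) (scale cA ⟨1-qx²⟩) (refl ∷ refl ∷ refl ∷ []) (φ t) ⟩
        ⟪ scale cA ⟨1-qx²⟩ ⟫ (φ t)
          ≋⟨ ⟪⟫-scale cA ⟨1-qx²⟩ (φ t) ⟩
        ⟦ cA ⟧ᶜ · ⟪ ⟨1-qx²⟩ ⟫ (φ t) ≋∎

      W⁻Gᴮ : ⟪ W⁻ ⟫ Gᴮ ≋ ⟦ cB ⟧ᶜ · ⟪ ⟨q-x²⟩ ⟫ (φ t)
      W⁻Gᴮ =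
        ⟪ W⁻ ⟫ Gᴮ
          ≋⟨ ≋-trans (⟪⟫-⊖ W⁻ _ (K · φ t)) (⊖-cong (⟪⟫-· W⁻ ⟦ 𝐊/t ⟧ᶜ _) (⟪⟫-· W⁻ K (φ t))) ⟩
        ⟦ 𝐊/t ⟧ᶜ · ⟪ W⁻ ⟫ (dilate (q ⁻¹) (φ t)) ⊖ K · ⟪ W⁻ ⟫ (φ t)
          ≋⟨ ⊖-cong (·-congˡ (≋-trans (⟪⟫-⊠ P⁻ˡ R⁻ˡ _) (≋-trans φ-qdiff⁻¹ (≋-sym (⟪⟫-⊠ P⁻ʳ R⁻ʳ (φ t))))))
              (≋-refl {K · ⟪ W⁻ ⟫ (φ t)}) ⟩
        ⟦ 𝐊/t ⟧ᶜ · ⟪ P⁻ʳ ⊠ R⁻ʳ ⟫ (φ t) ⊖ ⟦ 𝐊 ⟧ᶜ · ⟪ W⁻ ⟫ (φ t)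
          ≋⟨ ⟪⟫-scale-⊟ 𝐊/t 𝐊 (P⁻ʳ ⊠ R⁻ʳ) W⁻ (φ t) ⟩
        ⟪ scale 𝐊/t (P⁻ʳ ⊠ R⁻ʳ) ⊟ scale 𝐊 W⁻ ⟫ (φ t)
          ≋⟨ ≋-by-coefficients (scale 𝐊/t (P⁻ʳ ⊠ R⁻ʳ) ⊟ scale 𝐊 W⁻) (scale cB ⟨q-x²⟩) (refl ∷ refl ∷ refl ∷ []) (φ t) ⟩
        ⟪ scale cB ⟨q-x²⟩ ⟫ (φ t)
          ≋⟨ ⟪⟫-scale cB ⟨q-x²⟩ (φ t) ⟩
        ⟦ cB ⟧ᶜ · ⟪ ⟨q-x²⟩ ⟫ (φ t) ≋∎

      cleared : ∀ C G Wᵢ Wₒ D N c → ⟪ Wᵢ ⟫ G ≋ ⟦ c ⟧ᶜ · ⟪ D ⟫ (φ t) →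
        (∀ h → ⟪ ⟨1-x²⟩ ⟫ (⟪ D ⟫ (C ⊛ h)) ≋ ⟪ N ⟫ h) →
        ⟪ ⟨1-x²⟩ ⟫ (⟪ Wₒ ⟫ (⟪ Wᵢ ⟫ (C ⊛ G))) ≋ ⟪ scale c (Wₒ ⊠ N) ⟫ (φ t)
      cleared C G Wᵢ Wₒ D N c WᵢG D-cleared =
        ⟪ ⟨1-x²⟩ ⟫ (⟪ Wₒ ⟫ (⟪ Wᵢ ⟫ (C ⊛ G)))
          ≋⟨ ⟪⟫-cong ⟨1-x²⟩ (⟪⟫-cong Wₒ (≋-trans (⟪⟫-⊛ʳ Wᵢ C G) (⊛-congˡ WᵢG))) ⟩
        ⟪ ⟨1-x²⟩ ⟫ (⟪ Wₒ ⟫ (C ⊛ (γ · ⟪ D ⟫ (φ t))))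
          ≋⟨ ⟪⟫-cong ⟨1-x²⟩ (⟪⟫-cong Wₒ (≋-trans (⊛-·ʳ γ C (⟪ D ⟫ (φ t))) (·-congˡ (≋-sym (⟪⟫-⊛ʳ D C (φ t)))))) ⟩
        ⟪ ⟨1-x²⟩ ⟫ (⟪ Wₒ ⟫ (γ · ⟪ D ⟫ (C ⊛ φ t)))
          ≋⟨ ≋-trans (⟪⟫-cong ⟨1-x²⟩ (⟪⟫-· Wₒ γ _)) (⟪⟫-· ⟨1-x²⟩ γ _) ⟩
        γ · ⟪ ⟨1-x²⟩ ⟫ (⟪ Wₒ ⟫ (⟪ D ⟫ (C ⊛ φ t)))
          ≋⟨ ·-congˡ (⟪⟫-comm ⟨1-x²⟩ Wₒ _) ⟩
        γ · ⟪ Wₒ ⟫ (⟪ ⟨1-x²⟩ ⟫ (⟪ D ⟫ (C ⊛ φ t)))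
          ≋⟨ ·-congˡ (⟪⟫-cong Wₒ (D-cleared (φ t))) ⟩
        γ · ⟪ Wₒ ⟫ (⟪ N ⟫ (φ t))
          ≋⟨ ≋-sym (≋-trans (⟪⟫-scale c (Wₒ ⊠ N) (φ t)) (·-congˡ (⟪⟫-⊠ Wₒ N (φ t)))) ⟩
        ⟪ scale c (Wₒ ⊠ N) ⟫ (φ t) ≋∎
        where γ = ⟦ c ⟧ᶜ

      V-coefA : ⟪ V ⟫ (coefA ⊛ Gᴬ) ≋ ⟪ scale cA (W⁻ ⊠ NA) ⟫ (φ t)
      V-coefA = ≋-trans (⟪⟫-⊠³ ⟨1-x²⟩ W⁻ W⁺ (coefA ⊛ Gᴬ)) (cleared coefA Gᴬ W⁺ W⁻ ⟨1-qx²⟩ NA cA W⁺Gᴬ coefA-cleared)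

      V-coefB : ⟪ V ⟫ (coefB ⊛ Gᴮ) ≋ ⟪ scale cB (W⁺ ⊠ NB) ⟫ (φ t)
      V-coefB = ≋-trans (⟪⟫-⊠³ ⟨1-x²⟩ W⁻ W⁺ (coefB ⊛ Gᴮ))
        (≋-trans (⟪⟫-cong ⟨1-x²⟩ (⟪⟫-comm W⁻ W⁺ (coefB ⊛ Gᴮ))) (cleared coefB Gᴮ W⁻ W⁺ ⟨q-x²⟩ NB cB W⁻Gᴮ coefB-cleared))

      Vx : Poly
      Vx = ⟨1-x²⟩ ⊠ (P⁻ˡ ⊠ (P⁺ˡ ⊠ (0ᶜ ∷ cR ∷ [])))

      V-shift : ⟪ V ⟫ (shift (φ (q * t))) ≋ ⟪ Vx ⟫ (φ t)
      V-shift =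
        ⟪ V ⟫ (shift φ′)
          ≋⟨ ≋-trans (⟪⟫-⊠³ ⟨1-x²⟩ W⁻ W⁺ (shift φ′))
              (⟪⟫-cong ⟨1-x²⟩ (≋-trans (⟪⟫-⊠ P⁻ˡ R⁻ˡ _) (⟪⟫-cong P⁻ˡ (⟪⟫-cong R⁻ˡ (⟪⟫-⊠ P⁺ˡ R⁺ˡ (shift φ′)))))) ⟩
        ⟪ ⟨1-x²⟩ ⟫ (⟪ P⁻ˡ ⟫ (⟪ R⁻ˡ ⟫ (⟪ P⁺ˡ ⟫ (⟪ R⁺ˡ ⟫ (shift φ′)))))
          ≋⟨ ⟪⟫-cong ⟨1-x²⟩ (⟪⟫-cong P⁻ˡ (≋-trans (⟪⟫-comm R⁻ˡ P⁺ˡ _) (⟪⟫-cong P⁺ˡ (⟪⟫-comm R⁻ˡ R⁺ˡ (shift φ′))))) ⟩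
        ⟪ ⟨1-x²⟩ ⟫ (⟪ P⁻ˡ ⟫ (⟪ P⁺ˡ ⟫ (⟪ R⁺ˡ ⟫ (⟪ R⁻ˡ ⟫ (shift φ′)))))
          ≋⟨ ⟪⟫-cong ⟨1-x²⟩ (⟪⟫-cong P⁻ˡ (⟪⟫-cong P⁺ˡ x·contiguous)) ⟩
        ⟪ ⟨1-x²⟩ ⟫ (⟪ P⁻ˡ ⟫ (⟪ P⁺ˡ ⟫ (⟪ 0ᶜ ∷ cR ∷ [] ⟫ (φ t))))
          ≋⟨ ≋-sym (⟪⟫-⊠⁴ ⟨1-x²⟩ P⁻ˡ P⁺ˡ (0ᶜ ∷ cR ∷ []) (φ t)) ⟩
        ⟪ Vx ⟫ (φ t) ≋∎
        where
        φ′ = φ (q * t)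
        x·contiguous : ⟪ R⁺ˡ ⟫ (⟪ R⁻ˡ ⟫ (shift φ′)) ≋ ⟪ 0ᶜ ∷ cR ∷ [] ⟫ (φ t)
        x·contiguous =
          ⟪ R⁺ˡ ⟫ (⟪ R⁻ˡ ⟫ (shift φ′))
            ≋⟨ ≋-trans (⟪⟫-cong R⁺ˡ (⟪⟫-shift R⁻ˡ φ′)) (⟪⟫-shift R⁺ˡ (⟪ R⁻ˡ ⟫ φ′)) ⟩
          shift (⟪ R⁺ˡ ⟫ (⟪ R⁻ˡ ⟫ φ′))
            ≋⟨ shift-cong φ-contiguous ⟩
          shift (⟦ cR ⟧ᶜ · φ t)
            ≋⟨ shift-as-⟪⟫ cR (φ t) ⟩
          ⟪ 0ᶜ ∷ cR ∷ [] ⟫ (φ t) ≋∎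

      V-rhs : ⟪ V ⟫ (K · (ev t · φ t ⊕ ν t · shift (φ (q * t)))) ≋ ⟪ scale 𝐊ev V ⊞ scale 𝐊ν Vx ⟫ (φ t)
      V-rhs =
        ⟪ V ⟫ (K · (ev t · φ t ⊕ ν t · shift φ′))
          ≋⟨ ⟪⟫-cong V (≋-trans (·-distrib-⊕ K _ _)
                (⊕-cong (≋-trans (·-assoc K (ev t) (φ t)) (·-cong K*ev (≋-refl {φ t})))
                        (≋-trans (·-assoc K (ν t) (shift φ′)) (·-cong K*ν (≋-refl {shift φ′}))))) ⟩
        ⟪ V ⟫ (⟦ 𝐊ev ⟧ᶜ · φ t ⊕ ⟦ 𝐊ν ⟧ᶜ · shift φ′)
          ≋⟨ ≋-trans (⟪⟫-⊕ V _ _) (⊕-cong (⟪⟫-· V ⟦ 𝐊ev ⟧ᶜ (φ t)) (⟪⟫-· V ⟦ 𝐊ν ⟧ᶜ (shift φ′))) ⟩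
        ⟦ 𝐊ev ⟧ᶜ · ⟪ V ⟫ (φ t) ⊕ ⟦ 𝐊ν ⟧ᶜ · ⟪ V ⟫ (shift φ′)
          ≋⟨ ⊕-cong (≋-refl {⟦ 𝐊ev ⟧ᶜ · ⟪ V ⟫ (φ t)}) (·-congˡ V-shift) ⟩
        ⟦ 𝐊ev ⟧ᶜ · ⟪ V ⟫ (φ t) ⊕ ⟦ 𝐊ν ⟧ᶜ · ⟪ Vx ⟫ (φ t)
          ≋⟨ ≋-sym (≋-trans (⟪⟫-⊞ (scale 𝐊ev V) (scale 𝐊ν Vx) (φ t))
               (⊕-cong (⟪⟫-scale 𝐊ev V (φ t)) (⟪⟫-scale 𝐊ν Vx (φ t)))) ⟩
        ⟪ scale 𝐊ev V ⊞ scale 𝐊ν Vx ⟫ (φ t) ≋∎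
        where φ′ = φ (q * t)

      V₀≉0 : ⟦ constantCoeff V ⟧ᶜ ≉ 0#
      V₀≉0 = ≉0-resp-≈ (sym (prove ρ (constantCoeff V) (𝐪 :* 𝐚 :* (𝐪 :* (𝐚 :* 𝐭)) :* (𝐚 :* (𝐭 :* 𝐚))) refl))
        (*-≉0 (*-≉0 (*-≉0 q≉0 a≉0) (*-≉0 q≉0 (*-≉0 a≉0 t≉0))) (*-≉0 a≉0 (*-≉0 t≉0 a≉0)))

      -- After multiplying by K and by V every denominator is cleared (coefA and coefB
      -- by their quadratic denominators, the q^{±1}-dilates of φ t through its
      -- q-difference equations, φ (q t) through φ-contiguous), leaving an identity
      -- between polynomial multiples of φ t that is checked coefficientwise.
      AW-φ : AW t (φ t) ≋ ev t · φ t ⊕ ν t · shift (φ (q * t))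
      AW-φ = ·-cancelˡ K≉0 (⟪⟫-cancel V V₀≉0 (
        ⟪ V ⟫ (K · AW t (φ t))
          ≋⟨ ⟪⟫-cong V K·AW-φ ⟩
        ⟪ V ⟫ (coefA ⊛ Gᴬ ⊕ coefB ⊛ Gᴮ)
          ≋⟨ ⟪⟫-⊕ V (coefA ⊛ Gᴬ) (coefB ⊛ Gᴮ) ⟩
        ⟪ V ⟫ (coefA ⊛ Gᴬ) ⊕ ⟪ V ⟫ (coefB ⊛ Gᴮ)
          ≋⟨ ⊕-cong V-coefA V-coefB ⟩
        ⟪ scale cA (W⁻ ⊠ NA) ⟫ (φ t) ⊕ ⟪ scale cB (W⁺ ⊠ NB) ⟫ (φ t)
          ≋⟨ ≋-sym (⟪⟫-⊞ (scale cA (W⁻ ⊠ NA)) (scale cB (W⁺ ⊠ NB)) (φ t)) ⟩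
        ⟪ scale cA (W⁻ ⊠ NA) ⊞ scale cB (W⁺ ⊠ NB) ⟫ (φ t)
          ≋⟨ ≋-by-coefficients (scale cA (W⁻ ⊠ NA) ⊞ scale cB (W⁺ ⊠ NB)) (scale 𝐊ev V ⊞ scale 𝐊ν Vx)
              (refl ∷ refl ∷ refl ∷ refl ∷ refl ∷ refl ∷ refl ∷ []) (φ t) ⟩
        ⟪ scale 𝐊ev V ⊞ scale 𝐊ν Vx ⟫ (φ t)
          ≋⟨ ≋-sym V-rhs ⟩
        ⟪ V ⟫ (K · (ev t · φ t ⊕ ν t · shift (φ (q * t)))) ≋∎))

module SixPhiFiveExpansion {ℓ₁ ℓ₂ : Level} (F : Field ℓ₁ ℓ₂) where
  open ContiguityRelation F public

  module Expansion (a b c d q s r : Carrier) (r*r≈q : r * r ≈ q)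
    (q≉0 : q ≉ 0#) (s≉0 : s ≉ 0#) (a≉0 : a ≉ 0#) (b≉0 : b ≉ 0#) (c≉0 : c ≉ 0#) (d≉0 : d ≉ 0#)
    (qᵏ⁺¹≉1 : ∀ k → q ^ suc k ≉ 1#)
    (1-qᵏβ₁≉0 : ∀ k → 1# - q ^ k * (q * q * s * s / (a * b * c * d)) ≉ 0#)
    (1-qᵏβ₂≉0 : ∀ k → 1# - q ^ k * (r * s / a) ≉ 0#)
    (1-qᵏβ₃≉0 : ∀ k → 1# - q ^ k * (- (r * s / a)) ≉ 0#)
    (1-qᵏβ₄≉0 : ∀ k → 1# - q ^ k * (q * s / a) ≉ 0#)
    (1-qᵏβ₅≉0 : ∀ k → 1# - q ^ k * (- (q * s / a)) ≉ 0#) where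

    open BasisFunctions a b c d q a≉0 q≉0 qᵏ⁺¹≉1 public

    e : Carrier
    e = a * b * c * d

    e≉0 : e ≉ 0#
    e≉0 = *-≉0 (*-≉0 (*-≉0 a≉0 b≉0) c≉0) d≉0

    sq : ℕ → Carrier
    sq m = s * q ^ m

    sq≉0 : ∀ m → sq m ≉ 0#
    sq≉0 m = *-≉0 s≉0 (^-≉0 m q≉0)

    q*sq≈sq : ∀ m → q * sq m ≈ sq (suc m)
    q*sq≈sq m = solve 3 (λ q s qᵐ → q :* (s :* qᵐ) := s :* (q :* qᵐ)) refl q s (q ^ m)

    α₁ α₂ : ℕ → Carrier
    α₁ j = (q ⁻¹) ^ j
    α₂ j = q ^ suc j * s * s / (a * a)

    α₄ α₅ α₆ β₁ β₂ β₃ β₄ β₅ : Carrier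
    α₄ = q * s / (a * b)
    α₅ = q * s / (a * c)
    α₆ = q * s / (a * d)
    β₁ = q * q * s * s / (a * b * c * d)
    β₂ = r * s / a
    β₃ = - β₂
    β₄ = q * s / a
    β₅ = - β₄

    numer : ℕ → ℕ → Carrier
    numer j m = poch (α₁ j) m * poch (α₂ j) m * poch s m * poch α₄ m * poch α₅ m * poch α₆ m

    denom : ℕ → Carrier
    denom m = poch q m * poch β₁ m * poch β₂ m * poch β₃ m * poch β₄ m * poch β₅ m

    term : ℕ → ℕ → Carrier
    term j m = numer j m / denom m * q ^ m

    factor : Carrier → ℕ → Carrier
    factor u m = 1# - q ^ m * u

    numer-factor : ℕ → ℕ → Carrier
    numer-factor j m = factor (α₁ j) m * factor (α₂ j) m * factor s m * factor α₄ m * factor α₅ m * factor α₆ m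

    upper lower qβ₁ : ℕ → Carrier
    upper m = factor s m * factor α₄ m * factor α₅ m * factor α₆ m
    lower m = factor β₂ m * factor β₃ m * factor β₄ m * factor β₅ m
    qβ₁ m   = factor q m * factor β₁ m

    denom-factor : ℕ → Carrier
    denom-factor m = factor q m * factor β₁ m * factor β₂ m * factor β₃ m * factor β₄ m * factor β₅ m

    qβ₁≉0 : ∀ m → qβ₁ m ≉ 0#
    qβ₁≉0 m = *-≉0 (1-qᵏq≉0 m) (1-qᵏβ₁≉0 m)

    denom-factor≉0 : ∀ m → denom-factor m ≉ 0#
    denom-factor≉0 m = *-≉0 (*-≉0 (*-≉0 (*-≉0 (qβ₁≉0 m) (1-qᵏβ₂≉0 m)) (1-qᵏβ₃≉0 m)) (1-qᵏβ₄≉0 m)) (1-qᵏβ₅≉0 m)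

    denom≉0 : ∀ m → denom m ≉ 0#
    denom≉0 m = *-≉0 (*-≉0 (*-≉0 (*-≉0 (*-≉0 (qfac-≉0 m) (poch≉0 1-qᵏβ₁≉0)) (poch≉0 1-qᵏβ₂≉0)) (poch≉0 1-qᵏβ₃≉0))
                          (poch≉0 1-qᵏβ₄≉0)) (poch≉0 1-qᵏβ₅≉0)
      where
      poch≉0 : ∀ {u} → (∀ k → factor u k ≉ 0#) → poch u m ≉ 0#
      poch≉0 {u} factor≉0 = Π<-≉0 m (λ i → factor u i) (λ i _ → factor≉0 i)

    term-0 : ∀ j → term j 0 ≈ 1#
    term-0 j = begin
      (1# * 1# * 1# * 1# * 1# * 1#) * (1# * 1# * 1# * 1# * 1# * 1#) ⁻¹ * 1#
        ≈⟨ *-congʳ (*-congˡ (trans (⁻¹-cong (≉0-resp-≈ (sym 1⁶≈1) 1≉0) 1⁶≈1) 1⁻¹≈1)) ⟩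
      (1# * 1# * 1# * 1# * 1# * 1#) * 1# * 1#
        ≈⟨ solve 0 (con (+ 1) :* con (+ 1) :* con (+ 1) :* con (+ 1) :* con (+ 1) :* con (+ 1) :* con (+ 1) :* con (+ 1) := con (+ 1)) refl ⟩
      1# ∎
      where
      1⁶≈1 : 1# * 1# * 1# * 1# * 1# * 1# ≈ 1#
      1⁶≈1 = solve 0 (con (+ 1) :* con (+ 1) :* con (+ 1) :* con (+ 1) :* con (+ 1) :* con (+ 1) := con (+ 1)) refl

    term-suc : ∀ j m → term j (suc m) * denom-factor m ≈ term j m * numer-factor j m * q
    term-suc j m = x≈y*[z*z⁻¹]⇒x≈y (denom-factor≉0 m) (begin
      numer j (suc m) * denom (suc m) ⁻¹ * (q * q ^ m) * D
        ≈⟨ *-congʳ (*-congʳ (*-congˡ (trans (⁻¹-cong (denom≉0 (suc m)) denom-suc) (⁻¹-distrib-* (denom≉0 m) (denom-factor≉0 m))))) ⟩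
      numer j (suc m) * (denom m ⁻¹ * D ⁻¹) * (q * q ^ m) * D
        ≈⟨ solve 17 (λ p₁ p₂ p₃ p₄ p₅ p₆ f₁ f₂ f₃ f₄ f₅ f₆ E D′ q qᵐ D →
            (p₁ :* f₁) :* (p₂ :* f₂) :* (p₃ :* f₃) :* (p₄ :* f₄) :* (p₅ :* f₅) :* (p₆ :* f₆) :* (E :* D′) :* (q :* qᵐ) :* D
            := ((p₁ :* p₂ :* p₃ :* p₄ :* p₅ :* p₆) :* E :* qᵐ) :* (f₁ :* f₂ :* f₃ :* f₄ :* f₅ :* f₆) :* q :* (D :* D′))
            refl (poch (α₁ j) m) (poch (α₂ j) m) (poch s m) (poch α₄ m) (poch α₅ m) (poch α₆ m)
                 (factor (α₁ j) m) (factor (α₂ j) m) (factor s m) (factor α₄ m) (factor α₅ m) (factor α₆ m)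
                 (denom m ⁻¹) (D ⁻¹) q (q ^ m) D ⟩
      term j m * numer-factor j m * q * (D * D ⁻¹) ∎)
      where
      D = denom-factor m
      denom-suc : denom (suc m) ≈ denom m * D
      denom-suc = solve 12 (λ p₁ p₂ p₃ p₄ p₅ p₆ f₁ f₂ f₃ f₄ f₅ f₆ →
          (p₁ :* f₁) :* (p₂ :* f₂) :* (p₃ :* f₃) :* (p₄ :* f₄) :* (p₅ :* f₅) :* (p₆ :* f₆)
          := (p₁ :* p₂ :* p₃ :* p₄ :* p₅ :* p₆) :* (f₁ :* f₂ :* f₃ :* f₄ :* f₅ :* f₆))
        refl (poch q m) (poch β₁ m) (poch β₂ m) (poch β₃ m) (poch β₄ m) (poch β₅ m)
             (factor q m) (factor β₁ m) (factor β₂ m) (factor β₃ m) (factor β₄ m) (factor β₅ m)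

    α-factors : ∀ m k → factor (α₁ (suc (m ℕ.+ k))) m * factor (α₂ (suc (m ℕ.+ k))) m
                        ≈ (1# - (q ⁻¹) ^ suc k) * (1# - q ^ suc k * base (sq m))
    α-factors m k = *-cong (+-congˡ (-‿cong qᵐα₁)) (+-congˡ (-‿cong qᵐα₂))
      where
      qᵐα₁ : q ^ m * (q ⁻¹) ^ suc (m ℕ.+ k) ≈ (q ⁻¹) ^ suc k
      qᵐα₁ = begin
        q ^ m * (q ⁻¹) ^ suc (m ℕ.+ k)
          ≡⟨ ≡.cong (λ i → q ^ m * (q ⁻¹) ^ i) (ℕ.+-suc m k) ⟨
        q ^ m * (q ⁻¹) ^ (m ℕ.+ suc k)
          ≈⟨ *-congˡ (^-distribˡ-+-* (q ⁻¹) m (suc k)) ⟩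
        q ^ m * ((q ⁻¹) ^ m * (q ⁻¹) ^ suc k)
          ≈⟨ *-assoc _ _ _ ⟨
        q ^ m * (q ⁻¹) ^ m * (q ⁻¹) ^ suc k
          ≈⟨ *-congʳ (x^n*x⁻¹^n≈1 m q≉0) ⟩
        1# * (q ⁻¹) ^ suc k
          ≈⟨ *-identityˡ _ ⟩
        (q ⁻¹) ^ suc k ∎
      qᵐα₂ : q ^ m * α₂ (suc (m ℕ.+ k)) ≈ q ^ suc k * base (sq m)
      qᵐα₂ = begin
        q ^ m * (q * (q * q ^ (m ℕ.+ k)) * s * s * (a * a) ⁻¹)
          ≈⟨ *-congˡ (*-congʳ (*-congʳ (*-congʳ (*-congˡ (*-congˡ (^-distribˡ-+-* q m k)))))) ⟩
        q ^ m * (q * (q * (q ^ m * q ^ k)) * s * s * (a * a) ⁻¹)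
          ≈⟨ solve 5 (λ q qᵐ qᵏ s A → qᵐ :* (q :* (q :* (qᵐ :* qᵏ)) :* s :* s :* A) := q :* qᵏ :* (q :* (s :* qᵐ) :* (s :* qᵐ) :* A))
              refl q (q ^ m) (q ^ k) s ((a * a) ⁻¹) ⟩
        q ^ suc k * base (sq m) ∎

    lower-factorisation : ∀ m → lower m ≈ (1# - base (sq m)) * (1# - q * base (sq m))
    lower-factorisation m = begin
      factor β₂ m * factor β₃ m * factor β₄ m * factor β₅ m
        ≈⟨ solve 3 (λ Q x y → (con (+ 1) :- Q :* x) :* (con (+ 1) :- Q :* (:- x)) :* (con (+ 1) :- Q :* y) :* (con (+ 1) :- Q :* (:- y))
                             := (con (+ 1) :- Q :* Q :* (x :* x)) :* (con (+ 1) :- Q :* Q :* (y :* y)))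
            refl (q ^ m) β₂ β₄ ⟩
      (1# - q ^ m * q ^ m * (β₂ * β₂)) * (1# - q ^ m * q ^ m * (β₄ * β₄))
        ≈⟨ *-cong (+-congˡ (-‿cong (*-congˡ β₂²))) (+-congˡ (-‿cong (*-congˡ β₄²))) ⟩
      (1# - q ^ m * q ^ m * (q * s * s * A)) * (1# - q ^ m * q ^ m * (q * q * s * s * A))
        ≈⟨ solve 4 (λ Q q s A → (con (+ 1) :- Q :* Q :* (q :* s :* s :* A)) :* (con (+ 1) :- Q :* Q :* (q :* q :* s :* s :* A))
                               := (con (+ 1) :- q :* (s :* Q) :* (s :* Q) :* A) :* (con (+ 1) :- q :* (q :* (s :* Q) :* (s :* Q) :* A)))
            refl (q ^ m) q s A ⟩
      (1# - base (sq m)) * (1# - q * base (sq m)) ∎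
      where
      A = (a * a) ⁻¹
      a⁻¹a⁻¹ : a ⁻¹ * a ⁻¹ ≈ A
      a⁻¹a⁻¹ = sym (⁻¹-distrib-* a≉0 a≉0)
      β₂² : β₂ * β₂ ≈ q * s * s * A
      β₂² = begin
        r * s * a ⁻¹ * (r * s * a ⁻¹)
          ≈⟨ solve 3 (λ r s a′ → r :* s :* a′ :* (r :* s :* a′) := r :* r :* s :* s :* (a′ :* a′)) refl r s (a ⁻¹) ⟩
        r * r * s * s * (a ⁻¹ * a ⁻¹)
          ≈⟨ *-cong (*-congʳ (*-congʳ r*r≈q)) a⁻¹a⁻¹ ⟩
        q * s * s * A ∎
      β₄² : β₄ * β₄ ≈ q * q * s * s * A
      β₄² = trans (solve 3 (λ q s a′ → q :* s :* a′ :* (q :* s :* a′) := q :* q :* s :* s :* (a′ :* a′)) refl q s (a ⁻¹))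
                  (*-congˡ a⁻¹a⁻¹)

    R-step : ∀ m k → R (sq m) (suc k) * (factor (α₁ (suc (m ℕ.+ k))) m * factor (α₂ (suc (m ℕ.+ k))) m) * q
                      ≈ - (a / sq m) * R (sq (suc m)) k * lower m
    R-step m k = begin
      R t (suc k) * (factor (α₁ (suc (m ℕ.+ k))) m * factor (α₂ (suc (m ℕ.+ k))) m) * q
        ≈⟨ *-congʳ (*-congˡ (α-factors m k)) ⟩
      R t (suc k) * ((1# - (q ⁻¹) ^ suc k) * (1# - q ^ suc k * base t)) * q
        ≈⟨ R-suc-shift t (sq≉0 m) k ⟩
      - (a / t) * ((1# - base t) * (1# - q * base t)) * R (q * t) k
        ≈⟨ *-cong (*-congˡ (sym (lower-factorisation m))) (R-cong (*-≉0 q≉0 (sq≉0 m)) (q*sq≈sq m) k) ⟩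
      - (a / t) * lower m * R (sq (suc m)) k
        ≈⟨ solve 3 (λ x y z → x :* y :* z := x :* z :* y) refl (- (a / t)) (lower m) (R (sq (suc m)) k) ⟩
      - (a / t) * R (sq (suc m)) k * lower m ∎
      where t = sq m

    -- The right-hand side is Σₘ C m xᵐ φ (s qᵐ); κ m is the ratio C (m + 1) / C m.
    κ⁺ κ C : ℕ → Carrier
    κ⁺ m = - (a / sq m) * upper m
    κ m = κ⁺ m * qβ₁ m ⁻¹
    C zero    = 1#
    C (suc m) = C m * κ m

    summand : ∀ m k → R s (m ℕ.+ k) * term (m ℕ.+ k) m ≈ C m * R (sq m) k
    summand zero    k = begin
      R s k * term k 0
        ≈⟨ *-congˡ (term-0 k) ⟩
      R s k * 1#
        ≈⟨ *-identityʳ _ ⟩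
      R s k
        ≈⟨ R-cong s≉0 (sym (*-identityʳ s)) k ⟩
      R (sq 0) k
        ≈⟨ *-identityˡ _ ⟨
      1# * R (sq 0) k ∎
    summand (suc m) k = *-cancelˡ (denom-factor≉0 m) (begin
      D * (R s j * term j (suc m))
        ≈⟨ solve 3 (λ x y z → x :* (y :* z) := y :* (z :* x)) refl D (R s j) (term j (suc m)) ⟩
      R s j * (term j (suc m) * D)
        ≈⟨ *-congˡ (term-suc j m) ⟩
      R s j * (term j m * N * q)
        ≈⟨ solve 4 (λ x y z w → x :* (y :* z :* w) := (x :* y) :* z :* w) refl (R s j) (term j m) N q ⟩
      R s j * term j m * N * q
        ≈⟨ *-congʳ (*-congʳ previous) ⟩
      C m * R′ * N * q
        ≈⟨ solve 9 (λ C R′ f₁ f₂ f₃ f₄ f₅ f₆ q → C :* R′ :* (f₁ :* f₂ :* f₃ :* f₄ :* f₅ :* f₆) :* q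
                                             := C :* (R′ :* (f₁ :* f₂) :* q) :* (f₃ :* f₄ :* f₅ :* f₆))
            refl (C m) R′ (factor (α₁ j) m) (factor (α₂ j) m) (factor s m) (factor α₄ m) (factor α₅ m) (factor α₆ m) q ⟩
      C m * (R′ * (factor (α₁ j) m * factor (α₂ j) m) * q) * upper m
        ≈⟨ *-congʳ (*-congˡ (R-step m k)) ⟩
      C m * (- (a / sq m) * R″ * lower m) * upper m
        ≈⟨ x≈y*[z*z⁻¹]⇒x≈y (qβ₁≉0 m) (solve 14 (λ g₁ g₂ g₃ g₄ g₅ g₆ C w u₃ u₄ u₅ u₆ R″ g′ →
            (g₁ :* g₂ :* g₃ :* g₄ :* g₅ :* g₆) :* (C :* ((:- w :* (u₃ :* u₄ :* u₅ :* u₆)) :* g′) :* R″)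
            := C :* (:- w :* R″ :* (g₃ :* g₄ :* g₅ :* g₆)) :* (u₃ :* u₄ :* u₅ :* u₆) :* (g₁ :* g₂ :* g′))
            refl (factor q m) (factor β₁ m) (factor β₂ m) (factor β₃ m) (factor β₄ m) (factor β₅ m)
                 (C m) (a / sq m) (factor s m) (factor α₄ m) (factor α₅ m) (factor α₆ m) R″ (qβ₁ m ⁻¹)) ⟨
      D * (C (suc m) * R″) ∎)
      where
      j  = suc (m ℕ.+ k)
      D  = denom-factor m
      N  = numer-factor j m
      R′ = R (sq m) (suc k)
      R″ = R (sq (suc m)) k
      previous : R s j * term j m ≈ C m * R′
      previous = ≡.subst (λ i → R s i * term i m ≈ C m * R′) (ℕ.+-suc m k) (summand m (suc k))

    ω : ℕ → Carrier
    ω m = (1# - t) * (a * b - q * t) * (a * c - q * t) * (a * d - q * t) where t = sq m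

    α-clear : ∀ m u → u ≉ 0# → factor (q * s / (a * u)) m * (a * u) ≈ a * u - q * sq m
    α-clear m u u≉0 = begin
      (1# - q ^ m * (q * s * (a * u) ⁻¹)) * (a * u)
        ≈⟨ solve 6 (λ qᵐ q s a u A′ → (con (+ 1) :- qᵐ :* (q :* s :* A′)) :* (a :* u) := a :* u :- q :* (s :* qᵐ) :* ((a :* u) :* A′))
            refl (q ^ m) q s a u ((a * u) ⁻¹) ⟩
      a * u - q * sq m * ((a * u) * (a * u) ⁻¹)
        ≈⟨ +-congˡ (-‿cong (x≈y*[z*z⁻¹]⇒x≈y (*-≉0 a≉0 u≉0) refl)) ⟩
      a * u - q * sq m ∎

    κ⁺-clear : ∀ m → κ⁺ m * (sq m * a * e) ≈ - ω m
    κ⁺-clear m = begin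
      - (a * t ⁻¹) * (factor s m * f₄ * f₅ * f₆) * (t * a * e)
        ≈⟨ solve 10 (λ a t′ x f₄ f₅ f₆ t b c d → :- (a :* t′) :* (x :* f₄ :* f₅ :* f₆) :* (t :* a :* (a :* b :* c :* d))
                                                 := :- ((t′ :* t) :* x :* (f₄ :* (a :* b)) :* (f₅ :* (a :* c)) :* (f₆ :* (a :* d))))
            refl a (t ⁻¹) (factor s m) f₄ f₅ f₆ t b c d ⟩
      - ((t ⁻¹ * t) * factor s m * (f₄ * (a * b)) * (f₅ * (a * c)) * (f₆ * (a * d)))
        ≈⟨ -‿cong (*-cong (*-cong (*-cong (*-cong (⁻¹-inverseˡ (sq≉0 m)) (+-congˡ (-‿cong (*-comm (q ^ m) s))))
            (α-clear m b b≉0)) (α-clear m c c≉0)) (α-clear m d d≉0)) ⟩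
      - (1# * (1# - t) * (a * b - q * t) * (a * c - q * t) * (a * d - q * t))
        ≈⟨ -‿cong (*-congʳ (*-congʳ (*-congʳ (*-identityˡ _)))) ⟩
      - ω m ∎
      where
      t  = sq m
      f₄ = factor α₄ m
      f₅ = factor α₅ m
      f₆ = factor α₆ m

    ν-clear : ∀ m → ν (sq m) * (a * q * q * sq m * sq m) ≈ ω m
    ν-clear m = x≈y*[z*z⁻¹]⇒x≈y K≉0 (solve 8 (λ t a b c d q K K′ →
        (t :- con (+ 1)) :* (q :* t :- a :* b) :* (q :* t :- a :* c) :* (q :* t :- a :* d) :* K′ :* K
        := (con (+ 1) :- t) :* (a :* b :- q :* t) :* (a :* c :- q :* t) :* (a :* d :- q :* t) :* (K :* K′))
      refl (sq m) a b c d q K (K ⁻¹))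
      where
      K = a * q * q * sq m * sq m
      K≉0 : K ≉ 0#
      K≉0 = *-≉0 (*-≉0 (*-≉0 (*-≉0 a≉0 q≉0) q≉0) (sq≉0 m)) (sq≉0 m)

    qβ₁-clear : ∀ m → qβ₁ m * (s * e) ≈ (s - q * sq m) * (e - q * q * sq m * s)
    qβ₁-clear m = trans (solve 5 (λ qᵐ q s e e′ →
        (con (+ 1) :- qᵐ :* q) :* (con (+ 1) :- qᵐ :* (q :* q :* s :* s :* e′)) :* (s :* e)
        := (s :- q :* (s :* qᵐ)) :* (e :- q :* q :* (s :* qᵐ) :* s)
           :+ (:- ((con (+ 1) :- qᵐ :* q) :* qᵐ :* q :* q :* s :* s :* s)) :* (e :* e′ :- con (+ 1)))
      refl (q ^ m) q s e (e ⁻¹)) (x+c*[y-z]≈x _ _ (⁻¹-inverseʳ e≉0))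

    κ⁺Δ≈νqβ₁ : ∀ m → κ⁺ m * (ev s - ev (q * sq m)) ≈ ν (sq m) * qβ₁ m
    κ⁺Δ≈νqβ₁ m = *-≈-by-cross-multiplication
      (*-≉0 (*-≉0 t≉0 a≉0) e≉0) (*-≉0 (*-≉0 q≉0 s≉0) qt≉0)
      (*-≉0 (*-≉0 (*-≉0 (*-≉0 a≉0 q≉0) q≉0) t≉0) t≉0) (*-≉0 s≉0 e≉0)
      (κ⁺-clear m) (ev-difference s (q * t) s≉0 qt≉0) (ν-clear m) (qβ₁-clear m)
      (solve 6 (λ ω s t q a e →
         :- ω :* ((s :- q :* t) :* (q :* s :* (q :* t) :- e)) :* (a :* q :* q :* t :* t :* (s :* e))
         := ω :* ((s :- q :* t) :* (e :- q :* q :* t :* s)) :* (t :* a :* e :* (q :* s :* (q :* t))))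
       refl (ω m) s t q a e)
      where
      t = sq m
      t≉0 = sq≉0 m
      qt≉0 = *-≉0 q≉0 t≉0

    C-recurrence : ∀ m → C (suc m) * (ev s - ev (sq (suc m))) ≈ C m * ν (sq m)
    C-recurrence m = begin
      C m * (κ⁺ m * qβ₁ m ⁻¹) * (ev s - ev (sq (suc m)))
        ≈⟨ *-congˡ (+-congˡ (-‿cong (ev-cong (*-≉0 q≉0 (sq≉0 m)) (q*sq≈sq m)))) ⟨
      C m * (κ⁺ m * qβ₁ m ⁻¹) * Δ
        ≈⟨ solve 4 (λ C k g′ Δ → C :* (k :* g′) :* Δ := C :* (k :* Δ) :* g′) refl (C m) (κ⁺ m) (qβ₁ m ⁻¹) Δ ⟩
      C m * (κ⁺ m * Δ) * qβ₁ m ⁻¹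
        ≈⟨ *-congʳ (*-congˡ (κ⁺Δ≈νqβ₁ m)) ⟩
      C m * (ν (sq m) * qβ₁ m) * qβ₁ m ⁻¹
        ≈⟨ x≈y*[z*z⁻¹]⇒x≈y (qβ₁≉0 m)
            (solve 4 (λ C n g g′ → C :* (n :* g) :* g′ := C :* n :* (g :* g′)) refl (C m) (ν (sq m)) (qβ₁ m) (qβ₁ m ⁻¹)) ⟩
      C m * ν (sq m) ∎
      where Δ = ev s - ev (q * sq m)

    β₁-nonresonant : ∀ k → q * q ^ suc k * s * s ≉ a * b * c * d
    β₁-nonresonant k q²⁺ᵏs²≈e = 1-qᵏβ₁≉0 k (begin
      1# - q ^ k * (q * q * s * s * e ⁻¹)
        ≈⟨ +-congˡ (-‿cong (solve 4 (λ q qᵏ s e′ → qᵏ :* (q :* q :* s :* s :* e′) := q :* (q :* qᵏ) :* s :* s :* e′)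
            refl q (q ^ k) s (e ⁻¹))) ⟩
      1# - q * q ^ suc k * s * s * e ⁻¹
        ≈⟨ +-congˡ (-‿cong (*-congʳ q²⁺ᵏs²≈e)) ⟩
      1# - e * e ⁻¹
        ≈⟨ +-congˡ (-‿cong (⁻¹-inverseʳ e≉0)) ⟩
      1# - 1#
        ≈⟨ -‿inverseʳ 1# ⟩
      0# ∎)

    inner rhs′ : Series
    inner = Defs.innerSeries F a b c d q s r
    rhs′  = Defs.rhs F a b c d q s r

    R-sum φ-sum : ℕ → Series
    R-sum N = Σₛ N (λ m → C m · shiftBy m (R (sq m)))
    φ-sum N = Σₛ N (λ m → C m · shiftBy m (φ (sq m)))

    inner-expansion : ∀ N j → j < N → inner j ≈ R-sum N j
    inner-expansion N j j<N = begin
      R s j * Σ< (suc j) (term j)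
        ≈⟨ *-distribˡ-Σ< (suc j) (R s j) (term j) ⟨
      Σ< (suc j) (λ m → R s j * term j m)
        ≈⟨ Σ<-cong-< (suc j) (λ m m<1+j → summand-at m (ℕ.≤-pred m<1+j)) ⟩
      Σ< (suc j) (λ m → C m * shiftBy m (R (sq m)) j)
        ≈⟨ Σ<-vanishing-tail _ j N j<N (λ m j<m → trans (*-congˡ (shiftBy-< m _ j j<m)) (zeroʳ _)) ⟨
      R-sum N j ∎
      where
      summand-at : ∀ m → m ≤ j → R s j * term j m ≈ C m * shiftBy m (R (sq m)) j
      summand-at m m≤j = ≡.subst (λ i → R s i * term i m ≈ C m * shiftBy m (R (sq m)) i) (ℕ.m+[n∸m]≡n m≤j)
        (trans (summand m (j ∸ m)) (*-congˡ (sym (shiftBy-+ m (R (sq m)) (j ∸ m)))))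

    rhs-expansion : ∀ n k → k ≤ n → rhs′ k ≈ φ-sum (suc n) k
    rhs-expansion n k k≤n = begin
      (P ⊛ inner) k
        ≈⟨ ⊛-cong-≤ P k (λ i i≤k → inner-expansion (suc n) i (s≤s (ℕ.≤-trans i≤k k≤n))) ⟩
      (P ⊛ R-sum (suc n)) k
        ≈⟨ ⊛-Σₛ P (suc n) (λ m → C m · shiftBy m (R (sq m))) k ⟩
      Σ< (suc n) (λ m → (P ⊛ (C m · shiftBy m (R (sq m)))) k)
        ≈⟨ Σ<-cong (suc n) (λ m → trans (⊛-·ʳ (C m) P (shiftBy m (R (sq m))) k) (*-congˡ (⊛-shiftByʳ P m (R (sq m)) k))) ⟩
      φ-sum (suc n) k ∎

    AW-basis : ∀ n m → AW s (shiftBy m (φ (sq m))) n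
                         ≈ ev (sq m) * shiftBy m (φ (sq m)) n + ν (sq m) * shiftBy (suc m) (φ (sq (suc m))) n
    AW-basis n m = begin
      AW s (shiftBy m (φ t)) n
        ≈⟨ AW-shiftBy s m (φ t) s≉0 n ⟩
      shiftBy m (AW t (φ t)) n
        ≈⟨ shiftBy-cong m (AtParameter.AW-φ t (sq≉0 m)) n ⟩
      shiftBy m (ev t · φ t ⊕ ν t · shift (φ (q * t))) n
        ≈⟨ shiftBy-⊕ m _ _ n ⟩
      shiftBy m (ev t · φ t) n + shiftBy m (ν t · shift (φ (q * t))) n
        ≈⟨ +-cong (shiftBy-· m (ev t) (φ t) n) (shiftBy-· m (ν t) _ n) ⟩
      ev t * shiftBy m (φ t) n + ν t * shiftBy m (shift (φ (q * t))) n
        ≈⟨ +-congˡ (*-congˡ (trans (shiftBy-shift m _ n) (shiftBy-cong (suc m) φ-next n))) ⟩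
      ev t * shiftBy m (φ t) n + ν t * shiftBy (suc m) (φ (sq (suc m))) n ∎
      where
      t = sq m
      φ-next : φ (q * t) ≋ φ (sq (suc m))
      φ-next = ⊛-congˡ (R-cong (*-≉0 q≉0 (sq≉0 m)) (q*sq≈sq m))

    rhs-eigen : IsEigen F a b c d q s rhs′
    rhs-eigen n = begin
      AW s rhs′ n
        ≈⟨ AW-cong-≤ s rhs′ (φ-sum N) n (rhs-expansion n) ⟩
      AW s (φ-sum N) n
        ≈⟨ AW-Σₛ s N (λ m → C m · shiftBy m (φ (sq m))) n ⟩
      Σ< N (λ m → AW s (C m · shiftBy m (φ (sq m))) n)
        ≈⟨ Σ<-cong N (λ m → trans (AW-· s (C m) (shiftBy m (φ (sq m))) n) (trans (*-congˡ (AW-basis n m)) (telescoping-term m))) ⟩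
      Σ< N (λ m → ev s * (C m * Y m) + (T (suc m) - T m))
        ≈⟨ trans (Σ<-distrib-+ N _ _) (+-cong (*-distribˡ-Σ< N (ev s) _) (Σ<-telescope N T)) ⟩
      ev s * φ-sum N n + (T N - T 0)
        ≈⟨ +-congˡ (+-cong T-N≈0 (-‿cong T-0≈0)) ⟩
      ev s * φ-sum N n + (0# - 0#)
        ≈⟨ trans (+-congˡ (-‿inverseʳ 0#)) (+-identityʳ _) ⟩
      ev s * φ-sum N n
        ≈⟨ *-congˡ (rhs-expansion n n ℕ.≤-refl) ⟨
      ev s * rhs′ n ∎
      where
      N = suc n
      Y T : ℕ → Carrier
      Y m = shiftBy m (φ (sq m)) n
      T m = C m * (ev s - ev (sq m)) * Y m

      telescoping-term : ∀ m → C m * (ev (sq m) * Y m + ν (sq m) * Y (suc m)) ≈ ev s * (C m * Y m) + (T (suc m) - T m)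
      telescoping-term m = begin
        C m * (ev (sq m) * Y m + ν (sq m) * Y (suc m))
          ≈⟨ solve 6 (λ C E ν y y′ e → C :* (E :* y :+ ν :* y′) := e :* (C :* y) :+ (C :* ν :* y′ :- C :* (e :- E) :* y))
              refl (C m) (ev (sq m)) (ν (sq m)) (Y m) (Y (suc m)) (ev s) ⟩
        ev s * (C m * Y m) + (C m * ν (sq m) * Y (suc m) - T m)
          ≈⟨ +-congˡ (+-congʳ (*-congʳ (C-recurrence m))) ⟨
        ev s * (C m * Y m) + (T (suc m) - T m) ∎

      T-N≈0 : T N ≈ 0#
      T-N≈0 = trans (*-congˡ (shiftBy-< N (φ (sq N)) n ℕ.≤-refl)) (zeroʳ _)

      T-0≈0 : T 0 ≈ 0#
      T-0≈0 = trans (*-congʳ (*-congˡ (x≈y⇒x-y≈0 (ev-cong s≉0 (sym (*-identityʳ s)))))) (trans (*-congʳ (zeroʳ _)) (zeroˡ _))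

    rhs-0 : rhs′ 0 ≈ 1#
    rhs-0 = begin
      (P ⊛ inner) 0                     ≈⟨ ⊛-zeroth P inner ⟩
      P 0 * (R s 0 * (0# + term 0 0))   ≈⟨ *-cong P-0 (*-cong (R-0 s) (trans (+-identityˡ _) (term-0 0))) ⟩
      1# * (1# * 1#)                    ≈⟨ trans (*-identityˡ _) (*-identityˡ _) ⟩
      1#                                ∎

theorem1p1 : ∀ {ℓ₁ ℓ₂} (F : Field ℓ₁ ℓ₂) → let open Field F in
    (a b c d q s r : Carrier) → r * r ≈ q → Generic F a b c d q s r →
    ((rhs F a b c d q s r 0 ≈ 1# × IsEigen F a b c d q s (rhs F a b c d q s r))
     × ((f : ℕ → Carrier) → f 0 ≈ 1# → IsEigen F a b c d q s f →
        ∀ n → f n ≈ rhs F a b c d q s r n))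
theorem1p1 F a b c d q s r r*r≈q
           (q≉0 , s≉0 , a≉0 , b≉0 , c≉0 , d≉0 , qᵏ⁺¹≉1 , 1-qᵏβ₁≉0 , 1-qᵏβ₂≉0 , 1-qᵏβ₃≉0 , 1-qᵏβ₄≉0 , 1-qᵏβ₅≉0) =
  (rhs-0 , rhs-eigen) ,
  λ f f₀≈1 f-eigen → eigenvector-unique f rhs′ s≉0 qᵏ⁺¹≉1 β₁-nonresonant f-eigen rhs-eigen (trans f₀≈1 (sym rhs-0))
  where
  open SixPhiFiveExpansion F
  open Expansion a b c d q s r r*r≈q q≉0 s≉0 a≉0 b≉0 c≉0 d≉0 qᵏ⁺¹≉1 1-qᵏβ₁≉0 1-qᵏβ₂≉0 1-qᵏβ₃≉0 1-qᵏβ₄≉0 1-qᵏβ₅≉0
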